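{- For $s,q\in\mathbb{Z}_{>0}$ and $t,p\in\mathbb{Z}_{\ge0}$, the base polytope $B(M(\mathcal{C}_{s,t,p,q}))$ is unimodularly equivalent to the order polytope $\mathcal{O}_{W_{s,t,p,q}}$.
   Context: $M(G)$ is the graphic matroid (bases = spanning forests), $B(M)=\mathrm{conv}\{\chi_B: B\text{ basis}\}$. $\mathcal{C}_{s,t,p,q}$ is the multigraph with vertices $v_1,v_2,v_3,u_1,\dots,u_p,w_1,\dots,w_q$, having $s+1$ parallel edges between $v_1,v_2$, $t+1$ parallel edges between $v_2,v_3$, the path $v_1,u_1,\dots,u_p,v_3$ and the path $v_2,w_1,\dots,w_q,v_3$. $W_{s,t,p,q}$ is the poset on $\{\alpha_1,\dots,\alpha_s,\beta_1,\dots,\beta_p,\gamma_1,\dots,\gamma_t,\delta_1,\dots,\delta_q,\mu_1,\mu_2,\mu_3\}$ whose order is generated by the chains $\mu_1\prec\alpha_1\prec\cdots\prec\alpha_s$, $\mu_1\prec\beta_1\prec\cdots\prec\beta_p\prec\mu_2$, $\mu_3\prec\gamma_1\prec\cdots\prec\gamma_t\prec\mu_2$, $\mu_3\prec\delta_1\prec\cdots\prec\delta_q$. For a poset $\Pi$, the order polytope is $\mathcal{O}_\Pi=\{x\in\mathbb{R}^\Pi: x(a)\ge x(b)\text{ whenever }a\preceq b,\ 0\le x(a)\le1\}$. Unimodular equivalence of lattice polytopes in possibly different ambient spaces means an affine isomorphism of affine hulls mapping lattice points bijectively onto lattice points and one polytope onto the other.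
   Formalization: The polytopes $B(M(\mathcal{C}_{s,t,p,q}))$ and $\mathcal{O}_{W_{s,t,p,q}}$ consist of their points with rational coordinates, and their affine hulls and the affine isomorphism between them are taken over ℚ. -}

module Defs where

open import Data.Nat as ℕ using (ℕ; zero; suc)
open import Data.Fin as Fin using (Fin; zero; suc; inject₁; splitAt)
open import Data.Bool using (Bool; true; false; if_then_else_; _∧_; not; _∨_)
open import Data.Integer using (ℤ)
open import Data.Rational using (ℚ; 0ℚ; 1ℚ; _≤_; _+_; _*_; _/_)
open import Data.List using (List; []; _∷_)
open import Data.List.Relation.Unary.All using (All)
open import Data.Product using (Σ; _×_; _,_; proj₁; proj₂; ∃)
open import Data.Sum using (_⊎_; inj₁; inj₂)
open import Relation.Binary.PropositionalEquality using (_≡_)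
open import Relation.Nullary using (¬_; does)
open import Relation.Binary.Construct.Closure.ReflexiveTransitive using (Star)

-- A finite multigraph: vertex type V, edges Fin m, each edge with its
-- (unordered) pair of endpoints.
record Multigraph : Set₁ where
  field
    V    : Set
    m    : ℕ
    ends : Fin m → V × V

EdgeSet : ℕ → Set
EdgeSet m = Fin m → Bool

module _ (G : Multigraph) where
  open Multigraph G

  data Conn (F : EdgeSet m) : V → V → Set where
    here : ∀ {x} → Conn F x x
    fwd  : ∀ {x y z} (e : Fin m) → F e ≡ true → ends e ≡ (x , y) → Conn F y z → Conn F x z
    bwd  : ∀ {x y z} (e : Fin m) → F e ≡ true → ends e ≡ (y , x) → Conn F y z → Conn F x z

  remove : EdgeSet m → Fin m → EdgeSet m
  remove F e f = F f ∧ not (does (f Fin.≟ e))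

  insert : EdgeSet m → Fin m → EdgeSet m
  insert F e f = F f ∨ does (f Fin.≟ e)

  -- F is acyclic (a forest): no edge of F lies on a cycle of F, i.e. the
  -- endpoints of every edge of F are disconnected after removing that edge.
  Acyclic : EdgeSet m → Set
  Acyclic F = ∀ e → F e ≡ true → ¬ Conn (remove F e) (proj₁ (ends e)) (proj₂ (ends e))

  IsBasis : EdgeSet m → Set
  IsBasis F = Acyclic F × (∀ e → F e ≡ false → ¬ Acyclic (insert F e))

Point : ℕ → Set
Point d = Fin d → ℚ

Region : ℕ → Set₁
Region d = Point d → Set

χ : ∀ {m} → EdgeSet m → Point m
χ F e = if F e then 1ℚ else 0ℚ

weightSum : ∀ {d} → List (ℚ × Point d) → ℚ
weightSum []              = 0ℚ
weightSum ((λ' , _) ∷ xs) = λ' + weightSum xs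

combo : ∀ {d} → List (ℚ × Point d) → Point d
combo []              i = 0ℚ
combo ((λ' , y) ∷ xs) i = λ' * y i + combo xs i

_≈ₚ_ : ∀ {d} → Point d → Point d → Set
x ≈ₚ y = ∀ i → x i ≡ y i

ConvHull : ∀ {d} → Region d → Region d
ConvHull S x = Σ (List (ℚ × Point _)) λ L →
  All (λ p → S (proj₂ p)) L × All (λ p → 0ℚ ≤ proj₁ p) L ×
  weightSum L ≡ 1ℚ × x ≈ₚ combo L

AffHull : ∀ {d} → Region d → Region d
AffHull S x = Σ (List (ℚ × Point _)) λ L →
  All (λ p → S (proj₂ p)) L × weightSum L ≡ 1ℚ × x ≈ₚ combo L

Integral : ∀ {d} → Point d → Set
Integral x = ∀ i → ∃ λ (z : ℤ) → x i ≡ z / 1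

BasePolytope : (G : Multigraph) → Region (Multigraph.m G)
BasePolytope G = ConvHull λ y → Σ (EdgeSet (Multigraph.m G)) λ B → IsBasis G B × y ≈ₚ χ B

sumFin : ∀ n → (Fin n → ℚ) → ℚ
sumFin zero    f = 0ℚ
sumFin (suc n) f = f zero + sumFin n (λ i → f (suc i))

record AffineMap (m n : ℕ) : Set where
  field
    A : Fin n → Fin m → ℚ
    b : Fin n → ℚ
  apply : Point m → Point n
  apply x j = sumFin m (λ i → A j i * x i) + b j

_⇔'_ : Set → Set → Set
A ⇔' B = (A → B) × (B → A)

-- P ⊆ ℚ^m and Q ⊆ ℚ^n are unimodularly equivalent: there is an affine
-- isomorphism aff(P) → aff(Q) (restriction of the affine map f, with
-- inverse the restriction of g) mapping the lattice points of aff(P)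
-- bijectively onto those of aff(Q) and P onto Q.
UnimodEquiv : ∀ {m n} → Region m → Region n → Set
UnimodEquiv {m} {n} P Q = Σ (AffineMap m n) λ f → Σ (AffineMap n m) λ g →
  let F = AffineMap.apply f ; G = AffineMap.apply g in
  (∀ x → AffHull P x → AffHull Q (F x)) ×
  (∀ y → AffHull Q y → AffHull P (G y)) ×
  (∀ x → AffHull P x → G (F x) ≈ₚ x) ×
  (∀ y → AffHull Q y → F (G y) ≈ₚ y) ×
  (∀ x → AffHull P x → Integral x ⇔' Integral (F x)) ×
  (∀ x → AffHull P x → P x ⇔' Q (F x))

record GenPoset : Set₁ where
  field
    n   : ℕ
    gen : Fin n → Fin n → Set

  _≼_ : Fin n → Fin n → Set
  _≼_ = Star gen

OrderPolytope : (Π : GenPoset) → Region (GenPoset.n Π)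
OrderPolytope Π x =
  (∀ a b → a ≼ b → x b ≤ x a) × (∀ a → 0ℚ ≤ x a × x a ≤ 1ℚ)
  where open GenPoset Π

-- Sequences: path a, f 0, …, f (k-1), b  and chain a, f 0, …, f (k-1)

pathSeq : ∀ {A : Set} {k} → A → (Fin k → A) → A → Fin (suc (suc k)) → A
pathSeq         a f b zero          = a
pathSeq {k = zero}  a f b (suc zero)    = b
pathSeq {k = suc k} a f b (suc i)       = pathSeq (f zero) (λ j → f (suc j)) b i

chainSeq : ∀ {A : Set} {k} → A → (Fin k → A) → Fin (suc k) → A
chainSeq a f zero    = a
chainSeq a f (suc i) = f i

data Vtx (p q : ℕ) : Set where
  v₁ v₂ v₃ : Vtx p q
  u        : Fin p → Vtx p q
  w        : Fin q → Vtx p q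

-- edges: s+1 parallel v₁v₂, t+1 parallel v₂v₃, p+1 edges of the path
-- v₁ u₁ … u_p v₃, q+1 edges of the path v₂ w₁ … w_q v₃
nEdges : (s t p q : ℕ) → ℕ
nEdges s t p q = suc s ℕ.+ (suc t ℕ.+ (suc p ℕ.+ suc q))

endsC : (s t p q : ℕ) → Fin (nEdges s t p q) → Vtx p q × Vtx p q
endsC s t p q e with splitAt (suc s) e
... | inj₁ _ = v₁ , v₂
... | inj₂ e₁ with splitAt (suc t) e₁
...   | inj₁ _ = v₂ , v₃
...   | inj₂ e₂ with splitAt (suc p) e₂
...     | inj₁ i = pathSeq v₁ u v₃ (inject₁ i) , pathSeq v₁ u v₃ (suc i)
...     | inj₂ i = pathSeq v₂ w v₃ (inject₁ i) , pathSeq v₂ w v₃ (suc i)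

C : (s t p q : ℕ) → Multigraph
C s t p q = record { V = Vtx p q ; m = nEdges s t p q ; ends = endsC s t p q }

data WElt (s t p q : ℕ) : Set where
  μ₁ μ₂ μ₃ : WElt s t p q
  α : Fin s → WElt s t p q
  β : Fin p → WElt s t p q
  γ : Fin t → WElt s t p q
  δ : Fin q → WElt s t p q

nW : (s t p q : ℕ) → ℕ
nW s t p q = 3 ℕ.+ (s ℕ.+ (p ℕ.+ (t ℕ.+ q)))

decodeW : ∀ s t p q → Fin (nW s t p q) → WElt s t p q
decodeW s t p q x with splitAt 3 x
... | inj₁ zero = μ₁
... | inj₁ (suc zero) = μ₂
... | inj₁ (suc (suc zero)) = μ₃
... | inj₂ x₁ with splitAt s x₁
...   | inj₁ i = α i
...   | inj₂ x₂ with splitAt p x₂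
...     | inj₁ i = β i
...     | inj₂ x₃ with splitAt t x₃
...       | inj₁ i = γ i
...       | inj₂ i = δ i

-- generating chains: μ₁ ≺ α₁ ≺ … ≺ α_s ; μ₁ ≺ β₁ ≺ … ≺ β_p ≺ μ₂ ;
-- μ₃ ≺ γ₁ ≺ … ≺ γ_t ≺ μ₂ ; μ₃ ≺ δ₁ ≺ … ≺ δ_q
data Gen {s t p q : ℕ} : WElt s t p q → WElt s t p q → Set where
  chα : (i : Fin s)       → Gen (chainSeq μ₁ α (inject₁ i)) (chainSeq μ₁ α (suc i))
  chβ : (i : Fin (suc p)) → Gen (pathSeq μ₁ β μ₂ (inject₁ i)) (pathSeq μ₁ β μ₂ (suc i))
  chγ : (i : Fin (suc t)) → Gen (pathSeq μ₃ γ μ₂ (inject₁ i)) (pathSeq μ₃ γ μ₂ (suc i))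
  chδ : (i : Fin q)       → Gen (chainSeq μ₃ δ (inject₁ i)) (chainSeq μ₃ δ (suc i))

W : (s t p q : ℕ) → GenPoset
W s t p q = record { n = nW s t p q ; gen = λ a b → Gen (decodeW s t p q a) (decodeW s t p q b) }

{-# OPTIONS --safe #-}
module Submission where

-- The four chains of W,  μ₁ α₁ … α_s,  μ₁ β₁ … β_p μ₂,  μ₃ γ₁ … γ_t μ₂  and  μ₃ δ₁ … δ_q,
-- correspond to the four classes of edges of C: the v₁v₂ edges, the path through the u's, the
-- v₂v₃ edges and the path through the w's. The affine map toEdges sends y ∈ ℚ^W to the differences
-- of consecutive coordinates along the chains (one minus the difference on the two paths), and the
-- telescoping sums toW invert it; both have integer coefficients. An order ideal is determined by how
-- far it reaches along each chain, so toEdges sends its indicator to the indicator of an edge set with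
-- at most one v₁v₂ edge, at most one v₂v₃ edge and at most one edge missing from each path. Sorting
-- the spanning trees of C into five shapes shows that these edge sets are exactly the spanning trees.
-- As the order polytope is the convex hull of the indicators of order ideals, toEdges maps O_W onto
-- B(M(C)), and toW is its inverse on the affine hull of B(M(C)).

open import Data.Nat using (ℕ)
open import Defs using (EdgeSet; nEdges; IsBasis; C)

module Preliminaries where

  open import Defs using (pathSeq; chainSeq)
  open import Data.Nat as ℕ using (ℕ; zero; suc; z≤n; s≤s; _<_; _<ᵇ_; _≡ᵇ_)
  open import Data.Nat.Properties using (<⇒<ᵇ; <ᵇ⇒<; <-trans; n<1+n; ≤∧≢⇒<; ≮⇒≥; <⇒≱; ≤-pred; ≡ᵇ⇒≡; ≡⇒≡ᵇ)
  open import Data.Fin using (Fin; zero; suc; inject₁; fromℕ; toℕ)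
  open import Data.Bool using (true; false; T; if_then_else_)
  open import Data.Unit using (tt)
  open import Data.Maybe as Maybe using (Maybe; just; nothing)
  open import Data.Sum using (_⊎_; inj₁; inj₂)
  open import Data.Product using (Σ; _×_; _,_)
  open import Relation.Binary.PropositionalEquality
  open import Relation.Nullary using (¬_; yes; no; contradiction)

  true≢false : true ≢ false
  true≢false ()

  -- Opaque, so that unification solves for the arguments of if< instead of unfolding it.
  opaque
    if< : {A : Set} → ℕ → ℕ → A → A → A
    if< m n a b = if m <ᵇ n then a else b

    if<-yes : {A : Set} {a b : A} {m n : ℕ} → m < n → if< m n a b ≡ a
    if<-yes {m = m} {n} m<n with m <ᵇ n | <⇒<ᵇ m<n
    ... | true | _ = refl

    if<-no : {A : Set} {a b : A} {m n : ℕ} → ¬ m < n → if< m n a b ≡ b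
    if<-no {m = m} {n} m≮n with m <ᵇ n in eq
    ... | true  = contradiction (<ᵇ⇒< m n (subst T (sym eq) _)) m≮n
    ... | false = refl

    if<-suc : {A : Set} {a b : A} {m n : ℕ} → if< (suc m) (suc n) a b ≡ if< m n a b
    if<-suc = refl

    if<-just : {A : Set} {a b : A} {m n : ℕ} → if< m n (just a) (just b) ≢ nothing
    if<-just {m = m} {n} eq with m <ᵇ n
    if<-just () | true
    if<-just () | false

  module _ {A : Set} {a b : A} where

    if<-step : ∀ {k m} → m ≢ k → if< k m a b ≡ if< k (suc m) a b
    if<-step {k} {m} m≢k with k ℕ.<? m
    ... | yes k<m = trans (if<-yes k<m) (sym (if<-yes (<-trans k<m (n<1+n m))))
    ... | no k≮m  = trans (if<-no k≮m) (sym (if<-no (λ k<1+m → <⇒≱ (≤∧≢⇒< (≮⇒≥ k≮m) m≢k) (≤-pred k<1+m))))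

  module _ {A : Set} where

    pathSeq-inner : ∀ {k} (a : A) (f : Fin k → A) b (i : Fin k) → pathSeq a f b (suc (inject₁ i)) ≡ f i
    pathSeq-inner {suc k} a f b zero    = refl
    pathSeq-inner {suc k} a f b (suc i) = pathSeq-inner (f zero) (λ j → f (suc j)) b i

    pathSeq-last : ∀ {k} (a : A) (f : Fin k → A) b → pathSeq a f b (fromℕ (suc k)) ≡ b
    pathSeq-last {zero}  a f b = refl
    pathSeq-last {suc k} a f b = pathSeq-last (f zero) (λ j → f (suc j)) b

    pathSeq-along : ∀ {X : Set} {k} (a : A) (f : Fin k → A) b (h : A → X) (g : ℕ → X) →
      h a ≡ g 0 → (∀ i → h (f i) ≡ g (suc (toℕ i))) → h b ≡ g (suc k) →
      ∀ j → h (pathSeq a f b j) ≡ g (toℕ j)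
    pathSeq-along {k = zero}  a f b h g ha hf hb zero       = ha
    pathSeq-along {k = zero}  a f b h g ha hf hb (suc zero) = hb
    pathSeq-along {k = suc k} a f b h g ha hf hb zero       = ha
    pathSeq-along {k = suc k} a f b h g ha hf hb (suc j)    =
      pathSeq-along (f zero) (λ i → f (suc i)) b h (λ n → g (suc n)) (hf zero) (λ i → hf (suc i)) hb j

    chainSeq-along : ∀ {X : Set} {k} (a : A) (f : Fin k → A) (h : A → X) (g : ℕ → X) →
      h a ≡ g 0 → (∀ i → h (f i) ≡ g (suc (toℕ i))) → ∀ j → h (chainSeq a f j) ≡ g (toℕ j)
    chainSeq-along a f h g ha hf zero    = ha
    chainSeq-along a f h g ha hf (suc j) = hf j

  ≡ᵇ-true : ∀ {m n} → m ≡ n → (m ≡ᵇ n) ≡ true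
  ≡ᵇ-true {m} refl with m ≡ᵇ m | ≡⇒≡ᵇ m m refl
  ... | true | _ = refl

  ≡ᵇ-false : ∀ {m n} → m ≢ n → (m ≡ᵇ n) ≡ false
  ≡ᵇ-false {m} {n} m≢n with m ≡ᵇ n in eq
  ... | true  = contradiction (≡ᵇ⇒≡ m n (subst T (sym eq) tt)) m≢n
  ... | false = refl

  fin? : (k n : ℕ) → Maybe (Fin k)
  fin? zero    n       = nothing
  fin? (suc k) zero    = just zero
  fin? (suc k) (suc n) = Maybe.map suc (fin? k n)

  fin?-toℕ : ∀ {k} (i : Fin k) → fin? k (toℕ i) ≡ just i
  fin?-toℕ {suc k} zero    = refl
  fin?-toℕ {suc k} (suc i) = cong (Maybe.map suc) (fin?-toℕ i)

  fin?-≥ : ∀ k n → k ℕ.≤ n → fin? k n ≡ nothing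
  fin?-≥ zero    n       _         = refl
  fin?-≥ (suc k) (suc n) (s≤s k≤n) = cong (Maybe.map suc) (fin?-≥ k n k≤n)

  fin?-view : ∀ k n → (Σ (Fin k) λ i → fin? k n ≡ just i × toℕ i ≡ n) ⊎ (fin? k n ≡ nothing × k ℕ.≤ n)
  fin?-view zero    n       = inj₂ (refl , z≤n)
  fin?-view (suc k) zero    = inj₁ (zero , refl , refl)
  fin?-view (suc k) (suc n) with fin?-view k n
  ... | inj₁ (i , eq , i≡n) = inj₁ (suc i , cong (Maybe.map suc) eq , cong suc i≡n)
  ... | inj₂ (eq , k≤n)     = inj₂ (cong (Maybe.map suc) eq , s≤s k≤n)

module FiniteSums where

  open import Defs using (sumFin)
  open Preliminaries
  open import Data.Nat as ℕ using (ℕ; zero; suc; z≤n; s≤s)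
  open import Data.Nat.Properties using (n≮0)
  open import Data.Fin as Fin using (Fin; zero; suc; toℕ; _↑ˡ_; _↑ʳ_)
  open import Data.Bool using (if_then_else_)
  open import Data.Rational using (ℚ; 0ℚ; 1ℚ; _+_; _*_; _-_; -_)
  open import Data.Rational.Properties
  open import Data.Rational.Solver
  open import Relation.Binary.PropositionalEquality
  open import Relation.Nullary using (does; yes; no)

  open +-*-Solver using (solve; _:=_; _:+_; _:-_)

  sumFin-cong : ∀ n {f g : Fin n → ℚ} → (∀ i → f i ≡ g i) → sumFin n f ≡ sumFin n g
  sumFin-cong zero    f≡g = refl
  sumFin-cong (suc n) f≡g = cong₂ _+_ (f≡g zero) (sumFin-cong n (λ i → f≡g (suc i)))

  sumFin-zero : ∀ n → sumFin n (λ _ → 0ℚ) ≡ 0ℚ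
  sumFin-zero zero    = refl
  sumFin-zero (suc n) = cong (0ℚ +_) (sumFin-zero n)

  sumFin-+ : ∀ n (f g : Fin n → ℚ) → sumFin n (λ i → f i + g i) ≡ sumFin n f + sumFin n g
  sumFin-+ zero    f g = refl
  sumFin-+ (suc n) f g = begin
    (f zero + g zero) + sumFin n (λ i → f (suc i) + g (suc i))
      ≡⟨ cong ((f zero + g zero) +_) (sumFin-+ n (λ i → f (suc i)) (λ i → g (suc i))) ⟩
    (f zero + g zero) + (F + G)
      ≡⟨ solve 4 (λ a b c d → (a :+ b) :+ (c :+ d) := (a :+ c) :+ (b :+ d)) refl (f zero) (g zero) F G ⟩
    (f zero + F) + (g zero + G) ∎
    where
    open ≡-Reasoning
    F = sumFin n (λ i → f (suc i))
    G = sumFin n (λ i → g (suc i))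

  sumFin-*ˡ : ∀ n c (f : Fin n → ℚ) → sumFin n (λ i → c * f i) ≡ c * sumFin n f
  sumFin-*ˡ zero    c f = sym (*-zeroʳ c)
  sumFin-*ˡ (suc n) c f =
    trans (cong (c * f zero +_) (sumFin-*ˡ n c (λ i → f (suc i)))) (sym (*-distribˡ-+ c (f zero) _))

  sumFin-neg : ∀ n (f : Fin n → ℚ) → sumFin n (λ i → - f i) ≡ - sumFin n f
  sumFin-neg zero    f = refl
  sumFin-neg (suc n) f =
    trans (cong (- f zero +_) (sumFin-neg n (λ i → f (suc i)))) (sym (neg-distrib-+ (f zero) _))

  sumFin-splitAt : ∀ m n (f : Fin (m ℕ.+ n) → ℚ) →
    sumFin (m ℕ.+ n) f ≡ sumFin m (λ i → f (i ↑ˡ n)) + sumFin n (λ i → f (m ↑ʳ i))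
  sumFin-splitAt zero    n f = sym (+-identityˡ _)
  sumFin-splitAt (suc m) n f =
    trans (cong (f zero +_) (sumFin-splitAt m n (λ i → f (suc i)))) (sym (+-assoc (f zero) _ _))

  indicator : ∀ {n} → Fin n → Fin n → ℚ
  indicator k i = if does (i Fin.≟ k) then 1ℚ else 0ℚ

  sumFin-indicator : ∀ n (k : Fin n) (f : Fin n → ℚ) → sumFin n (λ i → indicator k i * f i) ≡ f k
  sumFin-indicator (suc n) zero f = begin
    1ℚ * f zero + sumFin n (λ i → 0ℚ * f (suc i))
      ≡⟨ cong₂ _+_ (*-identityˡ (f zero)) (trans (sumFin-cong n (λ i → *-zeroˡ (f (suc i)))) (sumFin-zero n)) ⟩
    f zero + 0ℚ
      ≡⟨ +-identityʳ (f zero) ⟩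
    f zero ∎
    where
    open ≡-Reasoning
  sumFin-indicator (suc n) (suc k) f = begin
    0ℚ * f zero + sumFin n (λ i → indicator (suc k) (suc i) * f (suc i))
      ≡⟨ cong₂ _+_ (*-zeroˡ (f zero)) (sumFin-cong n (λ i → cong (_* f (suc i)) (indicator-suc i))) ⟩
    0ℚ + sumFin n (λ i → indicator k i * f (suc i))
      ≡⟨ +-identityˡ _ ⟩
    sumFin n (λ i → indicator k i * f (suc i))
      ≡⟨ sumFin-indicator n k (λ i → f (suc i)) ⟩
    f (suc k) ∎
    where
    open ≡-Reasoning
    indicator-suc : ∀ i → indicator (suc k) (suc i) ≡ indicator k i
    indicator-suc i with i Fin.≟ k
    ... | yes _ = refl
    ... | no _  = refl

  χ< : ℕ → ℕ → ℚ
  χ< m n = if< m n 1ℚ 0ℚ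

  Δ : (ℕ → ℚ) → ℕ → ℚ
  Δ g i = g i - g (suc i)

  sumFin-telescope : ∀ n g → sumFin n (λ i → Δ g (toℕ i)) ≡ g 0 - g n
  sumFin-telescope zero    g = sym (+-inverseʳ (g 0))
  sumFin-telescope (suc n) g = begin
    Δ g 0 + sumFin n (λ i → Δ g (suc (toℕ i)))
      ≡⟨ cong (Δ g 0 +_) (sumFin-telescope n (λ m → g (suc m))) ⟩
    (g 0 - g 1) + (g 1 - g (suc n))
      ≡⟨ solve 3 (λ a b c → (a :- b) :+ (b :- c) := a :- c) refl (g 0) (g 1) (g (suc n)) ⟩
    g 0 - g (suc n) ∎
    where
    open ≡-Reasoning

  sumFin-telescope-above : ∀ n k g → k ℕ.< n →
    sumFin n (λ i → χ< k (toℕ i) * Δ g (toℕ i)) ≡ g (suc k) - g n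
  sumFin-telescope-above (suc n) zero g _ = begin
    χ< 0 0 * Δ g 0 + sumFin n (λ i → χ< 0 (suc (toℕ i)) * Δ g (suc (toℕ i)))
      ≡⟨ cong₂ _+_ (trans (cong (_* Δ g 0) (if<-no (λ ()))) (*-zeroˡ (Δ g 0)))
                   (sumFin-cong n (λ i → trans (cong (_* Δ g (suc (toℕ i))) (if<-yes (s≤s z≤n))) (*-identityˡ _))) ⟩
    0ℚ + sumFin n (λ i → Δ g (suc (toℕ i)))
      ≡⟨ +-identityˡ _ ⟩
    sumFin n (λ i → Δ g (suc (toℕ i)))
      ≡⟨ sumFin-telescope n (λ m → g (suc m)) ⟩
    g 1 - g (suc n) ∎
    where
    open ≡-Reasoning
  sumFin-telescope-above (suc n) (suc k) g (s≤s k<n) = begin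
    χ< (suc k) 0 * Δ g 0 + sumFin n (λ i → χ< (suc k) (suc (toℕ i)) * Δ g (suc (toℕ i)))
      ≡⟨ cong₂ _+_ (trans (cong (_* Δ g 0) (if<-no (λ ()))) (*-zeroˡ (Δ g 0)))
                   (sumFin-cong n (λ i → cong (_* Δ g (suc (toℕ i))) if<-suc)) ⟩
    0ℚ + sumFin n (λ i → χ< k (toℕ i) * Δ g (suc (toℕ i)))
      ≡⟨ +-identityˡ _ ⟩
    sumFin n (λ i → χ< k (toℕ i) * Δ g (suc (toℕ i)))
      ≡⟨ sumFin-telescope-above n k (λ m → g (suc m)) k<n ⟩
    g (suc (suc k)) - g (suc n) ∎
    where
    open ≡-Reasoning

  sumFin-telescope-below : ∀ n k g → k ℕ.≤ n →
    sumFin n (λ i → χ< (toℕ i) k * Δ g (toℕ i)) ≡ g 0 - g k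
  sumFin-telescope-below n zero g _ = begin
    sumFin n (λ i → χ< (toℕ i) 0 * Δ g (toℕ i))
      ≡⟨ sumFin-cong n (λ i → trans (cong (_* Δ g (toℕ i)) (if<-no n≮0)) (*-zeroˡ (Δ g (toℕ i)))) ⟩
    sumFin n (λ _ → 0ℚ)
      ≡⟨ sumFin-zero n ⟩
    0ℚ
      ≡⟨ sym (+-inverseʳ (g 0)) ⟩
    g 0 - g 0 ∎
    where
    open ≡-Reasoning
  sumFin-telescope-below (suc n) (suc k) g (s≤s k≤n) = begin
    χ< 0 (suc k) * Δ g 0 + sumFin n (λ i → χ< (suc (toℕ i)) (suc k) * Δ g (suc (toℕ i)))
      ≡⟨ cong₂ _+_ (trans (cong (_* Δ g 0) (if<-yes (s≤s z≤n))) (*-identityˡ (Δ g 0)))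
                   (sumFin-cong n (λ i → cong (_* Δ g (suc (toℕ i))) if<-suc)) ⟩
    Δ g 0 + sumFin n (λ i → χ< (toℕ i) k * Δ g (suc (toℕ i)))
      ≡⟨ cong (Δ g 0 +_) (sumFin-telescope-below n k (λ m → g (suc m)) k≤n) ⟩
    (g 0 - g 1) + (g 1 - g (suc k))
      ≡⟨ solve 3 (λ a b c → (a :- b) :+ (b :- c) := a :- c) refl (g 0) (g 1) (g (suc k)) ⟩
    g 0 - g (suc k) ∎
    where
    open ≡-Reasoning

  sumFin-*-zeroˡ : ∀ n (g : Fin n → ℚ) → sumFin n (λ i → 0ℚ * g i) ≡ 0ℚ
  sumFin-*-zeroˡ n g = trans (sumFin-cong n (λ i → *-zeroˡ (g i))) (sumFin-zero n)

  sumFin-*-telescope : ∀ n c g → sumFin n (λ i → c * Δ g (toℕ i)) ≡ c * (g 0 - g n)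
  sumFin-*-telescope n c g = trans (sumFin-*ˡ n c _) (cong (c *_) (sumFin-telescope n g))

module AffineHulls where

  open import Defs using (Point; Region; combo; weightSum; _≈ₚ_; AffineMap; module AffineMap; sumFin; ConvHull; AffHull)
  open FiniteSums
  open import Data.Nat using (ℕ)
  open import Data.Rational using (ℚ; 0ℚ; 1ℚ; _+_; _*_; _≤_)
  open import Data.Rational.Properties using (*-zeroʳ; *-zeroˡ; *-identityˡ; +-identityˡ)
  open import Data.Rational.Solver
  open import Data.List using (List; []; _∷_)
  import Data.List as List
  open import Data.List.Relation.Unary.All as All using (All; []; _∷_)
  open import Data.Product as Product using (Σ; _×_; _,_; proj₁; proj₂)
  open import Function using (_∘_)
  open import Relation.Binary.PropositionalEquality
  open import Relation.Binary.Bundles using (Setoid)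
  import Relation.Binary.Reasoning.Setoid as SetoidReasoning
  open import Level using (0ℓ)

  open +-*-Solver using (solve; _:=_; _:+_; _:*_)

  private
    variable
      d e : ℕ

  ≈ₚ-refl : {x : Point d} → x ≈ₚ x
  ≈ₚ-refl i = refl

  ≈ₚ-sym : {x y : Point d} → x ≈ₚ y → y ≈ₚ x
  ≈ₚ-sym x≈y i = sym (x≈y i)

  ≈ₚ-trans : {x y z : Point d} → x ≈ₚ y → y ≈ₚ z → x ≈ₚ z
  ≈ₚ-trans x≈y y≈z i = trans (x≈y i) (y≈z i)

  ≈ₚ-setoid : ℕ → Setoid 0ℓ 0ℓ
  ≈ₚ-setoid d = record
    { Carrier       = Point d
    ; _≈_           = _≈ₚ_
    ; isEquivalence = record { refl = ≈ₚ-refl ; sym = ≈ₚ-sym ; trans = ≈ₚ-trans }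
    }

  module ≈ₚ-Reasoning {d : ℕ} = SetoidReasoning (≈ₚ-setoid d)

  RespectsPointwise : Region d → Set
  RespectsPointwise S = ∀ {x y} → x ≈ₚ y → S x → S y

  Nonnegative : List (ℚ × Point d) → Set
  Nonnegative = All (λ p → 0ℚ ≤ proj₁ p)

  mapPoints : (Point d → Point e) → List (ℚ × Point d) → List (ℚ × Point e)
  mapPoints g = List.map (Product.map₂ g)

  weightSum-mapPoints : (g : Point d → Point e) (L : List (ℚ × Point d)) → weightSum (mapPoints g L) ≡ weightSum L
  weightSum-mapPoints g []            = refl
  weightSum-mapPoints g ((w , _) ∷ L) = cong (w +_) (weightSum-mapPoints g L)

  All-mapPoints : {S : Region d} {T : Region e} {g : Point d → Point e} → (∀ x → S x → T (g x)) →
    ∀ L → All (S ∘ proj₂) L → All (T ∘ proj₂) (mapPoints g L)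
  All-mapPoints g-maps []            []         = []
  All-mapPoints g-maps ((_ , x) ∷ L) (Sx ∷ SL) = g-maps x Sx ∷ All-mapPoints g-maps L SL

  Nonnegative-mapPoints : {g : Point d → Point e} (L : List (ℚ × Point d)) →
    Nonnegative L → Nonnegative (mapPoints g L)
  Nonnegative-mapPoints []      []          = []
  Nonnegative-mapPoints (_ ∷ L) (0≤w ∷ L≥0) = 0≤w ∷ Nonnegative-mapPoints L L≥0

  module _ (f : AffineMap d e) where
    open AffineMap f

    linearPart : Point d → Point e
    linearPart x j = sumFin d (λ i → A j i * x i)

    apply-cong : {x y : Point d} → x ≈ₚ y → apply x ≈ₚ apply y
    apply-cong x≈y j = cong (_+ b j) (sumFin-cong d (λ i → cong (A j i *_) (x≈y i)))

    linearPart-combo : ∀ L j → linearPart (combo L) j ≡ combo (mapPoints linearPart L) j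
    linearPart-combo [] j = trans (sumFin-cong d (λ i → *-zeroʳ (A j i))) (sumFin-zero d)
    linearPart-combo ((w , x) ∷ L) j = begin
      sumFin d (λ i → A j i * (w * x i + combo L i))
        ≡⟨ sumFin-cong d (λ i → solve 4 (λ a w x c → a :* (w :* x :+ c) := w :* (a :* x) :+ a :* c)
                                          refl (A j i) w (x i) (combo L i)) ⟩
      sumFin d (λ i → w * (A j i * x i) + A j i * combo L i)
        ≡⟨ sumFin-+ d _ _ ⟩
      sumFin d (λ i → w * (A j i * x i)) + linearPart (combo L) j
        ≡⟨ cong₂ _+_ (sumFin-*ˡ d w _) (linearPart-combo L j) ⟩
      w * linearPart x j + combo (mapPoints linearPart L) j ∎
      where
      open ≡-Reasoning

    private
      combo-apply : ∀ L j → combo (mapPoints apply L) j ≡ combo (mapPoints linearPart L) j + weightSum L * b j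
      combo-apply [] j = sym (trans (+-identityˡ _) (*-zeroˡ (b j)))
      combo-apply ((w , x) ∷ L) j = begin
        w * (linearPart x j + b j) + combo (mapPoints apply L) j
          ≡⟨ cong (w * (linearPart x j + b j) +_) (combo-apply L j) ⟩
        w * (linearPart x j + b j) + (combo (mapPoints linearPart L) j + weightSum L * b j)
          ≡⟨ solve 5 (λ w l c r s → w :* (l :+ c) :+ (r :+ s :* c) := (w :* l :+ r) :+ (w :+ s) :* c)
                     refl w (linearPart x j) (b j) (combo (mapPoints linearPart L) j) (weightSum L) ⟩
        (w * linearPart x j + combo (mapPoints linearPart L) j) + (w + weightSum L) * b j ∎
        where
        open ≡-Reasoning

    apply-combo : ∀ L → weightSum L ≡ 1ℚ → apply (combo L) ≈ₚ combo (mapPoints apply L)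
    apply-combo L ΣL≡1 j = begin
      linearPart (combo L) j + b j
        ≡⟨ cong₂ _+_ (linearPart-combo L j) (sym (trans (cong (_* b j) ΣL≡1) (*-identityˡ (b j)))) ⟩
      combo (mapPoints linearPart L) j + weightSum L * b j
        ≡⟨ sym (combo-apply L j) ⟩
      combo (mapPoints apply L) j ∎
      where
      open ≡-Reasoning

    AffHull-map : {S : Region d} {T : Region e} → (∀ x → S x → T (apply x)) →
      ∀ x → AffHull S x → AffHull T (apply x)
    AffHull-map f-maps x (L , SL , ΣL≡1 , x≈L) =
      mapPoints apply L , All-mapPoints f-maps L SL , trans (weightSum-mapPoints apply L) ΣL≡1 ,
      ≈ₚ-trans (apply-cong x≈L) (apply-combo L ΣL≡1)

    ConvHull-map : {S : Region d} {T : Region e} → (∀ x → S x → T (apply x)) →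
      ∀ x → ConvHull S x → ConvHull T (apply x)
    ConvHull-map f-maps x (L , SL , L≥0 , ΣL≡1 , x≈L) =
      mapPoints apply L , All-mapPoints f-maps L SL , Nonnegative-mapPoints L L≥0 ,
      trans (weightSum-mapPoints apply L) ΣL≡1 , ≈ₚ-trans (apply-cong x≈L) (apply-combo L ΣL≡1)

    Image : Region e
    Image y = Σ (Point d) λ x → y ≈ₚ apply x

  AffinelyClosed : Region d → Set
  AffinelyClosed T = ∀ L → weightSum L ≡ 1ℚ → All (T ∘ proj₂) L → T (combo L)

  ConvexlyClosed : Region d → Set
  ConvexlyClosed T = ∀ L → Nonnegative L → weightSum L ≡ 1ℚ → All (T ∘ proj₂) L → T (combo L)

  AffHull-least : {S T : Region d} → RespectsPointwise T → AffinelyClosed T → (∀ x → S x → T x) →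
    ∀ x → AffHull S x → T x
  AffHull-least T-resp T-closed S⊆T x (L , SL , ΣL≡1 , x≈L) =
    T-resp (≈ₚ-sym x≈L) (T-closed L ΣL≡1 (All.map (S⊆T _) SL))

  ConvHull-least : {S T : Region d} → RespectsPointwise T → ConvexlyClosed T → (∀ x → S x → T x) →
    ∀ x → ConvHull S x → T x
  ConvHull-least T-resp T-closed S⊆T x (L , SL , L≥0 , ΣL≡1 , x≈L) =
    T-resp (≈ₚ-sym x≈L) (T-closed L L≥0 ΣL≡1 (All.map (S⊆T _) SL))

  module _ (f : AffineMap d e) where
    open AffineMap f

    Image-respects : RespectsPointwise (Image f)
    Image-respects y≈y' (x , y≈fx) = x , ≈ₚ-trans (≈ₚ-sym y≈y') y≈fx

    Image-affinelyClosed : AffinelyClosed (Image f)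
    Image-affinelyClosed L ΣL≡1 imgL = combo (preimages L imgL) , ≈ₚ-trans (combo-preimages L imgL)
      (≈ₚ-sym (apply-combo f (preimages L imgL) (trans (weightSum-preimages L imgL) ΣL≡1)))
      where
      preimages : ∀ L → All (Image f ∘ proj₂) L → List (ℚ × Point d)
      preimages []            []               = []
      preimages ((w , _) ∷ L) ((x , _) ∷ imgL) = (w , x) ∷ preimages L imgL

      weightSum-preimages : ∀ L imgL → weightSum (preimages L imgL) ≡ weightSum L
      weightSum-preimages []            []            = refl
      weightSum-preimages ((w , _) ∷ L) (_ ∷ imgL) = cong (w +_) (weightSum-preimages L imgL)

      combo-preimages : ∀ L imgL → combo L ≈ₚ combo (mapPoints apply (preimages L imgL))
      combo-preimages []            []                  i = refl
      combo-preimages ((w , _) ∷ L) ((_ , y≈fx) ∷ imgL) i =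
        cong₂ _+_ (cong (w *_) (y≈fx i)) (combo-preimages L imgL i)

    Image-convexlyClosed : ConvexlyClosed (Image f)
    Image-convexlyClosed L _ = Image-affinelyClosed L

  ConvHull-respects : {S : Region d} → RespectsPointwise (ConvHull S)
  ConvHull-respects x≈y (L , SL , L≥0 , ΣL≡1 , x≈L) = L , SL , L≥0 , ΣL≡1 , ≈ₚ-trans (≈ₚ-sym x≈y) x≈L

module OrderPolytopes where

  open import Defs using (Point; Region; combo; weightSum; _≈ₚ_; ConvHull; GenPoset; module GenPoset; OrderPolytope)
  open AffineHulls
  open import Data.Nat as ℕ using (ℕ; zero; suc; z≤n; s≤s)
  import Data.Nat.Properties as ℕ
  open import Data.Fin using (Fin; zero; suc)
  open import Data.Bool using (Bool; true; false; if_then_else_)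
  open import Data.Unit using (tt)
  open import Data.Sum using (_⊎_; inj₁; inj₂)
  open import Data.Rational
  open import Data.Rational.Properties
  open import Data.Rational.Solver
  open import Data.List using (List; []; _∷_)
  open import Data.List.Relation.Unary.All as All using (All; []; _∷_)
  open import Data.Product using (Σ; _×_; _,_; proj₁; proj₂)
  open import Function using (_∘_)
  open import Relation.Binary.PropositionalEquality
  open import Relation.Nullary using (¬_; yes; no; contradiction)
  open import Relation.Nullary.Decidable using (toSum)
  open import Relation.Binary.Construct.Closure.ReflexiveTransitive using (ε; _◅_)

  open +-*-Solver using (solve; _:=_; _:+_; _:-_; con)

  0≤1 : 0ℚ ≤ 1ℚ
  0≤1 = ≤ᵇ⇒≤ tt

  private
    0≤q-p : ∀ {p q} → p ≤ q → 0ℚ ≤ q - p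
    0≤q-p {p} {q} p≤q = subst (_≤ q - p) (+-inverseʳ p) (+-monoˡ-≤ (- p) p≤q)

    *-monoˡ-≤-0≤ : ∀ w {p q} → 0ℚ ≤ w → p ≤ q → w * p ≤ w * q
    *-monoˡ-≤-0≤ w 0≤w = *-monoˡ-≤-nonNeg w {{nonNegative 0≤w}}

  private
    variable
      d : ℕ

  combo-mono : (L : List (ℚ × Point d)) (i j : Fin d) → Nonnegative L →
    All (λ p → proj₂ p i ≤ proj₂ p j) L → combo L i ≤ combo L j
  combo-mono []            i j []          []          = ≤-refl
  combo-mono ((w , x) ∷ L) i j (0≤w ∷ L≥0) (xi≤xj ∷ L≤) =
    +-mono-≤ (*-monoˡ-≤-0≤ w 0≤w xi≤xj) (combo-mono L i j L≥0 L≤)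

  combo-nonneg : (L : List (ℚ × Point d)) (i : Fin d) → Nonnegative L →
    All (λ p → 0ℚ ≤ proj₂ p i) L → 0ℚ ≤ combo L i
  combo-nonneg []            i []          []          = ≤-refl
  combo-nonneg ((w , x) ∷ L) i (0≤w ∷ L≥0) (0≤xi ∷ L≥) =
    +-mono-≤ (subst (_≤ w * x i) (*-zeroʳ w) (*-monoˡ-≤-0≤ w 0≤w 0≤xi)) (combo-nonneg L i L≥0 L≥)

  combo-≤-weightSum : (L : List (ℚ × Point d)) (i : Fin d) → Nonnegative L →
    All (λ p → proj₂ p i ≤ 1ℚ) L → combo L i ≤ weightSum L
  combo-≤-weightSum []            i []          []          = ≤-refl
  combo-≤-weightSum ((w , x) ∷ L) i (0≤w ∷ L≥0) (xi≤1 ∷ L≤) =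
    +-mono-≤ (subst (w * x i ≤_) (*-identityʳ w) (*-monoˡ-≤-0≤ w 0≤w xi≤1)) (combo-≤-weightSum L i L≥0 L≤)

  count : ∀ n → (Fin n → Bool) → ℕ
  count zero    f = 0
  count (suc n) f = (if f zero then 1 else 0) ℕ.+ count n (λ i → f (suc i))

  count-mono : ∀ n (f g : Fin n → Bool) → (∀ a → g a ≡ true → f a ≡ true) → count n g ℕ.≤ count n f
  count-mono zero    f g g⊆f = z≤n
  count-mono (suc n) f g g⊆f with g zero in g₀ | f zero in f₀
  ... | true  | true  = s≤s (count-mono n _ _ (λ a → g⊆f (suc a)))
  ... | true  | false = contradiction (trans (sym (g⊆f zero g₀)) f₀) λ ()
  ... | false | true  = ℕ.m≤n⇒m≤1+n (count-mono n _ _ (λ a → g⊆f (suc a)))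
  ... | false | false = count-mono n _ _ (λ a → g⊆f (suc a))

  count-< : ∀ n (f g : Fin n → Bool) → (∀ a → g a ≡ true → f a ≡ true) →
    ∀ a₀ → f a₀ ≡ true → g a₀ ≡ false → count n g ℕ.< count n f
  count-< (suc n) f g g⊆f zero f₀ g₀ rewrite f₀ | g₀ = s≤s (count-mono n _ _ (λ a → g⊆f (suc a)))
  count-< (suc n) f g g⊆f (suc a₀) fa₀ ga₀ with g zero in g₀ | f zero in f₀
  ... | true  | true  = s≤s (count-< n _ _ (λ a → g⊆f (suc a)) a₀ fa₀ ga₀)
  ... | true  | false = contradiction (trans (sym (g⊆f zero g₀)) f₀) λ ()
  ... | false | true  = ℕ.m≤n⇒m≤1+n (count-< n _ _ (λ a → g⊆f (suc a)) a₀ fa₀ ga₀)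
  ... | false | false = count-< n _ _ (λ a → g⊆f (suc a)) a₀ fa₀ ga₀

  minimumPositive : ∀ n (y : Fin n → ℚ) →
    (∀ a → ¬ 0ℚ < y a) ⊎ Σ (Fin n) (λ a₀ → 0ℚ < y a₀ × (∀ b → 0ℚ < y b → y a₀ ≤ y b))
  minimumPositive zero y = inj₁ (λ ())
  minimumPositive (suc n) y with minimumPositive n (λ i → y (suc i)) | 0ℚ <? y zero
  ... | inj₁ rest≤0 | yes y₀>0 = inj₂ (zero , y₀>0 , λ { zero _ → ≤-refl ; (suc b) yb>0 → contradiction yb>0 (rest≤0 b) })
  ... | inj₁ rest≤0 | no  y₀≯0 = inj₁ (λ { zero → y₀≯0 ; (suc b) → rest≤0 b })
  ... | inj₂ (a₀ , ya₀>0 , a₀-min) | no y₀≯0 =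
    inj₂ (suc a₀ , ya₀>0 , λ { zero y₀>0 → contradiction y₀>0 y₀≯0 ; (suc b) yb>0 → a₀-min b yb>0 })
  ... | inj₂ (a₀ , ya₀>0 , a₀-min) | yes y₀>0 with ≤-total (y zero) (y (suc a₀))
  ...   | inj₁ y₀≤ = inj₂ (zero , y₀>0 , λ { zero _ → ≤-refl ; (suc b) yb>0 → ≤-trans y₀≤ (a₀-min b yb>0) })
  ...   | inj₂ y₀≥ = inj₂ (suc a₀ , ya₀>0 , λ { zero _ → y₀≥ ; (suc b) yb>0 → a₀-min b yb>0 })

  isPositive : ℚ → Bool
  isPositive r with 0ℚ <? r
  ... | yes _ = true
  ... | no _  = false

  isPositive-true : ∀ {r} → 0ℚ < r → isPositive r ≡ true
  isPositive-true {r} r>0 with 0ℚ <? r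
  ... | yes _   = refl
  ... | no r≯0 = contradiction r>0 r≯0

  isPositive-false : ∀ {r} → ¬ 0ℚ < r → isPositive r ≡ false
  isPositive-false {r} r≯0 with 0ℚ <? r
  ... | yes r>0 = contradiction r>0 r≯0
  ... | no _    = refl

  isPositive⁻¹ : ∀ {r} → isPositive r ≡ true → 0ℚ < r
  isPositive⁻¹ {r} eq with 0ℚ <? r
  ... | yes r>0 = r>0

  module _ (Π : GenPoset) where
    open GenPoset Π

    Antitone : Point n → Set
    Antitone y = ∀ a b → a ≼ b → y b ≤ y a

    Antitone-generators : ∀ {y} → (∀ a b → gen a b → y b ≤ y a) → Antitone y
    Antitone-generators y-gen a b ε         = ≤-refl
    Antitone-generators y-gen a b (g ◅ a≼b) = ≤-trans (Antitone-generators y-gen _ b a≼b) (y-gen a _ g)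

    OrderPolytope-respects : RespectsPointwise (OrderPolytope Π)
    OrderPolytope-respects x≈y (x-anti , x∈[0,1]) =
      (λ a b a≼b → subst₂ _≤_ (x≈y b) (x≈y a) (x-anti a b a≼b)) ,
      (λ a → subst (0ℚ ≤_) (x≈y a) (proj₁ (x∈[0,1] a)) , subst (_≤ 1ℚ) (x≈y a) (proj₂ (x∈[0,1] a)))

    OrderPolytope-convex : ConvexlyClosed (OrderPolytope Π)
    OrderPolytope-convex L L≥0 ΣL≡1 L⊆O =
      (λ a b a≼b → combo-mono L b a L≥0 (All.map (λ x∈O → proj₁ x∈O a b a≼b) L⊆O)) ,
      (λ a → combo-nonneg L a L≥0 (All.map (λ x∈O → proj₁ (proj₂ x∈O a)) L⊆O) ,
             subst (combo L a ≤_) ΣL≡1 (combo-≤-weightSum L a L≥0 (All.map (λ x∈O → proj₂ (proj₂ x∈O a)) L⊆O)))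

    ZeroOne : Point n → Set
    ZeroOne z = ∀ a → z a ≡ 0ℚ ⊎ z a ≡ 1ℚ

    OrderVertex : Region n
    OrderVertex z = OrderPolytope Π z × ZeroOne z

    support : Point n → Fin n → Bool
    support y a = isPositive (y a)

    ConicBelow : ℚ → Point n → Set
    ConicBelow w y = Σ (List (ℚ × Point n)) λ L →
      All (OrderVertex ∘ proj₂) L × Nonnegative L × weightSum L ≤ w × y ≈ₚ combo L

    -- The support of an antitone y is an order ideal, so peeling off c · supp, with c the least
    -- positive value of y, leaves an antitone point with smaller support.
    module Peel {w : ℚ} {y : Point n} (y-anti : Antitone y) (y≥0 : ∀ a → 0ℚ ≤ y a) (y≤w : ∀ a → y a ≤ w)
                (a₀ : Fin n) (ya₀>0 : 0ℚ < y a₀) (a₀-min : ∀ b → 0ℚ < y b → y a₀ ≤ y b) where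

      c : ℚ
      c = y a₀

      supp : Point n
      supp a = if support y a then 1ℚ else 0ℚ

      supp-vertex : OrderVertex supp
      supp-vertex = (supp-antitone , λ a → supp-bounds (support y a)) , λ a → supp-zeroOne (support y a)
        where
        supp-antitone : Antitone supp
        supp-antitone a b a≼b with 0ℚ <? y b | 0ℚ <? y a
        ... | yes _    | yes _    = ≤-refl
        ... | yes yb>0 | no ya≯0 = contradiction (<-≤-trans yb>0 (y-anti a b a≼b)) ya≯0
        ... | no _     | yes _    = 0≤1
        ... | no _     | no _     = ≤-refl
        supp-bounds : ∀ β → 0ℚ ≤ (if β then 1ℚ else 0ℚ) × (if β then 1ℚ else 0ℚ) ≤ 1ℚ
        supp-bounds true  = 0≤1 , ≤-refl
        supp-bounds false = ≤-refl , 0≤1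
        supp-zeroOne : ∀ β → (if β then 1ℚ else 0ℚ) ≡ 0ℚ ⊎ (if β then 1ℚ else 0ℚ) ≡ 1ℚ
        supp-zeroOne true  = inj₂ refl
        supp-zeroOne false = inj₁ refl

      rest : Point n
      rest a = y a - c * supp a

      y≈c*supp+rest : ∀ a → y a ≡ c * supp a + rest a
      y≈c*supp+rest a = solve 2 (λ ya t → ya := t :+ (ya :- t)) refl (y a) (c * supp a)

      private
        rest-inside : ∀ {a} → 0ℚ < y a → rest a ≡ y a - c
        rest-inside {a} ya>0 rewrite isPositive-true ya>0 = cong (λ t → y a - t) (*-identityʳ c)

        rest-outside : ∀ {a} → ¬ 0ℚ < y a → rest a ≡ 0ℚ
        rest-outside {a} ya≯0 rewrite isPositive-false ya≯0 = begin
          y a - c * 0ℚ ≡⟨ cong (λ t → y a - t) (*-zeroʳ c) ⟩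
          y a + - 0ℚ   ≡⟨ +-identityʳ (y a) ⟩
          y a          ≡⟨ ≤-antisym (≮⇒≥ ya≯0) (y≥0 a) ⟩
          0ℚ           ∎
          where
          open ≡-Reasoning

      rest-nonneg : ∀ a → 0ℚ ≤ rest a
      rest-nonneg a with toSum (0ℚ <? y a)
      ... | inj₁ ya>0 = subst (0ℚ ≤_) (sym (rest-inside ya>0)) (0≤q-p (a₀-min a ya>0))
      ... | inj₂ ya≯0 = ≤-reflexive (sym (rest-outside ya≯0))

      rest-bounded : ∀ a → rest a ≤ w - c
      rest-bounded a with toSum (0ℚ <? y a)
      ... | inj₁ ya>0 = subst (_≤ w - c) (sym (rest-inside ya>0)) (+-monoˡ-≤ (- c) (y≤w a))
      ... | inj₂ ya≯0 = subst (_≤ w - c) (sym (rest-outside ya≯0)) (0≤q-p (y≤w a₀))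

      rest-antitone : Antitone rest
      rest-antitone a b a≼b with toSum (0ℚ <? y b) | toSum (0ℚ <? y a)
      ... | inj₁ yb>0 | inj₁ ya>0 = subst₂ _≤_ (sym (rest-inside yb>0)) (sym (rest-inside ya>0))
                                    (+-monoˡ-≤ (- c) (y-anti a b a≼b))
      ... | inj₁ yb>0 | inj₂ ya≯0 = contradiction (<-≤-trans yb>0 (y-anti a b a≼b)) ya≯0
      ... | inj₂ yb≯0 | _         = subst (_≤ rest a) (sym (rest-outside yb≯0)) (rest-nonneg a)

      rest-support-smaller : count n (support rest) ℕ.< count n (support y)
      rest-support-smaller =
        count-< n (support y) (support rest) rest⊆y a₀ (isPositive-true ya₀>0) (isPositive-false rest-a₀≯0)
        where
        rest⊆y : ∀ a → support rest a ≡ true → support y a ≡ true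
        rest⊆y a resta>0 with toSum (0ℚ <? y a)
        ... | inj₁ ya>0 = isPositive-true ya>0
        ... | inj₂ ya≯0 = contradiction (subst (0ℚ <_) (rest-outside ya≯0) (isPositive⁻¹ resta>0)) (<-irrefl refl)
        rest-a₀≯0 : ¬ 0ℚ < rest a₀
        rest-a₀≯0 = <-irrefl (sym (trans (rest-inside ya₀>0) (+-inverseʳ c)))

    conicBelow : ∀ k w y → count n (support y) ℕ.≤ k → 0ℚ ≤ w → Antitone y →
      (∀ a → 0ℚ ≤ y a) → (∀ a → y a ≤ w) → ConicBelow w y
    conicBelow k w y _ 0≤w y-anti y≥0 y≤w with minimumPositive n y
    ... | inj₁ y≤0 = [] , [] , [] , 0≤w , λ a → ≤-antisym (≮⇒≥ (y≤0 a)) (y≥0 a)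
    conicBelow zero w y ∣y∣≤0 _ _ _ _ | inj₂ (a₀ , ya₀>0 , _) =
      contradiction (ℕ.<-≤-trans (count-< n (support y) (λ _ → false) (λ _ ()) a₀ (isPositive-true ya₀>0) refl) ∣y∣≤0)
                    ℕ.n≮0
    conicBelow (suc k) w y ∣y∣≤k+1 _ y-anti y≥0 y≤w | inj₂ (a₀ , ya₀>0 , a₀-min)
      with conicBelow k (w - c) rest (ℕ.<⇒≤pred (ℕ.<-≤-trans rest-support-smaller ∣y∣≤k+1))
                      (0≤q-p (y≤w a₀)) rest-antitone rest-nonneg rest-bounded
      where
      open Peel y-anti y≥0 y≤w a₀ ya₀>0 a₀-min
    ... | L , L-vertices , L≥0 , ΣL≤w-c , rest≈L =
      (c , supp) ∷ L , supp-vertex ∷ L-vertices , <⇒≤ ya₀>0 ∷ L≥0 ,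
      subst (c + weightSum L ≤_) (solve 2 (λ c w → c :+ (w :- c) := w) refl c w) (+-monoʳ-≤ c ΣL≤w-c) ,
      λ a → trans (y≈c*supp+rest a) (cong (c * supp a +_) (rest≈L a))
      where
      open Peel y-anti y≥0 y≤w a₀ ya₀>0 a₀-min

    OrderPolytope⊆ConvHull-vertices : ∀ y → OrderPolytope Π y → ConvHull OrderVertex y
    OrderPolytope⊆ConvHull-vertices y (y-anti , y∈[0,1])
      with conicBelow (count n (support y)) 1ℚ y ℕ.≤-refl 0≤1 y-anti (proj₁ ∘ y∈[0,1]) (proj₂ ∘ y∈[0,1])
    ... | L , L-vertices , L≥0 , ΣL≤1 , y≈L =
      (1ℚ - weightSum L , origin) ∷ L , origin-vertex ∷ L-vertices , 0≤q-p ΣL≤1 ∷ L≥0 ,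
      solve 1 (λ σ → (con 1ℚ :- σ) :+ σ := con 1ℚ) refl (weightSum L) ,
      λ a → trans (y≈L a) (sym (trans (cong (_+ combo L a) (*-zeroʳ (1ℚ - weightSum L))) (+-identityˡ _)))
      where
      origin : Point n
      origin _ = 0ℚ
      origin-vertex : OrderVertex origin
      origin-vertex = ((λ _ _ _ → ≤-refl) , λ _ → ≤-refl , 0≤1) , λ _ → inj₁ refl

module Integrality where

  open import Defs using (AffineMap; module AffineMap; sumFin; Integral)
  open import Data.Nat as ℕ using (ℕ; zero; suc)
  import Data.Nat.Properties as ℕ
  open import Data.Fin using (Fin; zero; suc)
  open import Data.Bool using (Bool; true; false; if_then_else_)
  open import Data.Integer as ℤ using (ℤ)
  import Data.Integer.Properties as ℤ
  open import Data.Rational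
  open import Data.Rational.Properties
  open import Data.Product using (_,_; ∃)
  open AffineHulls using (RespectsPointwise)
  open import Relation.Binary.PropositionalEquality

  IsInteger : ℚ → Set
  IsInteger x = ∃ λ (z : ℤ) → x ≡ z / 1

  private
    ∣a∣≡1 : ∀ (a g : ℤ) → a ℤ.* g ≡ ℤ.+ 1 → ℤ.∣ a ∣ ≡ 1
    ∣a∣≡1 a g a*g≡1 = ℕ.m*n≡1⇒m≡1 _ _ (trans (sym (ℤ.abs-* a g)) (cong ℤ.∣_∣ a*g≡1))

    isInteger⇒↧≡1 : ∀ x → IsInteger x → ↧ₙ x ≡ 1
    isInteger⇒↧≡1 x (z , refl) = ∣a∣≡1 (↧ (z / 1)) _ (↧-/ z 1)

    ↧≡1⇒isInteger : ∀ x → ↧ₙ x ≡ 1 → IsInteger x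
    ↧≡1⇒isInteger (mkℚ z zero _) _ = z , sym (↥p/↧p≡p (mkℚ z 0 _))

    ↧-op≡1 : ∀ (op : ℚ → ℚ → ℚ) (nf : ℚ → ℚ → ℤ) → (∀ a b → ↧ (op a b) ℤ.* nf a b ≡ ℤ.+ (↧ₙ a ℕ.* ↧ₙ b)) →
      ∀ {a b} → IsInteger a → IsInteger b → IsInteger (op a b)
    ↧-op≡1 op nf ↧-op {a} {b} a∈ℤ b∈ℤ = ↧≡1⇒isInteger (op a b) (∣a∣≡1 (↧ (op a b)) (nf a b)
      (trans (↧-op a b) (cong₂ (λ m n → ℤ.+ (m ℕ.* n)) (isInteger⇒↧≡1 a a∈ℤ) (isInteger⇒↧≡1 b b∈ℤ))))

  isInteger-+ : ∀ {a b} → IsInteger a → IsInteger b → IsInteger (a + b)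
  isInteger-+ = ↧-op≡1 _+_ _ ↧-+

  isInteger-* : ∀ {a b} → IsInteger a → IsInteger b → IsInteger (a * b)
  isInteger-* = ↧-op≡1 _*_ _ (λ a b → trans (↧-* a b) (ℤ.pos-* (↧ₙ a) (↧ₙ b)))

  isInteger-neg : ∀ {a} → IsInteger a → IsInteger (- a)
  isInteger-neg {a} a∈ℤ = ↧≡1⇒isInteger (- a) (trans (cong ℤ.∣_∣ (↧-neg a)) (isInteger⇒↧≡1 a a∈ℤ))

  isInteger-0 : IsInteger 0ℚ
  isInteger-0 = ℤ.+ 0 , refl

  isInteger-1 : IsInteger 1ℚ
  isInteger-1 = ℤ.+ 1 , refl

  isInteger-if : ∀ (β : Bool) → IsInteger (if β then 1ℚ else 0ℚ)
  isInteger-if true  = isInteger-1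
  isInteger-if false = isInteger-0

  isInteger-sumFin : ∀ n (f : Fin n → ℚ) → (∀ i → IsInteger (f i)) → IsInteger (sumFin n f)
  isInteger-sumFin zero    f _   = isInteger-0
  isInteger-sumFin (suc n) f f∈ℤ = isInteger-+ (f∈ℤ zero) (isInteger-sumFin n (λ i → f (suc i)) (λ i → f∈ℤ (suc i)))

  module _ {m n : ℕ} (f : AffineMap m n) where
    open AffineMap f

    apply-integral : (∀ j i → IsInteger (A j i)) → (∀ j → IsInteger (b j)) →
      ∀ x → Integral x → Integral (apply x)
    apply-integral A∈ℤ b∈ℤ x x∈ℤ j =
      isInteger-+ (isInteger-sumFin m _ (λ i → isInteger-* (A∈ℤ j i) (x∈ℤ i))) (b∈ℤ j)

  Integral-respects : ∀ {d} → RespectsPointwise {d} Integral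
  Integral-respects x≈y x∈ℤ i = subst IsInteger (x≈y i) (x∈ℤ i)

module Thresholds where

  open Preliminaries
  open FiniteSums
  open import Data.Nat as ℕ using (ℕ; zero; suc; z≤n; s≤s; _≡ᵇ_)
  import Data.Nat.Properties as ℕ
  open import Data.Bool using (Bool; if_then_else_)
  open import Data.Unit using (tt)
  open import Data.Sum using (_⊎_; inj₁; inj₂)
  open import Data.Product using (Σ; _×_; _,_)
  open import Data.Rational using (ℚ; 0ℚ; 1ℚ; _-_; _≤_)
  open import Data.Rational.Properties using (≤-refl; ≤ᵇ⇒≤; ≤-antisym)
  open import Relation.Binary.PropositionalEquality
  open import Relation.Binary using (tri<; tri≈; tri>)
  open import Relation.Nullary using (yes; no; contradiction)

  bit : Bool → ℚ
  bit β = if β then 1ℚ else 0ℚ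

  χ<-zeroOne : ∀ m n → χ< m n ≡ 0ℚ ⊎ χ< m n ≡ 1ℚ
  χ<-zeroOne m n with m ℕ.<? n
  ... | yes m<n = inj₂ (if<-yes m<n)
  ... | no m≮n  = inj₁ (if<-no m≮n)

  0≤χ< : ∀ m n → 0ℚ ≤ χ< m n
  0≤χ< m n with χ<-zeroOne m n
  ... | inj₁ eq = subst (0ℚ ≤_) (sym eq) ≤-refl
  ... | inj₂ eq = subst (0ℚ ≤_) (sym eq) (≤ᵇ⇒≤ tt)

  χ<-antitone : ∀ m n → χ< (suc m) n ≤ χ< m n
  χ<-antitone m n with (suc m) ℕ.<? n
  ... | yes m+1<n = subst₂ _≤_ (sym (if<-yes m+1<n)) (sym (if<-yes (ℕ.<-trans (ℕ.n<1+n m) m+1<n))) ≤-refl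
  ... | no m+1≮n  = subst (_≤ χ< m n) (sym (if<-no m+1≮n)) (0≤χ< m n)

  χ<-step : ∀ m n → χ< m n - χ< (suc m) n ≡ bit (n ≡ᵇ suc m)
  χ<-step m n with ℕ.<-cmp m n
  ... | tri< m<n _ _ with ℕ.<-cmp (suc m) n
  ...   | tri< m+1<n _ _ = begin
    χ< m n - χ< (suc m) n        ≡⟨ cong₂ _-_ (if<-yes m<n) (if<-yes m+1<n) ⟩
    1ℚ - 1ℚ                      ≡⟨⟩
    0ℚ                           ≡⟨ cong bit (sym (≡ᵇ-false (ℕ.>⇒≢ m+1<n))) ⟩
    bit (n ≡ᵇ suc m)             ∎
    where
    open ≡-Reasoning
  ...   | tri≈ _ m+1≡n _ = begin
    χ< m n - χ< (suc m) n        ≡⟨ cong₂ _-_ (if<-yes m<n) (if<-no (ℕ.<-irrefl m+1≡n)) ⟩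
    1ℚ - 0ℚ                      ≡⟨⟩
    1ℚ                           ≡⟨ cong bit (sym (≡ᵇ-true (sym m+1≡n))) ⟩
    bit (n ≡ᵇ suc m)             ∎
    where
    open ≡-Reasoning
  ...   | tri> _ _ n<m+1 = contradiction m<n (ℕ.≤⇒≯ (ℕ.≤-pred n<m+1))
  χ<-step m n | tri≈ _ m≡n _ = begin
    χ< m n - χ< (suc m) n        ≡⟨ cong₂ _-_ (if<-no (ℕ.<-irrefl m≡n))
                                    (if<-no (λ m+1<n → ℕ.<-irrefl m≡n (ℕ.<-trans (ℕ.n<1+n m) m+1<n))) ⟩
    0ℚ - 0ℚ                      ≡⟨⟩
    0ℚ                           ≡⟨ cong bit (sym (≡ᵇ-false (λ n≡m+1 → ℕ.1+n≢n (sym (trans m≡n n≡m+1))))) ⟩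
    bit (n ≡ᵇ suc m)             ∎
    where
    open ≡-Reasoning
  χ<-step m n | tri> _ _ n<m = begin
    χ< m n - χ< (suc m) n        ≡⟨ cong₂ _-_ (if<-no (ℕ.<-asym n<m))
                                    (if<-no (λ m+1<n → ℕ.<-asym n<m (ℕ.<-trans (ℕ.n<1+n m) m+1<n))) ⟩
    0ℚ - 0ℚ                      ≡⟨⟩
    0ℚ                           ≡⟨ cong bit (sym (≡ᵇ-false (λ n≡m+1 → ℕ.<-asym n<m (subst (m ℕ.<_) (sym n≡m+1) (ℕ.n<1+n m))))) ⟩
    bit (n ≡ᵇ suc m)             ∎
    where
    open ≡-Reasoning

  ZeroOneOn : ℕ → (ℕ → ℚ) → Set
  ZeroOneOn N f = ∀ n → n ℕ.≤ N → f n ≡ 0ℚ ⊎ f n ≡ 1ℚ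

  AntitoneOn : ℕ → (ℕ → ℚ) → Set
  AntitoneOn N f = ∀ n → n ℕ.< N → f (suc n) ≤ f n

  threshold : ∀ N f → ZeroOneOn N f → AntitoneOn N f →
    Σ ℕ λ τ → τ ℕ.≤ suc N × (∀ n → n ℕ.≤ N → f n ≡ χ< n τ)
  threshold zero f f-01 _ with f-01 0 z≤n
  ... | inj₁ f0≡0 = 0 , z≤n , λ { zero _ → trans f0≡0 (sym (if<-no (λ ()))) }
  ... | inj₂ f0≡1 = 1 , s≤s z≤n , λ { zero _ → trans f0≡1 (sym (if<-yes (s≤s z≤n))) }
  threshold (suc N) f f-01 f-anti
    with threshold N f (λ n n≤N → f-01 n (ℕ.m≤n⇒m≤1+n n≤N)) (λ n n<N → f-anti n (ℕ.m≤n⇒m≤1+n n<N))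
  ... | τ , τ≤N+1 , f≡ with ℕ.m≤n⇒m<n∨m≡n τ≤N+1
  ...   | inj₁ τ<N+1 = τ , ℕ.m≤n⇒m≤1+n τ≤N+1 , extend
    where
    fN≡0 : f N ≡ 0ℚ
    fN≡0 = trans (f≡ N ℕ.≤-refl) (if<-no (λ N<τ → ℕ.<⇒≱ N<τ (ℕ.≤-pred τ<N+1)))
    fN+1≡0 : f (suc N) ≡ 0ℚ
    fN+1≡0 with f-01 (suc N) ℕ.≤-refl
    ... | inj₁ eq = eq
    ... | inj₂ eq = contradiction (≤-antisym (subst₂ _≤_ eq fN≡0 (f-anti N ℕ.≤-refl)) (≤ᵇ⇒≤ tt)) λ ()
    extend : ∀ n → n ℕ.≤ suc N → f n ≡ χ< n τ
    extend n n≤N+1 with ℕ.m≤n⇒m<n∨m≡n n≤N+1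
    ... | inj₁ n<N+1 = f≡ n (ℕ.≤-pred n<N+1)
    ... | inj₂ refl  = trans fN+1≡0 (sym (if<-no (λ N+1<τ → ℕ.<⇒≱ N+1<τ (ℕ.<⇒≤ τ<N+1))))
  ...   | inj₂ refl with f-01 (suc N) ℕ.≤-refl
  ...     | inj₂ fN+1≡1 = suc (suc N) , ℕ.≤-refl , extend
    where
    extend : ∀ n → n ℕ.≤ suc N → f n ≡ χ< n (suc (suc N))
    extend n n≤N+1 with ℕ.m≤n⇒m<n∨m≡n n≤N+1
    ... | inj₁ n<N+1 = trans (f≡ n (ℕ.≤-pred n<N+1)) (trans (if<-yes n<N+1) (sym (if<-yes (ℕ.m≤n⇒m≤1+n n<N+1))))
    ... | inj₂ refl  = trans fN+1≡1 (sym (if<-yes ℕ.≤-refl))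
  ...     | inj₁ fN+1≡0 = suc N , ℕ.n≤1+n _ , extend
    where
    extend : ∀ n → n ℕ.≤ suc N → f n ≡ χ< n (suc N)
    extend n n≤N+1 with ℕ.m≤n⇒m<n∨m≡n n≤N+1
    ... | inj₁ n<N+1 = f≡ n (ℕ.≤-pred n<N+1)
    ... | inj₂ refl  = trans fN+1≡0 (sym (if<-no (ℕ.<-irrefl refl)))

module Forests where

  open import Defs using (Multigraph; module Multigraph; EdgeSet; Conn; here; fwd; bwd; remove; insert; Acyclic; IsBasis)
  open import Data.Nat as ℕ using (ℕ; zero; suc)
  import Data.Nat.Properties as ℕ
  open import Data.Fin as Fin using (Fin; zero; suc; inject₁; fromℕ)
  open import Data.Bool using (Bool; true; false)
  open import Data.Bool.Properties using (∨-zeroʳ)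
  open import Data.Empty using (⊥-elim)
  open import Data.Sum using (_⊎_; inj₁; inj₂)
  open import Data.Maybe using (Maybe; just; nothing)
  open import Data.Product using (Σ; _×_; _,_; proj₁; proj₂)
  open import Relation.Binary.PropositionalEquality
  open import Relation.Nullary using (¬_; yes; no; contradiction)
  open import Relation.Nullary.Decidable using (toSum)

  module _ (G : Multigraph) where
    open Multigraph G

    private
      variable
        F F′ : EdgeSet m
        x y z : V

    Conn-trans : Conn G F x y → Conn G F y z → Conn G F x z
    Conn-trans here            c = c
    Conn-trans (fwd e e∈F q c₁) c = fwd e e∈F q (Conn-trans c₁ c)
    Conn-trans (bwd e e∈F q c₁) c = bwd e e∈F q (Conn-trans c₁ c)

    Conn-sym : Conn G F x y → Conn G F y x
    Conn-sym here            = here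
    Conn-sym (fwd e e∈F q c) = Conn-trans (Conn-sym c) (bwd e e∈F q here)
    Conn-sym (bwd e e∈F q c) = Conn-trans (Conn-sym c) (fwd e e∈F q here)

    Conn-mono : (∀ e → F e ≡ true → F′ e ≡ true) → Conn G F x y → Conn G F′ x y
    Conn-mono F⊆F′ here            = here
    Conn-mono F⊆F′ (fwd e e∈F q c) = fwd e (F⊆F′ e e∈F) q (Conn-mono F⊆F′ c)
    Conn-mono F⊆F′ (bwd e e∈F q c) = bwd e (F⊆F′ e e∈F) q (Conn-mono F⊆F′ c)

    Conn-path : ∀ {k} (g : Fin (suc (suc k)) → V) →
      (∀ i → Conn G F (g (inject₁ i)) (g (suc i))) → Conn G F (g zero) (g (fromℕ (suc k)))
    Conn-path {k = zero}  g step = step zero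
    Conn-path {k = suc k} g step = Conn-trans (step zero) (Conn-path (λ j → g (suc j)) (λ i → step (suc i)))

    Invariant : EdgeSet m → (V → Set) → Set
    Invariant F P = ∀ e → F e ≡ true →
      (P (proj₁ (ends e)) → P (proj₂ (ends e))) × (P (proj₂ (ends e)) → P (proj₁ (ends e)))

    Conn-invariant : (P : V → Set) → Invariant F P → Conn G F x y → P x → P y
    Conn-invariant P inv here             px = px
    Conn-invariant P inv (fwd e e∈F refl c) px = Conn-invariant P inv c (proj₁ (inv e e∈F) px)
    Conn-invariant P inv (bwd e e∈F refl c) px = Conn-invariant P inv c (proj₂ (inv e e∈F) px)

    ConstantOn : EdgeSet m → (V → Bool) → Set
    ConstantOn F ℓ = ∀ e → F e ≡ true → ℓ (proj₁ (ends e)) ≡ ℓ (proj₂ (ends e))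

    Conn-constant : (ℓ : V → Bool) → ConstantOn F ℓ → Conn G F x y → ℓ x ≡ ℓ y
    Conn-constant {x = x} ℓ const c =
      Conn-invariant (λ z → ℓ x ≡ ℓ z) (λ e e∈F → (λ p → trans p (const e e∈F)) , (λ p → trans p (sym (const e e∈F)))) c refl

    insert-self : ∀ F e → insert G F e e ≡ true
    insert-self F e with e Fin.≟ e
    ... | yes _  = ∨-zeroʳ (F e)
    ... | no e≢e = contradiction refl e≢e

    insert-⊇ : ∀ F e f → F f ≡ true → insert G F e f ≡ true
    insert-⊇ F e f f∈F rewrite f∈F = refl

    insert⁻ : ∀ F e f → insert G F e f ≡ true → f ≢ e → F f ≡ true
    insert⁻ F e f f∈F+e f≢e with F f | f Fin.≟ e
    ... | true  | _       = refl
    ... | false | yes f≡e = contradiction f≡e f≢e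
    ... | false | no _    = f∈F+e

    remove-⊆ : ∀ F e f → remove G F e f ≡ true → F f ≡ true
    remove-⊆ F e f f∈F-e with F f
    ... | true = refl

    remove-≢ : ∀ F e f → remove G F e f ≡ true → f ≢ e
    remove-≢ F e f f∈F-e f≡e with F f | f Fin.≟ e
    remove-≢ F e f () f≡e | true  | yes _
    ... | true  | no f≢e = f≢e f≡e
    remove-≢ F e f () f≡e | false | _

    remove⁺ : ∀ F e f → F f ≡ true → f ≢ e → remove G F e f ≡ true
    remove⁺ F e f f∈F f≢e rewrite f∈F with f Fin.≟ e
    ... | yes f≡e = contradiction f≡e f≢e
    ... | no _    = refl

    ReachesEnd : EdgeSet m → V → Fin m → Set
    ReachesEnd H x e = Conn G H x (proj₁ (ends e)) ⊎ Conn G H x (proj₂ (ends e))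

    ReachedFromEnd : EdgeSet m → Fin m → V → Set
    ReachedFromEnd H e z = Conn G H (proj₁ (ends e)) z ⊎ Conn G H (proj₂ (ends e)) z

    Conn-insert⁻ : ∀ H e → Conn G (insert G H e) x z → Conn G H x z ⊎ (ReachesEnd H x e × ReachedFromEnd H e z)
    Conn-insert⁻ H e here = inj₁ here
    Conn-insert⁻ H e (fwd f f∈H+e refl c) with toSum (f Fin.≟ e) | Conn-insert⁻ H e c
    ... | inj₁ refl | inj₁ c′       = inj₂ (inj₁ here , inj₂ c′)
    ... | inj₁ refl | inj₂ (_ , c′) = inj₂ (inj₁ here , c′)
    ... | inj₂ f≢e  | inj₁ c′       = inj₁ (fwd f (insert⁻ H e f f∈H+e f≢e) refl c′)
    ... | inj₂ f≢e  | inj₂ (r , c′) = inj₂ (extend r , c′)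
      where
      extend : ReachesEnd H _ e → ReachesEnd H _ e
      extend (inj₁ r) = inj₁ (fwd f (insert⁻ H e f f∈H+e f≢e) refl r)
      extend (inj₂ r) = inj₂ (fwd f (insert⁻ H e f f∈H+e f≢e) refl r)
    Conn-insert⁻ H e (bwd f f∈H+e refl c) with toSum (f Fin.≟ e) | Conn-insert⁻ H e c
    ... | inj₁ refl | inj₁ c′       = inj₂ (inj₂ here , inj₁ c′)
    ... | inj₁ refl | inj₂ (_ , c′) = inj₂ (inj₂ here , c′)
    ... | inj₂ f≢e  | inj₁ c′       = inj₁ (bwd f (insert⁻ H e f f∈H+e f≢e) refl c′)
    ... | inj₂ f≢e  | inj₂ (r , c′) = inj₂ (extend r , c′)
      where
      extend : ReachesEnd H _ e → ReachesEnd H _ e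
      extend (inj₁ r) = inj₁ (bwd f (insert⁻ H e f f∈H+e f≢e) refl r)
      extend (inj₂ r) = inj₂ (bwd f (insert⁻ H e f f∈H+e f≢e) refl r)

    Acyclic-insert : ∀ F e (ℓ : V → Bool) → Acyclic G F → ConstantOn F ℓ →
      ℓ (proj₁ (ends e)) ≢ ℓ (proj₂ (ends e)) → Acyclic G (insert G F e)
    Acyclic-insert F e ℓ F-acyclic ℓ-const ℓ-cuts g g∈F+e c with toSum (g Fin.≟ e)
    ... | inj₁ refl = ℓ-cuts (Conn-constant ℓ (λ f f∈ → ℓ-const f (F+g-g⊆F f f∈)) c)
      where
      F+g-g⊆F : ∀ f → remove G (insert G F g) g f ≡ true → F f ≡ true
      F+g-g⊆F f f∈ = insert⁻ F g f (remove-⊆ (insert G F g) g f f∈) (remove-≢ (insert G F g) g f f∈)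
    ... | inj₂ g≢e with Conn-insert⁻ (remove G F g) e (Conn-mono F+e-g⊆F-g+e c)
      where
      F+e-g⊆F-g+e : ∀ f → remove G (insert G F e) g f ≡ true → insert G (remove G F g) e f ≡ true
      F+e-g⊆F-g+e f f∈ with toSum (f Fin.≟ e)
      ... | inj₁ refl = insert-self (remove G F g) f
      ... | inj₂ f≢e  = insert-⊇ (remove G F g) e f
        (remove⁺ F g f (insert⁻ F e f (remove-⊆ (insert G F e) g f f∈) f≢e) (remove-≢ (insert G F e) g f f∈))
    ... | inj₁ c′ = F-acyclic g g∈F c′
      where g∈F = insert⁻ F e g g∈F+e g≢e
    ... | inj₂ (g₁~e , e~g₂) = ℓ-cuts (through g₁~e e~g₂)
      where
      g∈F = insert⁻ F e g g∈F+e g≢e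
      const : ConstantOn (remove G F g) ℓ
      const f f∈ = ℓ-const f (remove-⊆ F g f f∈)
      through : ReachesEnd (remove G F g) (proj₁ (ends g)) e → ReachedFromEnd (remove G F g) e (proj₂ (ends g)) →
        ℓ (proj₁ (ends e)) ≡ ℓ (proj₂ (ends e))
      through (inj₁ g₁~e₁) (inj₁ e₁~g₂) = ⊥-elim (F-acyclic g g∈F (Conn-trans g₁~e₁ e₁~g₂))
      through (inj₁ g₁~e₁) (inj₂ e₂~g₂) =
        trans (sym (Conn-constant ℓ const g₁~e₁)) (trans (ℓ-const g g∈F) (sym (Conn-constant ℓ const e₂~g₂)))
      through (inj₂ g₁~e₂) (inj₁ e₁~g₂) =
        trans (Conn-constant ℓ const e₁~g₂) (trans (sym (ℓ-const g g∈F)) (Conn-constant ℓ const g₁~e₂))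
      through (inj₂ g₁~e₂) (inj₂ e₂~g₂) = ⊥-elim (F-acyclic g g∈F (Conn-trans g₁~e₂ e₂~g₂))

    IsEdgeBetween : Fin m → V → V → Set
    IsEdgeBetween e v w = ends e ≡ (v , w) ⊎ ends e ≡ (w , v)

    record TreeCertificate (F : EdgeSet m) : Set where
      field
        height : V → ℕ
        root   : V
        parent : V → Maybe (V × Fin m)
        parent-edge : ∀ v w e → parent v ≡ just (w , e) → F e ≡ true × IsEdgeBetween e v w × height w ℕ.< height v
        orphan⇒root : ∀ v → parent v ≡ nothing → v ≡ root
        edge-parent : ∀ e → F e ≡ true → Σ V λ v → Σ V λ w → parent v ≡ just (w , e)

    module _ {F : EdgeSet m} (cert : TreeCertificate F) where
      open TreeCertificate cert

      data Descendant (c : V) : V → Set where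
        itself : Descendant c c
        child  : ∀ {x w e} → parent x ≡ just (w , e) → Descendant c w → Descendant c x

      private
        just-injective : ∀ {a b : V × Fin m} → just a ≡ just b → a ≡ b
        just-injective refl = refl

      Descendant-height : ∀ {c x} → Descendant c x → height c ℕ.≤ height x
      Descendant-height itself = ℕ.≤-refl
      Descendant-height {x = x} (child {w = w} {e} px d) =
        ℕ.≤-trans (Descendant-height d) (ℕ.<⇒≤ (proj₂ (proj₂ (parent-edge x w e px))))

      certificate-acyclic : Acyclic G F
      certificate-acyclic g g∈F c~ with edge-parent g g∈F
      ... | c , w , pc with parent-edge c w g pc
      ...   | _ , between , w<c = ℕ.<⇒≱ w<c (Descendant-height (w-descends between))
        where
        closed : Invariant (remove G F g) (Descendant c)
        closed f f∈ with edge-parent f (remove-⊆ F g f f∈)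
        ... | v , u , pv with parent-edge v u f pv
        ...   | _ , inj₁ refl , _ = up , child pv
          where
          up : Descendant c v → Descendant c u
          up itself       = contradiction (cong proj₂ (just-injective (trans (sym pv) pc))) (remove-≢ F g f f∈)
          up (child pv′ d) = subst (Descendant c) (cong proj₁ (just-injective (trans (sym pv′) pv))) d
        ...   | _ , inj₂ refl , _ = child pv , up
          where
          up : Descendant c v → Descendant c u
          up itself       = contradiction (cong proj₂ (just-injective (trans (sym pv) pc))) (remove-≢ F g f f∈)
          up (child pv′ d) = subst (Descendant c) (cong proj₁ (just-injective (trans (sym pv′) pv))) d
        w-descends : IsEdgeBetween g c w → Descendant c w
        w-descends (inj₁ ends≡) = Conn-invariant (Descendant c) closed (subst (λ p → Conn G _ (proj₁ p) (proj₂ p)) ends≡ c~) itself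
        w-descends (inj₂ ends≡) =
          Conn-invariant (Descendant c) closed (Conn-sym (subst (λ p → Conn G _ (proj₁ p) (proj₂ p)) ends≡ c~)) itself

      Conn-root : ∀ k v → height v ℕ.≤ k → Conn G F v root
      Conn-root k v hv≤k with parent v in pv
      ... | nothing = subst (λ z → Conn G F z root) (sym (orphan⇒root v pv)) here
      Conn-root zero v hv≤0 | just (w , e) = contradiction (ℕ.<-≤-trans (proj₂ (proj₂ (parent-edge v w e pv))) hv≤0) ℕ.n≮0
      Conn-root (suc k) v hv≤k+1 | just (w , e) with parent-edge v w e pv
      ... | e∈F , inj₁ ends≡ , w<v = fwd e e∈F ends≡ (Conn-root k w (ℕ.≤-pred (ℕ.≤-trans w<v hv≤k+1)))
      ... | e∈F , inj₂ ends≡ , w<v = bwd e e∈F ends≡ (Conn-root k w (ℕ.≤-pred (ℕ.≤-trans w<v hv≤k+1)))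

      certificate-connected : ∀ x y → Conn G F x y
      certificate-connected x y = Conn-trans (Conn-root _ x ℕ.≤-refl) (Conn-sym (Conn-root _ y ℕ.≤-refl))

      certificate-basis : IsBasis G F
      certificate-basis = certificate-acyclic , maximal
        where
        maximal : ∀ e → F e ≡ false → ¬ Acyclic G (insert G F e)
        maximal e e∉F F+e-acyclic = F+e-acyclic e (insert-self F e) (Conn-mono F⊆F+e-e (certificate-connected _ _))
          where
          F⊆F+e-e : ∀ f → F f ≡ true → remove G (insert G F e) e f ≡ true
          F⊆F+e-e f f∈F = remove⁺ (insert G F e) e f (insert-⊇ F e f f∈F) λ { refl → contradiction (trans (sym f∈F) e∉F) λ () }

module Selections where

  open Preliminaries
  open import Data.Nat as ℕ using (ℕ; suc; _≡ᵇ_)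
  import Data.Nat.Properties as ℕ
  open import Data.Fin as Fin using (Fin; toℕ)
  import Data.Fin.Properties as Fin
  open import Data.Fin.Properties using (any?)
  open import Data.Bool as Bool using (Bool; true; false)
  open import Data.Bool.Properties using (¬-not)
  open import Data.Empty using (⊥; ⊥-elim)
  open import Data.Maybe using (Maybe; just; nothing)
  open import Data.Product using (Σ; _,_)
  open import Function using (_∘_)
  open import Relation.Binary.PropositionalEquality
  open import Relation.Binary using (tri<; tri≈; tri>)
  open import Relation.Nullary using (does; yes; no; contradiction)

  selects : ∀ {n} → Maybe (Fin n) → Fin n → Bool
  selects nothing  _ = false
  selects (just a) b = does (b Fin.≟ a)

  selects-self : ∀ {n} (a : Fin n) → selects (just a) a ≡ true
  selects-self a with a Fin.≟ a
  ... | yes _  = refl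
  ... | no a≢a = contradiction refl a≢a

  selects-≢ : ∀ {n} {a b : Fin n} → b ≢ a → selects (just a) b ≡ false
  selects-≢ {a = a} {b} b≢a with b Fin.≟ a
  ... | yes b≡a = contradiction b≡a b≢a
  ... | no _    = refl

  selects⁻¹ : ∀ {n} {ma : Maybe (Fin n)} {b} → selects ma b ≡ true → ma ≡ just b
  selects⁻¹ {ma = just a} {b} sel with b Fin.≟ a
  ... | yes b≡a = cong just (sym b≡a)

  selection : ∀ {n} (f : Fin n → Bool) → (∀ i j → f i ≡ true → f j ≡ true → i ≡ j) →
    Σ (Maybe (Fin n)) λ m → ∀ i → f i ≡ selects m i
  selection f unique with any? (λ i → f i Bool.≟ true)
  ... | no none = nothing , λ i → ¬-not (none ∘ (i ,_))
  ... | yes (i₀ , fi₀) = just i₀ , agree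
    where
    agree : ∀ i → f i ≡ selects (just i₀) i
    agree i with f i in fi | i Fin.≟ i₀
    ... | true  | yes _    = refl
    ... | true  | no i≢i₀  = contradiction (unique i i₀ fi fi₀) i≢i₀
    ... | false | yes refl = contradiction (trans (sym fi₀) fi) λ ()
    ... | false | no _     = refl

  unique-by-order : ∀ {n} (f : Fin n → Bool) → (∀ i j → toℕ i ℕ.< toℕ j → f i ≡ true → f j ≡ true → ⊥) →
    ∀ i j → f i ≡ true → f j ≡ true → i ≡ j
  unique-by-order f apart i j fi fj with ℕ.<-cmp (toℕ i) (toℕ j)
  ... | tri< i<j _ _ = ⊥-elim (apart i j i<j fi fj)
  ... | tri≈ _ i≡j _ = Fin.toℕ-injective i≡j
  ... | tri> _ _ j<i = ⊥-elim (apart j i j<i fj fi)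

  selects-≡ᵇ : ∀ {n} (a b : Fin n) → selects (just a) b ≡ (toℕ a ≡ᵇ toℕ b)
  selects-≡ᵇ a b with b Fin.≟ a
  ... | yes refl = sym (≡ᵇ-true {toℕ a} refl)
  ... | no b≢a   = sym (≡ᵇ-false (λ a≡b → b≢a (sym (Fin.toℕ-injective a≡b))))

  past-end : ∀ {n} (k : Fin (suc n)) → (suc n ≡ᵇ toℕ k) ≡ false
  past-end k = ≡ᵇ-false (λ n+1≡k → ℕ.<-irrefl (sym n+1≡k) (Fin.toℕ<n k))

module GraphC (s t p q : ℕ) where

  open import Defs
  open Selections
  open import Data.Nat as ℕ using (ℕ; zero; suc)
  open import Data.Fin as Fin using (Fin; suc; inject₁; splitAt; _↑ˡ_; _↑ʳ_)
  import Data.Fin.Properties as Fin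
  open import Data.Bool using (Bool; not)
  open import Data.Maybe using (Maybe; just; nothing)
  open import Data.Sum using (inj₁; inj₂)
  open import Data.Product using (_×_; _,_)
  open import Relation.Binary.PropositionalEquality

  nE : ℕ
  nE = nEdges s t p q

  V : Set
  V = Vtx p q

  uPath : Fin (suc (suc p)) → V
  uPath = pathSeq v₁ u v₃

  wPath : Fin (suc (suc q)) → V
  wPath = pathSeq v₂ w v₃

  -- Each class of edges is named after the chain of W it corresponds to (eβ for the
  -- path through the u's, eδ for the path through the w's).
  data Edge : Set where
    eα : Fin (suc s) → Edge
    eγ : Fin (suc t) → Edge
    eβ : Fin (suc p) → Edge
    eδ : Fin (suc q) → Edge

  endpoints : Edge → V × V
  endpoints (eα _) = v₁ , v₂
  endpoints (eγ _) = v₂ , v₃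
  endpoints (eβ k) = uPath (inject₁ k) , uPath (suc k)
  endpoints (eδ l) = wPath (inject₁ l) , wPath (suc l)

  decode : Fin nE → Edge
  decode e with splitAt (suc s) e
  ... | inj₁ i = eα i
  ... | inj₂ e₁ with splitAt (suc t) e₁
  ...   | inj₁ j = eγ j
  ...   | inj₂ e₂ with splitAt (suc p) e₂
  ...     | inj₁ k = eβ k
  ...     | inj₂ l = eδ l

  encode : Edge → Fin nE
  encode (eα i) = i ↑ˡ _
  encode (eγ j) = suc s ↑ʳ (j ↑ˡ _)
  encode (eβ k) = suc s ↑ʳ (suc t ↑ʳ (k ↑ˡ _))
  encode (eδ l) = suc s ↑ʳ (suc t ↑ʳ (suc p ↑ʳ l))

  ends-decode : ∀ e → endsC s t p q e ≡ endpoints (decode e)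
  ends-decode e with splitAt (suc s) e
  ... | inj₁ _ = refl
  ... | inj₂ e₁ with splitAt (suc t) e₁
  ...   | inj₁ _ = refl
  ...   | inj₂ e₂ with splitAt (suc p) e₂
  ...     | inj₁ _ = refl
  ...     | inj₂ _ = refl

  decode-encode : ∀ x → decode (encode x) ≡ x
  decode-encode (eα i) rewrite Fin.splitAt-↑ˡ (suc s) i (suc t ℕ.+ (suc p ℕ.+ suc q)) = refl
  decode-encode (eγ j) rewrite Fin.splitAt-↑ʳ (suc s) (suc t ℕ.+ (suc p ℕ.+ suc q)) (j ↑ˡ (suc p ℕ.+ suc q))
                             | Fin.splitAt-↑ˡ (suc t) j (suc p ℕ.+ suc q) = refl
  decode-encode (eβ k) rewrite Fin.splitAt-↑ʳ (suc s) (suc t ℕ.+ (suc p ℕ.+ suc q)) (suc t ↑ʳ (k ↑ˡ suc q))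
                             | Fin.splitAt-↑ʳ (suc t) (suc p ℕ.+ suc q) (k ↑ˡ suc q)
                             | Fin.splitAt-↑ˡ (suc p) k (suc q) = refl
  decode-encode (eδ l) rewrite Fin.splitAt-↑ʳ (suc s) (suc t ℕ.+ (suc p ℕ.+ suc q)) (suc t ↑ʳ (suc p ↑ʳ l))
                             | Fin.splitAt-↑ʳ (suc t) (suc p ℕ.+ suc q) (suc p ↑ʳ l)
                             | Fin.splitAt-↑ʳ (suc p) (suc q) l = refl

  encode-decode : ∀ e → encode (decode e) ≡ e
  encode-decode e with splitAt (suc s) e in eq₁
  ... | inj₁ i = Fin.splitAt⁻¹-↑ˡ eq₁
  ... | inj₂ e₁ with splitAt (suc t) e₁ in eq₂
  ...   | inj₁ j = trans (cong (suc s ↑ʳ_) (Fin.splitAt⁻¹-↑ˡ eq₂)) (Fin.splitAt⁻¹-↑ʳ eq₁)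
  ...   | inj₂ e₂ with splitAt (suc p) e₂ in eq₃
  ...     | inj₁ k = trans (cong (λ z → suc s ↑ʳ (suc t ↑ʳ z)) (Fin.splitAt⁻¹-↑ˡ eq₃))
                       (trans (cong (suc s ↑ʳ_) (Fin.splitAt⁻¹-↑ʳ eq₂)) (Fin.splitAt⁻¹-↑ʳ eq₁))
  ...     | inj₂ l = trans (cong (λ z → suc s ↑ʳ (suc t ↑ʳ z)) (Fin.splitAt⁻¹-↑ʳ eq₃))
                       (trans (cong (suc s ↑ʳ_) (Fin.splitAt⁻¹-↑ʳ eq₂)) (Fin.splitAt⁻¹-↑ʳ eq₁))

  ends-encode : ∀ x → endsC s t p q (encode x) ≡ endpoints x
  ends-encode x = trans (ends-decode (encode x)) (cong endpoints (decode-encode x))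

  encode-injective : ∀ {x y} → encode x ≡ encode y → x ≡ y
  encode-injective {x} {y} eq = trans (sym (decode-encode x)) (trans (cong decode eq) (decode-encode y))

  data Shape : Set where
    paths    : Shape
    α-cutβ   : Fin (suc s) → Fin (suc p) → Shape
    γ-cutδ   : Fin (suc t) → Fin (suc q) → Shape
    αγ-cutβδ : Fin (suc s) → Fin (suc t) → Fin (suc p) → Fin (suc q) → Shape
    α-cutδ   : Fin (suc s) → Fin (suc q) → Shape

  αEdge : Shape → Maybe (Fin (suc s))
  αEdge (α-cutβ i _)       = just i
  αEdge (αγ-cutβδ i _ _ _) = just i
  αEdge (α-cutδ i _)       = just i
  αEdge _                  = nothing

  γEdge : Shape → Maybe (Fin (suc t))
  γEdge (γ-cutδ j _)       = just j
  γEdge (αγ-cutβδ _ j _ _) = just j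
  γEdge _                  = nothing

  βCut : Shape → Maybe (Fin (suc p))
  βCut (α-cutβ _ k)       = just k
  βCut (αγ-cutβδ _ _ k _) = just k
  βCut _                  = nothing

  δCut : Shape → Maybe (Fin (suc q))
  δCut (γ-cutδ _ l)       = just l
  δCut (αγ-cutβδ _ _ _ l) = just l
  δCut (α-cutδ _ l)       = just l
  δCut _                  = nothing

  inTree : Shape → Edge → Bool
  inTree σ (eα i) = selects (αEdge σ) i
  inTree σ (eγ j) = selects (γEdge σ) j
  inTree σ (eβ k) = not (selects (βCut σ) k)
  inTree σ (eδ l) = not (selects (δCut σ) l)

  tree : Shape → EdgeSet nE
  tree σ e = inTree σ (decode e)

  tree-encode : ∀ σ x → tree σ (encode x) ≡ inTree σ x
  tree-encode σ x = cong (inTree σ) (decode-encode x)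

module TreesAreBases (s t p q : ℕ) where

  open import Defs
  open Preliminaries
  open Forests
  open Selections
  open import Data.Nat as ℕ using (ℕ; zero; suc; z≤n; s≤s; _<_; _≤_; _∸_)
  import Data.Nat.Properties as ℕ
  open import Data.Fin as Fin using (Fin; zero; suc; inject₁; fromℕ; toℕ)
  import Data.Fin.Properties as Fin
  open import Data.Bool using (true; false; not)
  open import Data.Maybe using (Maybe; just; nothing)
  open import Data.Maybe.Properties using (just-injective)
  open import Data.Sum using (inj₁; inj₂)
  open import Data.Product using (Σ; _×_; _,_)
  open import Relation.Binary.PropositionalEquality
  open import Relation.Binary using (tri<; tri≈; tri>)
  open import Relation.Nullary using (¬_; contradiction)
  open import Relation.Nullary.Decidable using (toSum)
  open import Data.Fin.Relation.Unary.Top using (view; ‵fromℕ; ‵inject₁)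
  open GraphC s t p q

  private
    βstart βend δend : V × Fin nE
    βstart = uPath (suc zero) , encode (eβ zero)
    βend   = uPath (inject₁ (fromℕ p)) , encode (eβ (fromℕ p))
    δend   = wPath (inject₁ (fromℕ q)) , encode (eδ (fromℕ q))

    viaα : Fin (suc s) → V × Fin nE
    viaα i = v₂ , encode (eα i)

    viaγ : Fin (suc t) → V × Fin nE
    viaγ j = v₂ , encode (eγ j)

    h+[n∸n] : ∀ h n → h ℕ.+ (n ∸ n) ≡ h
    h+[n∸n] h n = trans (cong (h ℕ.+_) (ℕ.n∸n≡0 n)) (ℕ.+-identityʳ h)

    toℕ≤ : ∀ {n} (k : Fin (suc n)) → toℕ k ≤ n
    toℕ≤ k = ℕ.≤-pred (Fin.toℕ<n k)

    ≮toℕ : ∀ {n} (k : Fin (suc n)) → ¬ suc n < suc (toℕ k)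
    ≮toℕ k lt = ℕ.<⇒≱ (ℕ.≤-pred lt) (toℕ≤ k)

    not-last : ∀ {n} (m : Fin (suc n)) → suc (toℕ m) ≢ suc (suc n)
    not-last m eq = ℕ.<⇒≢ (Fin.toℕ<n m) (ℕ.suc-injective eq)

    cut-kept : ∀ {n} (k m : Fin n) → suc (toℕ m) ≢ suc (toℕ k) → not (selects (just k) m) ≡ true
    cut-kept k m m≢k rewrite selects-≢ {a = k} {m} (λ m≡k → m≢k (cong (λ i → ℕ.suc (toℕ i)) m≡k)) = refl

    cut-cut : ∀ {n} (k m : Fin n) → suc (toℕ m) ≡ suc (toℕ k) → not (selects (just k) m) ≡ false
    cut-cut k m eq rewrite Fin.toℕ-injective (ℕ.suc-injective eq) | selects-self k = refl

    via-selected : ∀ {n} {A : Set} (f : Fin n → A) {i i′} → selects (just i) i′ ≡ true → f i ≡ f i′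
    via-selected f sel = cong f (just-injective (selects⁻¹ sel))

  -- A spanning tree of C rooted at v₂: on the path v₁ u v₃ the vertices before position kβ
  -- hang towards v₁ and the others towards v₃, likewise on v₂ w v₃ with kδ; the edge at a
  -- turning point is the one left out of the tree.
  module Layout (σ : Shape) (kβ kδ h₃ : ℕ) (parent₁ parent₃ : V × Fin nE) where

    βHeight : ℕ → ℕ
    βHeight n = if< n kβ (suc n) (h₃ ℕ.+ (suc p ∸ n))

    δHeight : ℕ → ℕ
    δHeight n = if< n kδ n (h₃ ℕ.+ (suc q ∸ n))

    height : V → ℕ
    height v₁    = βHeight 0
    height v₂    = 0
    height v₃    = h₃
    height (u i) = βHeight (suc (toℕ i))
    height (w j) = δHeight (suc (toℕ j))

    parent : V → Maybe (V × Fin nE)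
    parent v₁    = just parent₁
    parent v₂    = nothing
    parent v₃    = just parent₃
    parent (u i) = if< (suc (toℕ i)) kβ (just (uPath (inject₁ (inject₁ i)) , encode (eβ (inject₁ i))))
                                        (just (uPath (suc (suc i)) , encode (eβ (suc i))))
    parent (w j) = if< (suc (toℕ j)) kδ (just (wPath (inject₁ (inject₁ j)) , encode (eδ (inject₁ j))))
                                        (just (wPath (suc (suc j)) , encode (eδ (suc j))))

    ParentEdge : V → Set
    ParentEdge v = ∀ x e → parent v ≡ just (x , e) →
      tree σ e ≡ true × IsEdgeBetween (C s t p q) e v x × height x < height v

    record Valid : Set where
      field
        kδ-positive : 1 ≤ kδ
        βHeight-v₃ : βHeight (suc p) ≡ h₃
        δHeight-v₃ : δHeight (suc q) ≡ h₃
        β-kept : ∀ k → suc (toℕ k) ≢ kβ → inTree σ (eβ k) ≡ true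
        β-cut  : ∀ k → suc (toℕ k) ≡ kβ → inTree σ (eβ k) ≡ false
        δ-kept : ∀ l → suc (toℕ l) ≢ kδ → inTree σ (eδ l) ≡ true
        δ-cut  : ∀ l → suc (toℕ l) ≡ kδ → inTree σ (eδ l) ≡ false
        parent₁-β : kβ ≡ 0 → parent₁ ≡ βstart
        parent₁-α : ∀ i → inTree σ (eα i) ≡ true → parent₁ ≡ viaα i
        parent₃-β : suc p < kβ → parent₃ ≡ βend
        parent₃-δ : suc q < kδ → parent₃ ≡ δend
        parent₃-γ : ∀ j → inTree σ (eγ j) ≡ true → parent₃ ≡ viaγ j
        parent₁-edge : ParentEdge v₁
        parent₃-edge : ParentEdge v₃

    height-uPath : βHeight (suc p) ≡ h₃ → ∀ j → height (uPath j) ≡ βHeight (toℕ j)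
    height-uPath βHeight-v₃ = pathSeq-along v₁ u v₃ height βHeight refl (λ _ → refl) (sym βHeight-v₃)

    height-wPath : 1 ≤ kδ → δHeight (suc q) ≡ h₃ → ∀ j → height (wPath j) ≡ δHeight (toℕ j)
    height-wPath kδ-positive δHeight-v₃ =
      pathSeq-along v₂ w v₃ height δHeight (sym (if<-yes kδ-positive)) (λ _ → refl) (sym δHeight-v₃)

    α-parent-edge : ∀ i → parent₁ ≡ viaα i → inTree σ (eα i) ≡ true → 0 < kβ → ParentEdge v₁
    α-parent-edge i refl i∈σ 0<kβ _ _ refl =
      trans (tree-encode σ (eα i)) i∈σ , inj₁ (ends-encode (eα i)) , subst (0 <_) (sym (if<-yes 0<kβ)) (s≤s z≤n)

    γ-parent-edge : ∀ j → parent₃ ≡ viaγ j → inTree σ (eγ j) ≡ true → 0 < h₃ → ParentEdge v₃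
    γ-parent-edge j refl j∈σ 0<h₃ _ _ refl = trans (tree-encode σ (eγ j)) j∈σ , inj₂ (ends-encode (eγ j)) , 0<h₃

    βstart-parent-edge : parent₁ ≡ βstart → kβ ≡ 0 → inTree σ (eβ zero) ≡ true → βHeight (suc p) ≡ h₃ →
      ParentEdge v₁
    βstart-parent-edge refl refl 0∈σ βHeight-v₃ _ _ refl =
      trans (tree-encode σ (eβ zero)) 0∈σ , inj₁ (ends-encode (eβ zero)) ,
      subst (_< height v₁) (sym (height-uPath βHeight-v₃ (suc zero)))
        (subst₂ _<_ (sym (if<-no (λ ()))) (sym (if<-no (λ ()))) (ℕ.+-monoʳ-< h₃ (ℕ.n<1+n p)))

    βend-parent-edge : parent₃ ≡ βend → kβ ≡ suc (suc p) → h₃ ≡ suc (suc p) →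
      inTree σ (eβ (fromℕ p)) ≡ true → ParentEdge v₃
    βend-parent-edge refl refl refl p∈σ _ _ refl =
      trans (tree-encode σ (eβ (fromℕ p))) p∈σ ,
      inj₂ (trans (ends-encode (eβ (fromℕ p))) (cong (uPath (inject₁ (fromℕ p)) ,_) (pathSeq-last v₁ u v₃))) ,
      subst (_< suc (suc p)) (sym (trans (height-uPath (if<-yes (ℕ.n<1+n (suc p))) (inject₁ (fromℕ p)))
                                         (cong βHeight (trans (Fin.toℕ-inject₁ (fromℕ p)) (Fin.toℕ-fromℕ p)))))
        (subst (_< suc (suc p)) (sym (if<-yes (ℕ.<-trans (ℕ.n<1+n p) (ℕ.n<1+n (suc p))))) (ℕ.n<1+n (suc p)))

    δend-parent-edge : parent₃ ≡ δend → kδ ≡ suc (suc q) → h₃ ≡ suc q →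
      inTree σ (eδ (fromℕ q)) ≡ true → ParentEdge v₃
    δend-parent-edge refl refl refl q∈σ _ _ refl =
      trans (tree-encode σ (eδ (fromℕ q))) q∈σ ,
      inj₂ (trans (ends-encode (eδ (fromℕ q))) (cong (wPath (inject₁ (fromℕ q)) ,_) (pathSeq-last v₂ w v₃))) ,
      subst (_< suc q) (sym (trans (height-wPath (s≤s z≤n) (if<-yes (ℕ.n<1+n (suc q))) (inject₁ (fromℕ q)))
                                   (cong δHeight (trans (Fin.toℕ-inject₁ (fromℕ q)) (Fin.toℕ-fromℕ q)))))
        (subst (_< suc q) (sym (if<-yes (ℕ.<-trans (ℕ.n<1+n q) (ℕ.n<1+n (suc q))))) (ℕ.n<1+n q))

    module _ (valid : Valid) where
      open Valid valid

      private
        i+1≢ : ∀ {n k} (i : Fin n) → suc (toℕ i) < k → suc (toℕ (inject₁ i)) ≢ k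
        i+1≢ i lt eq = ℕ.<⇒≢ lt (trans (cong suc (sym (Fin.toℕ-inject₁ i))) eq)

        i+2≢ : ∀ {n k} (i : Fin n) → ¬ suc (toℕ i) < k → suc (toℕ (suc i)) ≢ k
        i+2≢ i nlt eq = nlt (subst (suc (toℕ i) <_) eq (ℕ.n<1+n _))

        toℕ-inject₁² : ∀ {n} (i : Fin n) → toℕ (inject₁ (inject₁ i)) ≡ toℕ i
        toℕ-inject₁² i = trans (Fin.toℕ-inject₁ (inject₁ i)) (Fin.toℕ-inject₁ i)

        suc∸-step : ∀ {n} (i : Fin n) → suc n ∸ suc (suc (toℕ i)) < suc n ∸ suc (toℕ i)
        suc∸-step {n} i = ℕ.∸-monoʳ-< {m = n} (ℕ.n<1+n (toℕ i)) (Fin.toℕ<n i)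

      u-parent-edge : ∀ i → ParentEdge (u i)
      u-parent-edge i x e pu with toSum (suc (toℕ i) ℕ.<? kβ)
      ... | inj₁ lt with trans (sym (if<-yes lt)) pu
      ...   | refl = trans (tree-encode σ (eβ (inject₁ i))) (β-kept (inject₁ i) (i+1≢ i lt)) ,
                     inj₂ (trans (ends-encode (eβ (inject₁ i)))
                                 (cong (uPath (inject₁ (inject₁ i)) ,_) (pathSeq-inner v₁ u v₃ i))) ,
                     subst (_< height (u i))
                       (sym (trans (height-uPath βHeight-v₃ _) (cong βHeight (toℕ-inject₁² i))))
                       (subst₂ _<_ (sym (if<-yes (ℕ.<-trans (ℕ.n<1+n (toℕ i)) lt))) (sym (if<-yes lt)) (ℕ.n<1+n _))
      u-parent-edge i x e pu | inj₂ nlt with trans (sym (if<-no nlt)) pu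
      ...   | refl = trans (tree-encode σ (eβ (suc i))) (β-kept (suc i) (i+2≢ i nlt)) ,
                     inj₁ (trans (ends-encode (eβ (suc i))) (cong (_, uPath (suc (suc i))) (pathSeq-inner v₁ u v₃ i))) ,
                     subst (_< height (u i)) (sym (height-uPath βHeight-v₃ (suc (suc i))))
                       (subst₂ _<_ (sym (if<-no (λ lt → nlt (ℕ.<-trans (ℕ.n<1+n _) lt)))) (sym (if<-no nlt))
                         (ℕ.+-monoʳ-< h₃ (suc∸-step i)))

      w-parent-edge : ∀ j → ParentEdge (w j)
      w-parent-edge j x e pw with toSum (suc (toℕ j) ℕ.<? kδ)
      ... | inj₁ lt with trans (sym (if<-yes lt)) pw
      ...   | refl = trans (tree-encode σ (eδ (inject₁ j))) (δ-kept (inject₁ j) (i+1≢ j lt)) ,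
                     inj₂ (trans (ends-encode (eδ (inject₁ j)))
                                 (cong (wPath (inject₁ (inject₁ j)) ,_) (pathSeq-inner v₂ w v₃ j))) ,
                     subst (_< height (w j))
                       (sym (trans (height-wPath kδ-positive δHeight-v₃ _) (cong δHeight (toℕ-inject₁² j))))
                       (subst₂ _<_ (sym (if<-yes (ℕ.<-trans (ℕ.n<1+n (toℕ j)) lt))) (sym (if<-yes lt)) (ℕ.n<1+n _))
      w-parent-edge j x e pw | inj₂ nlt with trans (sym (if<-no nlt)) pw
      ...   | refl = trans (tree-encode σ (eδ (suc j))) (δ-kept (suc j) (i+2≢ j nlt)) ,
                     inj₁ (trans (ends-encode (eδ (suc j))) (cong (_, wPath (suc (suc j))) (pathSeq-inner v₂ w v₃ j))) ,
                     subst (_< height (w j)) (sym (height-wPath kδ-positive δHeight-v₃ (suc (suc j))))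
                       (subst₂ _<_ (sym (if<-no (λ lt → nlt (ℕ.<-trans (ℕ.n<1+n _) lt)))) (sym (if<-no nlt))
                         (ℕ.+-monoʳ-< h₃ (suc∸-step j)))

      orphan⇒v₂ : ∀ v → parent v ≡ nothing → v ≡ v₂
      orphan⇒v₂ v₂ _ = refl
      orphan⇒v₂ (u i) pu = contradiction pu if<-just
      orphan⇒v₂ (w j) pw = contradiction pw if<-just

      HasParentEdge : Edge → Set
      HasParentEdge x = Σ V λ v → Σ V λ y → parent v ≡ just (y , encode x)

      β-edge-parent : ∀ k → inTree σ (eβ k) ≡ true → HasParentEdge (eβ k)
      β-edge-parent k k∈σ with ℕ.<-cmp (suc (toℕ k)) kβ
      ... | tri≈ _ k+1≡kβ _ = contradiction (trans (sym k∈σ) (β-cut k k+1≡kβ)) true≢false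
      ... | tri< lt _ _ with view k
      ...   | ‵inject₁ i = u i , _ , if<-yes (subst (λ z → suc z < kβ) (Fin.toℕ-inject₁ i) lt)
      ...   | ‵fromℕ     = v₃ , _ , cong just (parent₃-β (subst (λ z → suc z < kβ) (Fin.toℕ-fromℕ p) lt))
      β-edge-parent zero    _ | tri> _ _ gt = v₁ , _ , cong just (parent₁-β (ℕ.n≤0⇒n≡0 (ℕ.≤-pred gt)))
      β-edge-parent (suc i) _ | tri> _ _ gt = u i , _ , if<-no (ℕ.<⇒≱ gt)

      δ-edge-parent : ∀ l → inTree σ (eδ l) ≡ true → HasParentEdge (eδ l)
      δ-edge-parent l l∈σ with ℕ.<-cmp (suc (toℕ l)) kδ
      ... | tri≈ _ l+1≡kδ _ = contradiction (trans (sym l∈σ) (δ-cut l l+1≡kδ)) true≢false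
      ... | tri< lt _ _ with view l
      ...   | ‵inject₁ j = w j , _ , if<-yes (subst (λ z → suc z < kδ) (Fin.toℕ-inject₁ j) lt)
      ...   | ‵fromℕ     = v₃ , _ , cong just (parent₃-δ (subst (λ z → suc z < kδ) (Fin.toℕ-fromℕ q) lt))
      δ-edge-parent zero    _ | tri> _ _ gt = contradiction kδ-positive (ℕ.<⇒≱ gt)
      δ-edge-parent (suc j) _ | tri> _ _ gt = w j , _ , if<-no (ℕ.<⇒≱ gt)

      edge-parent : ∀ x → inTree σ x ≡ true → HasParentEdge x
      edge-parent (eα i) i∈σ = v₁ , v₂ , cong just (parent₁-α i i∈σ)
      edge-parent (eγ j) j∈σ = v₃ , v₂ , cong just (parent₃-γ j j∈σ)
      edge-parent (eβ k) k∈σ = β-edge-parent k k∈σ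
      edge-parent (eδ l) l∈σ = δ-edge-parent l l∈σ

      certificate : TreeCertificate (C s t p q) (tree σ)
      certificate = record
        { height      = height
        ; root        = v₂
        ; parent      = parent
        ; parent-edge = λ where
            v₁    → parent₁-edge
            v₂    → λ _ _ ()
            v₃    → parent₃-edge
            (u i) → u-parent-edge i
            (w j) → w-parent-edge j
        ; orphan⇒root = orphan⇒v₂
        ; edge-parent = λ e e∈σ → subst (λ e′ → Σ V λ v → Σ V λ y → parent v ≡ just (y , e′))
                                        (encode-decode e) (edge-parent (decode e) e∈σ)
        }

  tree-basis : ∀ σ → IsBasis (C s t p q) (tree σ)
  tree-basis paths = certificate-basis (C s t p q) (certificate record
    { kδ-positive  = s≤s z≤n
    ; βHeight-v₃   = βHeight-v₃
    ; δHeight-v₃   = if<-yes (ℕ.n<1+n (suc q))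
    ; β-kept       = λ _ _ → refl
    ; β-cut        = λ _ ()
    ; δ-kept       = λ _ _ → refl
    ; δ-cut        = λ l eq → contradiction eq (not-last l)
    ; parent₁-β    = λ _ → refl
    ; parent₁-α    = λ _ ()
    ; parent₃-β    = λ ()
    ; parent₃-δ    = λ _ → refl
    ; parent₃-γ    = λ _ ()
    ; parent₁-edge = βstart-parent-edge refl refl refl βHeight-v₃
    ; parent₃-edge = δend-parent-edge refl refl refl refl
    })
    where
    open Layout paths 0 (suc (suc q)) (suc q) βstart δend
    βHeight-v₃ : βHeight (suc p) ≡ suc q
    βHeight-v₃ = trans (if<-no (λ ())) (h+[n∸n] (suc q) (suc p))
  tree-basis σ@(α-cutβ i k) = certificate-basis (C s t p q) (certificate record
    { kδ-positive  = s≤s z≤n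
    ; βHeight-v₃   = βHeight-v₃
    ; δHeight-v₃   = if<-yes (ℕ.n<1+n (suc q))
    ; β-kept       = cut-kept k
    ; β-cut        = cut-cut k
    ; δ-kept       = λ _ _ → refl
    ; δ-cut        = λ l eq → contradiction eq (not-last l)
    ; parent₁-β    = λ ()
    ; parent₁-α    = λ _ → via-selected viaα
    ; parent₃-β    = λ lt → contradiction lt (≮toℕ k)
    ; parent₃-δ    = λ _ → refl
    ; parent₃-γ    = λ _ ()
    ; parent₁-edge = α-parent-edge i refl (selects-self i) (s≤s z≤n)
    ; parent₃-edge = δend-parent-edge refl refl refl refl
    })
    where
    open Layout σ (suc (toℕ k)) (suc (suc q)) (suc q) (viaα i) δend
    βHeight-v₃ : βHeight (suc p) ≡ suc q
    βHeight-v₃ = trans (if<-no (≮toℕ k)) (h+[n∸n] (suc q) (suc p))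
  tree-basis σ@(γ-cutδ j l) = certificate-basis (C s t p q) (certificate record
    { kδ-positive  = s≤s z≤n
    ; βHeight-v₃   = βHeight-v₃
    ; δHeight-v₃   = trans (if<-no (≮toℕ l)) (h+[n∸n] 1 (suc q))
    ; β-kept       = λ _ _ → refl
    ; β-cut        = λ _ ()
    ; δ-kept       = cut-kept l
    ; δ-cut        = cut-cut l
    ; parent₁-β    = λ _ → refl
    ; parent₁-α    = λ _ ()
    ; parent₃-β    = λ ()
    ; parent₃-δ    = λ lt → contradiction lt (≮toℕ l)
    ; parent₃-γ    = λ _ → via-selected viaγ
    ; parent₁-edge = βstart-parent-edge refl refl refl βHeight-v₃
    ; parent₃-edge = γ-parent-edge j refl (selects-self j) (s≤s z≤n)
    })
    where
    open Layout σ 0 (suc (toℕ l)) 1 βstart (viaγ j)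
    βHeight-v₃ : βHeight (suc p) ≡ 1
    βHeight-v₃ = trans (if<-no (λ ())) (h+[n∸n] 1 (suc p))
  tree-basis σ@(αγ-cutβδ i j k l) = certificate-basis (C s t p q) (certificate record
    { kδ-positive  = s≤s z≤n
    ; βHeight-v₃   = trans (if<-no (≮toℕ k)) (h+[n∸n] 1 (suc p))
    ; δHeight-v₃   = trans (if<-no (≮toℕ l)) (h+[n∸n] 1 (suc q))
    ; β-kept       = cut-kept k
    ; β-cut        = cut-cut k
    ; δ-kept       = cut-kept l
    ; δ-cut        = cut-cut l
    ; parent₁-β    = λ ()
    ; parent₁-α    = λ _ → via-selected viaα
    ; parent₃-β    = λ lt → contradiction lt (≮toℕ k)
    ; parent₃-δ    = λ lt → contradiction lt (≮toℕ l)
    ; parent₃-γ    = λ _ → via-selected viaγ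
    ; parent₁-edge = α-parent-edge i refl (selects-self i) (s≤s z≤n)
    ; parent₃-edge = γ-parent-edge j refl (selects-self j) (s≤s z≤n)
    })
    where
    open Layout σ (suc (toℕ k)) (suc (toℕ l)) 1 (viaα i) (viaγ j)
  tree-basis σ@(α-cutδ i l) = certificate-basis (C s t p q) (certificate record
    { kδ-positive  = s≤s z≤n
    ; βHeight-v₃   = if<-yes (ℕ.n<1+n (suc p))
    ; δHeight-v₃   = trans (if<-no (≮toℕ l)) (h+[n∸n] (suc (suc p)) (suc q))
    ; β-kept       = λ _ _ → refl
    ; β-cut        = λ k eq → contradiction eq (not-last k)
    ; δ-kept       = cut-kept l
    ; δ-cut        = cut-cut l
    ; parent₁-β    = λ ()
    ; parent₁-α    = λ _ → via-selected viaα
    ; parent₃-β    = λ _ → refl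
    ; parent₃-δ    = λ lt → contradiction lt (≮toℕ l)
    ; parent₃-γ    = λ _ ()
    ; parent₁-edge = α-parent-edge i refl (selects-self i) (s≤s z≤n)
    ; parent₃-edge = βend-parent-edge refl refl refl refl
    })
    where
    open Layout σ (suc (suc p)) (suc (toℕ l)) (suc (suc p)) (viaα i) βend

module BasesAreTrees (s t p q : ℕ) (B : EdgeSet (nEdges s t p q)) (B-basis : IsBasis (C s t p q) B) where

  open import Defs
  open Preliminaries
  open Forests
  open Selections
  open import Data.Nat as ℕ using (ℕ; zero; suc; z≤n; s≤s; _<_; _≤_)
  import Data.Nat.Properties as ℕ
  open import Data.Fin as Fin using (Fin; zero; suc; inject₁; toℕ)
  import Data.Fin.Properties as Fin
  open import Data.Bool as Bool using (Bool; true; false; not)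
  open import Data.Bool.Properties using (not-involutive)
  open import Data.Empty using (⊥; ⊥-elim)
  open import Data.Maybe using (Maybe; just; nothing)
  open import Data.Product using (Σ; _,_; proj₁; proj₂)
  open import Relation.Binary.PropositionalEquality
  open import Relation.Nullary using (¬_; yes; no; contradiction)
  open import Function using (_∘_)
  open GraphC s t p q

  private
    graph = C s t p q
    B-acyclic = proj₁ B-basis
    B-maximal = proj₂ B-basis

  inB : Edge → Bool
  inB x = B (encode x)

  B-decode : ∀ e → B e ≡ inB (decode e)
  B-decode e = cong B (sym (encode-decode e))

  Joins : EdgeSet nE → Edge → Set
  Joins H x = Conn graph H (proj₁ (endpoints x)) (proj₂ (endpoints x))

  no-cycle : ∀ x → inB x ≡ true → ¬ Joins (remove graph B (encode x)) x
  no-cycle x x∈B c =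
    B-acyclic (encode x) x∈B (subst (λ e → Conn graph (remove graph B (encode x)) (proj₁ e) (proj₂ e)) (sym (ends-encode x)) c)

  edge-joins : ∀ {H} x → H (encode x) ≡ true → Joins H x
  edge-joins x x∈H = fwd (encode x) x∈H (ends-encode x) here

  inB-remove : ∀ x y → inB y ≡ true → y ≢ x → remove graph B (encode x) (encode y) ≡ true
  inB-remove x y y∈B y≢x = remove⁺ graph B (encode x) (encode y) y∈B (y≢x ∘ encode-injective)

  uPath-conn : ∀ {H} → (∀ k → H (encode (eβ k)) ≡ true) → Conn graph H v₁ v₃
  uPath-conn {H} all∈H = subst (Conn graph H v₁) (pathSeq-last v₁ u v₃) (Conn-path graph uPath (λ k → edge-joins (eβ k) (all∈H k)))

  wPath-conn : ∀ {H} → (∀ l → H (encode (eδ l)) ≡ true) → Conn graph H v₂ v₃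
  wPath-conn {H} all∈H = subst (Conn graph H v₂) (pathSeq-last v₂ w v₃) (Conn-path graph wPath (λ l → edge-joins (eδ l) (all∈H l)))

  -- As B is
  -- a maximal forest, a colouring that is constant along B is constant along every edge
  -- (agrees-outside), so exhibiting one that is not rules out an edge pattern.
  module Labelling (ℓ₁ ℓ₂ ℓ₃ : Bool) (ℓu ℓw : ℕ → Bool)
                   (ℓu-v₁ : ℓu 0 ≡ ℓ₁) (ℓu-v₃ : ℓu (suc p) ≡ ℓ₃) (ℓw-v₂ : ℓw 0 ≡ ℓ₂) (ℓw-v₃ : ℓw (suc q) ≡ ℓ₃) where

    ℓ : V → Bool
    ℓ v₁    = ℓ₁
    ℓ v₂    = ℓ₂
    ℓ v₃    = ℓ₃
    ℓ (u i) = ℓu (suc (toℕ i))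
    ℓ (w j) = ℓw (suc (toℕ j))

    ℓ-uPath : ∀ j → ℓ (uPath j) ≡ ℓu (toℕ j)
    ℓ-uPath = pathSeq-along v₁ u v₃ ℓ ℓu (sym ℓu-v₁) (λ _ → refl) (sym ℓu-v₃)

    ℓ-wPath : ∀ j → ℓ (wPath j) ≡ ℓw (toℕ j)
    ℓ-wPath = pathSeq-along v₂ w v₃ ℓ ℓw (sym ℓw-v₂) (λ _ → refl) (sym ℓw-v₃)

    Agrees : Edge → Set
    Agrees x = ℓ (proj₁ (endpoints x)) ≡ ℓ (proj₂ (endpoints x))

    ℓ-β-start : ∀ k → ℓ (uPath (inject₁ k)) ≡ ℓu (toℕ k)
    ℓ-β-start k = trans (ℓ-uPath (inject₁ k)) (cong ℓu (Fin.toℕ-inject₁ k))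

    ℓ-δ-start : ∀ l → ℓ (wPath (inject₁ l)) ≡ ℓw (toℕ l)
    ℓ-δ-start l = trans (ℓ-wPath (inject₁ l)) (cong ℓw (Fin.toℕ-inject₁ l))

    β-agrees : ∀ k → Agrees (eβ k) → ℓu (toℕ k) ≡ ℓu (suc (toℕ k))
    β-agrees k agree = trans (sym (ℓ-β-start k)) (trans agree (ℓ-uPath (suc k)))

    δ-agrees : ∀ l → Agrees (eδ l) → ℓw (toℕ l) ≡ ℓw (suc (toℕ l))
    δ-agrees l agree = trans (sym (ℓ-δ-start l)) (trans agree (ℓ-wPath (suc l)))

    constantOn-B : (∀ i → inB (eα i) ≡ true → ℓ₁ ≡ ℓ₂) → (∀ j → inB (eγ j) ≡ true → ℓ₂ ≡ ℓ₃) →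
      (∀ k → inB (eβ k) ≡ true → ℓu (toℕ k) ≡ ℓu (suc (toℕ k))) →
      (∀ l → inB (eδ l) ≡ true → ℓw (toℕ l) ≡ ℓw (suc (toℕ l))) → ConstantOn graph B ℓ
    constantOn-B α-steps γ-steps β-steps δ-steps e e∈B =
      subst (λ ends → ℓ (proj₁ ends) ≡ ℓ (proj₂ ends)) (sym (ends-decode e))
            (agrees (decode e) (trans (sym (B-decode e)) e∈B))
      where
      agrees : ∀ x → inB x ≡ true → Agrees x
      agrees (eα i) i∈B = α-steps i i∈B
      agrees (eγ j) j∈B = γ-steps j j∈B
      agrees (eβ k) k∈B = trans (ℓ-β-start k) (trans (β-steps k k∈B) (sym (ℓ-uPath (suc k))))
      agrees (eδ l) l∈B = trans (ℓ-δ-start l) (trans (δ-steps l l∈B) (sym (ℓ-wPath (suc l))))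

    agrees-outside : ConstantOn graph B ℓ → ∀ x → inB x ≡ false → Agrees x
    agrees-outside ℓ-const x x∉B with ℓ (proj₁ (endpoints x)) Bool.≟ ℓ (proj₂ (endpoints x))
    ... | yes agree   = agree
    ... | no disagree = ⊥-elim (B-maximal (encode x) x∉B
      (Acyclic-insert graph B (encode x) ℓ B-acyclic ℓ-const
        (disagree ∘ subst (λ ends → ℓ (proj₁ ends) ≡ ℓ (proj₂ ends)) (ends-encode x))))

  private
    between : ℕ → ℕ → ℕ → Bool
    between a b n = if< a n (if< b n false true) false

    upTo above : ℕ → ℕ → Bool
    upTo  k n = if< k n false true
    above k n = if< k n true false

    none : ℕ → Bool
    none _ = false

    between-step : ∀ {a b m} → m ≢ a → m ≢ b → between a b m ≡ between a b (suc m)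
    between-step {a} {b} {m} m≢a m≢b =
      trans (if<-step m≢a) (cong (λ z → if< a (suc m) z false) (if<-step m≢b))

    toℕ-≢ : ∀ {n} {x y : Fin n} → x ≢ y → toℕ x ≢ toℕ y
    toℕ-≢ x≢y = x≢y ∘ Fin.toℕ-injective

    other : ∀ {x y} → inB x ≡ true → inB y ≡ false → x ≢ y
    other x∈B y∉B refl = true≢false (trans (sym x∈B) y∉B)

    β-other : ∀ {k m} → inB (eβ m) ≡ true → inB (eβ k) ≡ false → toℕ m ≢ toℕ k
    β-other m∈B k∉B = toℕ-≢ (other m∈B k∉B ∘ cong eβ)

    δ-other : ∀ {l m} → inB (eδ m) ≡ true → inB (eδ l) ≡ false → toℕ m ≢ toℕ l
    δ-other m∈B l∉B = toℕ-≢ (other m∈B l∉B ∘ cong eδ)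

  β-missing-apart : ∀ k k′ → toℕ k < toℕ k′ → inB (eβ k) ≡ false → inB (eβ k′) ≡ false → ⊥
  β-missing-apart k k′ k<k′ k∉B k′∉B = true≢false (sym (begin
    false                                   ≡⟨ sym (if<-no (ℕ.<-irrefl refl)) ⟩
    between (toℕ k) (toℕ k′) (toℕ k)        ≡⟨ β-agrees k (agrees-outside B-constant (eβ k) k∉B) ⟩
    between (toℕ k) (toℕ k′) (suc (toℕ k))  ≡⟨ k+1-inside ⟩
    true                                    ∎))
    where
    open ≡-Reasoning
    open Labelling false false false (between (toℕ k) (toℕ k′)) none
                   (if<-no ℕ.n≮0) (trans (if<-yes (Fin.toℕ<n k)) (if<-yes (Fin.toℕ<n k′))) refl refl
    B-constant : ConstantOn graph B ℓ
    B-constant = constantOn-B (λ _ _ → refl) (λ _ _ → refl)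
      (λ m m∈B → between-step (β-other m∈B k∉B) (β-other m∈B k′∉B)) (λ _ _ → refl)
    k+1-inside : between (toℕ k) (toℕ k′) (suc (toℕ k)) ≡ true
    k+1-inside = trans (if<-yes (ℕ.n<1+n _)) (if<-no (λ k′<k+1 → ℕ.<⇒≱ k<k′ (ℕ.≤-pred k′<k+1)))

  δ-missing-apart : ∀ l l′ → toℕ l < toℕ l′ → inB (eδ l) ≡ false → inB (eδ l′) ≡ false → ⊥
  δ-missing-apart l l′ l<l′ l∉B l′∉B = true≢false (sym (begin
    false                                   ≡⟨ sym (if<-no (ℕ.<-irrefl refl)) ⟩
    between (toℕ l) (toℕ l′) (toℕ l)        ≡⟨ δ-agrees l (agrees-outside B-constant (eδ l) l∉B) ⟩
    between (toℕ l) (toℕ l′) (suc (toℕ l))  ≡⟨ l+1-inside ⟩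
    true                                    ∎))
    where
    open ≡-Reasoning
    open Labelling false false false none (between (toℕ l) (toℕ l′))
                   refl refl (if<-no ℕ.n≮0) (trans (if<-yes (Fin.toℕ<n l)) (if<-yes (Fin.toℕ<n l′)))
    B-constant : ConstantOn graph B ℓ
    B-constant = constantOn-B (λ _ _ → refl) (λ _ _ → refl) (λ _ _ → refl)
      (λ m m∈B → between-step (δ-other m∈B l∉B) (δ-other m∈B l′∉B))
    l+1-inside : between (toℕ l) (toℕ l′) (suc (toℕ l)) ≡ true
    l+1-inside = trans (if<-yes (ℕ.n<1+n _)) (if<-no (λ l′<l+1 → ℕ.<⇒≱ l<l′ (ℕ.≤-pred l′<l+1)))

  β-missing⇒α : ∀ k → inB (eβ k) ≡ false → (∀ i → inB (eα i) ≡ false) → ⊥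
  β-missing⇒α k k∉B no-α = contradiction (agrees-outside B-constant (eα zero) (no-α zero)) λ ()
    where
    open Labelling true false false (upTo (toℕ k)) none (if<-no ℕ.n≮0) (if<-yes (Fin.toℕ<n k)) refl refl
    B-constant : ConstantOn graph B ℓ
    B-constant = constantOn-B (λ i i∈B → contradiction (trans (sym i∈B) (no-α i)) true≢false) (λ _ _ → refl)
      (λ m m∈B → if<-step (β-other m∈B k∉B)) (λ _ _ → refl)

  βδ-missing⇒γ : ∀ k l → inB (eβ k) ≡ false → inB (eδ l) ≡ false → (∀ j → inB (eγ j) ≡ false) → ⊥
  βδ-missing⇒γ k l k∉B l∉B no-γ = contradiction (agrees-outside B-constant (eγ zero) (no-γ zero)) λ ()
    where
    open Labelling false false true (above (toℕ k)) (above (toℕ l))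
                         (if<-no ℕ.n≮0) (if<-yes (Fin.toℕ<n k)) (if<-no ℕ.n≮0) (if<-yes (Fin.toℕ<n l))
    B-constant : ConstantOn graph B ℓ
    B-constant = constantOn-B (λ _ _ → refl) (λ j j∈B → contradiction (trans (sym j∈B) (no-γ j)) true≢false)
      (λ m m∈B → if<-step (β-other m∈B k∉B)) (λ m m∈B → if<-step (δ-other m∈B l∉B))

  δ-missing⇒αγ : ∀ l → inB (eδ l) ≡ false → (∀ i → inB (eα i) ≡ false) → (∀ j → inB (eγ j) ≡ false) → ⊥
  δ-missing⇒αγ l l∉B no-α no-γ = contradiction (agrees-outside B-constant (eα zero) (no-α zero)) λ ()
    where
    open Labelling false true false none (upTo (toℕ l)) refl refl (if<-no ℕ.n≮0) (if<-yes (Fin.toℕ<n l))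
    B-constant : ConstantOn graph B ℓ
    B-constant = constantOn-B (λ i i∈B → contradiction (trans (sym i∈B) (no-α i)) true≢false)
      (λ j j∈B → contradiction (trans (sym j∈B) (no-γ j)) true≢false)
      (λ _ _ → refl) (λ m m∈B → if<-step (δ-other m∈B l∉B))

  α-unique : ∀ i i′ → inB (eα i) ≡ true → inB (eα i′) ≡ true → i ≡ i′
  α-unique i i′ i∈B i′∈B with i Fin.≟ i′
  ... | yes i≡i′ = i≡i′
  ... | no i≢i′  = ⊥-elim (no-cycle (eα i) i∈B (edge-joins (eα i′) (inB-remove (eα i) (eα i′) i′∈B λ { refl → i≢i′ refl })))

  γ-unique : ∀ j j′ → inB (eγ j) ≡ true → inB (eγ j′) ≡ true → j ≡ j′
  γ-unique j j′ j∈B j′∈B with j Fin.≟ j′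
  ... | yes j≡j′ = j≡j′
  ... | no j≢j′  = ⊥-elim (no-cycle (eγ j) j∈B (edge-joins (eγ j′) (inB-remove (eγ j) (eγ j′) j′∈B λ { refl → j≢j′ refl })))

  γ⇒δ-missing : ∀ j → inB (eγ j) ≡ true → (∀ l → inB (eδ l) ≡ true) → ⊥
  γ⇒δ-missing j j∈B all-δ = no-cycle (eγ j) j∈B (wPath-conn (λ l → inB-remove (eγ j) (eδ l) (all-δ l) (λ ())))

  α⇒βδ-missing : ∀ i → inB (eα i) ≡ true → (∀ k → inB (eβ k) ≡ true) → (∀ l → inB (eδ l) ≡ true) → ⊥
  α⇒βδ-missing i i∈B all-β all-δ = no-cycle (eα i) i∈B
    (Conn-trans graph (uPath-conn (λ k → inB-remove (eα i) (eβ k) (all-β k) (λ ())))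
                      (Conn-sym graph (wPath-conn (λ l → inB-remove (eα i) (eδ l) (all-δ l) (λ ())))))

  αγ⇒β-missing : ∀ i j → inB (eα i) ≡ true → inB (eγ j) ≡ true → (∀ k → inB (eβ k) ≡ true) → ⊥
  αγ⇒β-missing i j i∈B j∈B all-β = no-cycle (eα i) i∈B
    (Conn-trans graph (uPath-conn (λ k → inB-remove (eα i) (eβ k) (all-β k) (λ ())))
                      (Conn-sym graph (edge-joins (eγ j) (inB-remove (eα i) (eγ j) j∈B (λ ())))))

  private
    not-true : ∀ {b} → not b ≡ true → b ≡ false
    not-true {false} _ = refl

    not-false : ∀ {b} → not b ≡ false → b ≡ true
    not-false {true} _ = refl

  αSelection : Σ (Maybe (Fin (suc s))) λ m → ∀ i → inB (eα i) ≡ selects m i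
  αSelection = selection (inB ∘ eα) α-unique

  γSelection : Σ (Maybe (Fin (suc t))) λ m → ∀ j → inB (eγ j) ≡ selects m j
  γSelection = selection (inB ∘ eγ) γ-unique

  βCutSelection : Σ (Maybe (Fin (suc p))) λ m → ∀ k → not (inB (eβ k)) ≡ selects m k
  βCutSelection = selection (not ∘ inB ∘ eβ) (unique-by-order _ λ k k′ k<k′ k∉B k′∉B →
    β-missing-apart k k′ k<k′ (not-true k∉B) (not-true k′∉B))

  δCutSelection : Σ (Maybe (Fin (suc q))) λ m → ∀ l → not (inB (eδ l)) ≡ selects m l
  δCutSelection = selection (not ∘ inB ∘ eδ) (unique-by-order _ λ l l′ l<l′ l∉B l′∉B →
    δ-missing-apart l l′ l<l′ (not-true l∉B) (not-true l′∉B))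

  B≡tree : ∀ σ → (∀ i → inB (eα i) ≡ selects (αEdge σ) i) → (∀ j → inB (eγ j) ≡ selects (γEdge σ) j) →
    (∀ k → not (inB (eβ k)) ≡ selects (βCut σ) k) → (∀ l → not (inB (eδ l)) ≡ selects (δCut σ) l) →
    ∀ e → B e ≡ tree σ e
  B≡tree σ α≡ γ≡ β≡ δ≡ e = trans (B-decode e) (agree (decode e))
    where
    agree : ∀ x → inB x ≡ inTree σ x
    agree (eα i) = α≡ i
    agree (eγ j) = γ≡ j
    agree (eβ k) = trans (sym (not-involutive _)) (cong not (β≡ k))
    agree (eδ l) = trans (sym (not-involutive _)) (cong not (δ≡ l))

  basis-tree : Σ Shape λ σ → ∀ e → B e ≡ tree σ e
  basis-tree with αSelection | γSelection | βCutSelection | δCutSelection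
  ... | nothing , α≡ | _ , γ≡ | just k , β≡ | _ , δ≡ =
    ⊥-elim (β-missing⇒α k (not-true (trans (β≡ k) (selects-self k))) α≡)
  ... | nothing , α≡ | nothing , γ≡ | nothing , β≡ | nothing , δ≡ = paths , B≡tree paths α≡ γ≡ β≡ δ≡
  ... | nothing , α≡ | nothing , γ≡ | nothing , β≡ | just l , δ≡ =
    ⊥-elim (δ-missing⇒αγ l (not-true (trans (δ≡ l) (selects-self l))) α≡ γ≡)
  ... | _ , α≡ | just j , γ≡ | _ , β≡ | nothing , δ≡ =
    ⊥-elim (γ⇒δ-missing j (trans (γ≡ j) (selects-self j)) (not-false ∘ δ≡))
  ... | nothing , α≡ | just j , γ≡ | nothing , β≡ | just l , δ≡ = γ-cutδ j l , B≡tree (γ-cutδ j l) α≡ γ≡ β≡ δ≡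
  ... | just i , α≡ | nothing , γ≡ | nothing , β≡ | nothing , δ≡ =
    ⊥-elim (α⇒βδ-missing i (trans (α≡ i) (selects-self i)) (not-false ∘ β≡) (not-false ∘ δ≡))
  ... | just i , α≡ | nothing , γ≡ | nothing , β≡ | just l , δ≡ = α-cutδ i l , B≡tree (α-cutδ i l) α≡ γ≡ β≡ δ≡
  ... | just i , α≡ | just j , γ≡ | nothing , β≡ | just l , δ≡ =
    ⊥-elim (αγ⇒β-missing i j (trans (α≡ i) (selects-self i)) (trans (γ≡ j) (selects-self j)) (not-false ∘ β≡))
  ... | just i , α≡ | nothing , γ≡ | just k , β≡ | nothing , δ≡ = α-cutβ i k , B≡tree (α-cutβ i k) α≡ γ≡ β≡ δ≡
  ... | just i , α≡ | nothing , γ≡ | just k , β≡ | just l , δ≡ =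
    ⊥-elim (βδ-missing⇒γ k l (not-true (trans (β≡ k) (selects-self k))) (not-true (trans (δ≡ l) (selects-self l))) γ≡)
  ... | just i , α≡ | just j , γ≡ | just k , β≡ | just l , δ≡ =
    αγ-cutβδ i j k l , B≡tree (αγ-cutβδ i j k l) α≡ γ≡ β≡ δ≡

module PosetW (s t p q : ℕ) where

  open import Defs
  open Preliminaries
  open FiniteSums
  open import Data.Nat as ℕ using (ℕ; zero; suc; z≤n; s≤s)
  import Data.Nat.Properties as ℕ
  open import Data.Fin as Fin using (Fin; zero; suc; toℕ; splitAt; _↑ˡ_; _↑ʳ_)
  import Data.Fin.Properties as Fin
  open import Data.Maybe as Maybe using (Maybe; just; nothing; maybe)
  open import Data.Sum using (inj₁; inj₂)
  open import Data.Product using (_,_)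
  open import Data.Rational using (ℚ; 0ℚ; 1ℚ; _+_; _*_; _-_; -_)
  open import Data.Rational.Properties using (*-zeroˡ; +-identityʳ)
  open import Data.Rational.Solver
  open import Relation.Binary.PropositionalEquality

  open +-*-Solver using (solve; _:=_; _:+_; _:*_; _:-_; :-_; con)
  open GraphC s t p q

  nW′ : ℕ
  nW′ = nW s t p q

  encodeW : WElt s t p q → Fin nW′
  encodeW μ₁    = zero
  encodeW μ₂    = suc zero
  encodeW μ₃    = suc (suc zero)
  encodeW (α i) = suc (suc (suc (i ↑ˡ (p ℕ.+ (t ℕ.+ q)))))
  encodeW (β i) = suc (suc (suc (s ↑ʳ (i ↑ˡ (t ℕ.+ q)))))
  encodeW (γ i) = suc (suc (suc (s ↑ʳ (p ↑ʳ (i ↑ˡ q)))))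
  encodeW (δ i) = suc (suc (suc (s ↑ʳ (p ↑ʳ (t ↑ʳ i)))))

  decodeW-encodeW : ∀ x → decodeW s t p q (encodeW x) ≡ x
  decodeW-encodeW μ₁ = refl
  decodeW-encodeW μ₂ = refl
  decodeW-encodeW μ₃ = refl
  decodeW-encodeW (α i) rewrite Fin.splitAt-↑ˡ s i (p ℕ.+ (t ℕ.+ q)) = refl
  decodeW-encodeW (β i) rewrite Fin.splitAt-↑ʳ s (p ℕ.+ (t ℕ.+ q)) (i ↑ˡ (t ℕ.+ q))
                              | Fin.splitAt-↑ˡ p i (t ℕ.+ q) = refl
  decodeW-encodeW (γ i) rewrite Fin.splitAt-↑ʳ s (p ℕ.+ (t ℕ.+ q)) (p ↑ʳ (i ↑ˡ q))
                              | Fin.splitAt-↑ʳ p (t ℕ.+ q) (i ↑ˡ q)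
                              | Fin.splitAt-↑ˡ t i q = refl
  decodeW-encodeW (δ i) rewrite Fin.splitAt-↑ʳ s (p ℕ.+ (t ℕ.+ q)) (p ↑ʳ (t ↑ʳ i))
                              | Fin.splitAt-↑ʳ p (t ℕ.+ q) (t ↑ʳ i)
                              | Fin.splitAt-↑ʳ t q i = refl

  encodeW-decodeW : ∀ a → encodeW (decodeW s t p q a) ≡ a
  encodeW-decodeW zero             = refl
  encodeW-decodeW (suc zero)       = refl
  encodeW-decodeW (suc (suc zero)) = refl
  encodeW-decodeW (suc (suc (suc a₁))) with splitAt s a₁ in eq₁
  ... | inj₁ i = cong (λ z → suc (suc (suc z))) (Fin.splitAt⁻¹-↑ˡ eq₁)
  ... | inj₂ a₂ with splitAt p a₂ in eq₂
  ...   | inj₁ i = cong (λ z → suc (suc (suc z))) (trans (cong (s ↑ʳ_) (Fin.splitAt⁻¹-↑ˡ eq₂)) (Fin.splitAt⁻¹-↑ʳ eq₁))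
  ...   | inj₂ a₃ with splitAt t a₃ in eq₃
  ...     | inj₁ i = cong (λ z → suc (suc (suc z))) (trans (cong (λ z → s ↑ʳ (p ↑ʳ z)) (Fin.splitAt⁻¹-↑ˡ eq₃))
                       (trans (cong (s ↑ʳ_) (Fin.splitAt⁻¹-↑ʳ eq₂)) (Fin.splitAt⁻¹-↑ʳ eq₁)))
  ...     | inj₂ i = cong (λ z → suc (suc (suc z))) (trans (cong (λ z → s ↑ʳ (p ↑ʳ z)) (Fin.splitAt⁻¹-↑ʳ eq₃))
                       (trans (cong (s ↑ʳ_) (Fin.splitAt⁻¹-↑ʳ eq₂)) (Fin.splitAt⁻¹-↑ʳ eq₁)))

  -- Position n on the chains μ₁ α₁ … α_s, μ₁ β₁ … β_p μ₂, μ₃ γ₁ … γ_t μ₂ and μ₃ δ₁ … δ_q;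
  -- past the end of the first and last chain, nothing stands for the coordinate 0.
  αPos βPos γPos δPos : ℕ → Maybe (WElt s t p q)
  αPos zero    = just μ₁
  αPos (suc n) = Maybe.map α (fin? s n)
  βPos zero    = just μ₁
  βPos (suc n) = just (maybe β μ₂ (fin? p n))
  γPos zero    = just μ₃
  γPos (suc n) = just (maybe γ μ₂ (fin? t n))
  δPos zero    = just μ₃
  δPos (suc n) = Maybe.map δ (fin? q n)

  value : Point nW′ → Maybe (WElt s t p q) → ℚ
  value y nothing  = 0ℚ
  value y (just x) = y (encodeW x)

  coordinate : Maybe (WElt s t p q) → Fin nW′ → ℚ
  coordinate nothing  a = 0ℚ
  coordinate (just x) a = indicator (encodeW x) a

  sumFin-coordinate : ∀ y mx → sumFin nW′ (λ a → coordinate mx a * y a) ≡ value y mx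
  sumFin-coordinate y nothing  = trans (sumFin-cong nW′ (λ a → *-zeroˡ (y a))) (sumFin-zero nW′)
  sumFin-coordinate y (just x) = sumFin-indicator nW′ (encodeW x) y

  -- toEdges takes differences of consecutive coordinates along the chains, and 1 − (difference)
  -- on the two paths of C, where a tree misses an edge rather than contains one.
  plus minus : Edge → Maybe (WElt s t p q)
  plus  (eα i) = αPos (toℕ i)
  plus  (eγ j) = γPos (toℕ j)
  plus  (eβ k) = βPos (suc (toℕ k))
  plus  (eδ l) = δPos (suc (toℕ l))
  minus (eα i) = αPos (suc (toℕ i))
  minus (eγ j) = γPos (suc (toℕ j))
  minus (eβ k) = βPos (toℕ k)
  minus (eδ l) = δPos (toℕ l)

  offset : Edge → ℚ
  offset (eα _) = 0ℚ
  offset (eγ _) = 0ℚ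
  offset (eβ _) = 1ℚ
  offset (eδ _) = 1ℚ

  toEdges : AffineMap nW′ nE
  toEdges = record
    { A = λ e a → coordinate (plus (decode e)) a - coordinate (minus (decode e)) a
    ; b = λ e → offset (decode e)
    }

  edgeValue : Point nW′ → Edge → ℚ
  edgeValue y x = (value y (plus x) - value y (minus x)) + offset x

  apply-toEdges : ∀ y e → AffineMap.apply toEdges y e ≡ edgeValue y (decode e)
  apply-toEdges y e = cong (_+ offset x) (begin
    sumFin nW′ (λ a → (coordinate (plus x) a - coordinate (minus x) a) * y a)
      ≡⟨ sumFin-cong nW′ (λ a → solve 3 (λ c d v → (c :- d) :* v := c :* v :+ (:- (d :* v)))
                                        refl (coordinate (plus x) a) (coordinate (minus x) a) (y a)) ⟩
    sumFin nW′ (λ a → coordinate (plus x) a * y a + - (coordinate (minus x) a * y a))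
      ≡⟨ sumFin-+ nW′ (λ a → coordinate (plus x) a * y a) (λ a → - (coordinate (minus x) a * y a)) ⟩
    sumFin nW′ (λ a → coordinate (plus x) a * y a) + sumFin nW′ (λ a → - (coordinate (minus x) a * y a))
      ≡⟨ cong₂ _+_ (sumFin-coordinate y (plus x))
                   (trans (sumFin-neg nW′ (λ a → coordinate (minus x) a * y a)) (cong -_ (sumFin-coordinate y (minus x)))) ⟩
    value y (plus x) - value y (minus x) ∎)
    where
    open ≡-Reasoning
    x = decode e

  -- Row x of toW inverts toEdges by telescoping: y(α κ) and y(δ κ) add up the differences
  -- after κ on their chain, y(μ₁) all α-differences, y(β κ) and y(μ₂) subtract from y(μ₁)
  -- the β-differences up to κ, and y(μ₃), y(γ κ) arise in the same way from the δ and γ chains.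
  rowα rowγ rowβ rowδ : WElt s t p q → ℕ → ℚ
  rowα μ₁    _ = 1ℚ
  rowα μ₂    _ = 1ℚ
  rowα (α κ) i = χ< (toℕ κ) i
  rowα (β κ) _ = 1ℚ
  rowα _     _ = 0ℚ
  rowγ (γ κ) j = - χ< j (suc (toℕ κ))
  rowγ _     _ = 0ℚ
  rowβ μ₂    _ = 1ℚ
  rowβ (β κ) k = χ< k (suc (toℕ κ))
  rowβ _     _ = 0ℚ
  rowδ μ₃    _ = - 1ℚ
  rowδ (γ κ) _ = - 1ℚ
  rowδ (δ κ) l = - χ< (toℕ κ) l
  rowδ _     _ = 0ℚ

  row : WElt s t p q → Edge → ℚ
  row x (eα i) = rowα x (toℕ i)
  row x (eγ j) = rowγ x (toℕ j)
  row x (eβ k) = rowβ x (toℕ k)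
  row x (eδ l) = rowδ x (toℕ l)

  βRowSum δRowSum toW-offset : WElt s t p q → ℚ
  βRowSum x    = sumFin (suc p) (λ k → rowβ x (toℕ k))
  δRowSum x    = sumFin (suc q) (λ l → rowδ x (toℕ l))
  toW-offset x = - (βRowSum x + δRowSum x)

  toW : AffineMap nE nW′
  toW = record
    { A = λ a e → row (decodeW s t p q a) (decode e)
    ; b = λ a → toW-offset (decodeW s t p q a)
    }

  sumFin-edges : ∀ (h : Edge → ℚ) → sumFin nE (λ e → h (decode e)) ≡
    sumFin (suc s) (λ i → h (eα i)) + (sumFin (suc t) (λ j → h (eγ j)) +
      (sumFin (suc p) (λ k → h (eβ k)) + sumFin (suc q) (λ l → h (eδ l))))
  sumFin-edges h =
    trans (sumFin-splitAt (suc s) _ (λ e → h (decode e)))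
    (cong₂ _+_ (sumFin-cong (suc s) (λ i → cong h (decode-encode (eα i))))
    (trans (sumFin-splitAt (suc t) _ (λ e → h (decode (suc s ↑ʳ e))))
    (cong₂ _+_ (sumFin-cong (suc t) (λ j → cong h (decode-encode (eγ j))))
    (trans (sumFin-splitAt (suc p) _ (λ e → h (decode (suc s ↑ʳ (suc t ↑ʳ e)))))
    (cong₂ _+_ (sumFin-cong (suc p) (λ k → cong h (decode-encode (eβ k))))
               (sumFin-cong (suc q) (λ l → cong h (decode-encode (eδ l)))))))))

  αValue βValue γValue δValue : Point nW′ → ℕ → ℚ
  αValue y n = value y (αPos n)
  βValue y n = value y (βPos n)
  γValue y n = value y (γPos n)
  δValue y n = value y (δPos n)

  αTerm βTerm γTerm δTerm : Point nW′ → WElt s t p q → ℚ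
  αTerm y x = sumFin (suc s) (λ i → rowα x (toℕ i) * Δ (αValue y) (toℕ i))
  γTerm y x = sumFin (suc t) (λ j → rowγ x (toℕ j) * Δ (γValue y) (toℕ j))
  βTerm y x = sumFin (suc p) (λ k → rowβ x (toℕ k) * Δ (βValue y) (toℕ k))
  δTerm y x = sumFin (suc q) (λ l → rowδ x (toℕ l) * Δ (δValue y) (toℕ l))

  toW-toEdges-terms : ∀ y x → sumFin nE (λ e → row x (decode e) * edgeValue y (decode e)) + toW-offset x ≡
    αTerm y x + γTerm y x - βTerm y x - δTerm y x
  toW-toEdges-terms y x = begin
    sumFin nE (λ e → row x (decode e) * edgeValue y (decode e)) + toW-offset x
      ≡⟨ cong (_+ toW-offset x) (sumFin-edges (λ z → row x z * edgeValue y z)) ⟩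
    (sumFin (suc s) (λ i → rowα x (toℕ i) * (Δ (αValue y) (toℕ i) + 0ℚ)) +
     (sumFin (suc t) (λ j → rowγ x (toℕ j) * (Δ (γValue y) (toℕ j) + 0ℚ)) +
      (sumFin (suc p) (λ k → rowβ x (toℕ k) * ((βValue y (suc (toℕ k)) - βValue y (toℕ k)) + 1ℚ)) +
       sumFin (suc q) (λ l → rowδ x (toℕ l) * ((δValue y (suc (toℕ l)) - δValue y (toℕ l)) + 1ℚ))))) + toW-offset x
      ≡⟨ cong (_+ toW-offset x) (cong₂ _+_ (plain (suc s) αValue rowα)
                                 (cong₂ _+_ (plain (suc t) γValue rowγ)
                                 (cong₂ _+_ (complemented (suc p) βValue rowβ) (complemented (suc q) δValue rowδ)))) ⟩
    (αTerm y x + (γTerm y x + ((- βTerm y x + βRowSum x) + (- δTerm y x + δRowSum x)))) + - (βRowSum x + δRowSum x)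
      ≡⟨ solve 6 (λ a c b d r r′ → (a :+ (c :+ ((:- b :+ r) :+ (:- d :+ r′)))) :+ (:- (r :+ r′)) := a :+ c :- b :- d)
                 refl (αTerm y x) (γTerm y x) (βTerm y x) (δTerm y x) (βRowSum x) (δRowSum x) ⟩
    αTerm y x + γTerm y x - βTerm y x - δTerm y x ∎
    where
    open ≡-Reasoning
    plain : ∀ n (V : Point nW′ → ℕ → ℚ) (r : WElt s t p q → ℕ → ℚ) →
      sumFin n (λ i → r x (toℕ i) * (Δ (V y) (toℕ i) + 0ℚ)) ≡ sumFin n (λ i → r x (toℕ i) * Δ (V y) (toℕ i))
    plain n V r = sumFin-cong n (λ i → cong (r x (toℕ i) *_) (+-identityʳ (Δ (V y) (toℕ i))))
    complemented : ∀ n (V : Point nW′ → ℕ → ℚ) (r : WElt s t p q → ℕ → ℚ) →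
      sumFin n (λ i → r x (toℕ i) * ((V y (suc (toℕ i)) - V y (toℕ i)) + 1ℚ)) ≡
      - sumFin n (λ i → r x (toℕ i) * Δ (V y) (toℕ i)) + sumFin n (λ i → r x (toℕ i))
    complemented n V r = begin
      sumFin n (λ i → r x (toℕ i) * ((V y (suc (toℕ i)) - V y (toℕ i)) + 1ℚ))
        ≡⟨ sumFin-cong n (λ i → solve 3 (λ c a b → c :* ((b :- a) :+ con 1ℚ) := :- (c :* (a :- b)) :+ c)
                                         refl (r x (toℕ i)) (V y (toℕ i)) (V y (suc (toℕ i)))) ⟩
      sumFin n (λ i → - (r x (toℕ i) * Δ (V y) (toℕ i)) + r x (toℕ i))
        ≡⟨ sumFin-+ n (λ i → - (r x (toℕ i) * Δ (V y) (toℕ i))) (λ i → r x (toℕ i)) ⟩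
      sumFin n (λ i → - (r x (toℕ i) * Δ (V y) (toℕ i))) + sumFin n (λ i → r x (toℕ i))
        ≡⟨ cong (_+ sumFin n (λ i → r x (toℕ i))) (sumFin-neg n (λ i → r x (toℕ i) * Δ (V y) (toℕ i))) ⟩
      - sumFin n (λ i → r x (toℕ i) * Δ (V y) (toℕ i)) + sumFin n (λ i → r x (toℕ i)) ∎

  module _ (y : Point nW′) where
    αValue-end : αValue y (suc s) ≡ 0ℚ
    αValue-end rewrite fin?-≥ s s ℕ.≤-refl = refl
    αValue-α : ∀ κ → αValue y (suc (toℕ κ)) ≡ y (encodeW (α κ))
    αValue-α κ rewrite fin?-toℕ κ = refl
    βValue-end : βValue y (suc p) ≡ y (encodeW μ₂)
    βValue-end rewrite fin?-≥ p p ℕ.≤-refl = refl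
    βValue-β : ∀ κ → βValue y (suc (toℕ κ)) ≡ y (encodeW (β κ))
    βValue-β κ rewrite fin?-toℕ κ = refl
    γValue-γ : ∀ κ → γValue y (suc (toℕ κ)) ≡ y (encodeW (γ κ))
    γValue-γ κ rewrite fin?-toℕ κ = refl
    δValue-end : δValue y (suc q) ≡ 0ℚ
    δValue-end rewrite fin?-≥ q q ℕ.≤-refl = refl
    δValue-δ : ∀ κ → δValue y (suc (toℕ κ)) ≡ y (encodeW (δ κ))
    δValue-δ κ rewrite fin?-toℕ κ = refl

    private
      cong-terms : ∀ {a c b d a′ c′ b′ d′} → a ≡ a′ → c ≡ c′ → b ≡ b′ → d ≡ d′ →
        a + c - b - d ≡ a′ + c′ - b′ - d′
      cong-terms refl refl refl refl = refl

      sumFin-neg* : ∀ n (f g : Fin n → ℚ) → sumFin n (λ i → (- f i) * g i) ≡ - sumFin n (λ i → f i * g i)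
      sumFin-neg* n f g = trans (sumFin-cong n (λ i → solve 2 (λ a b → (:- a) :* b := :- (a :* b)) refl (f i) (g i)))
                                (sumFin-neg n (λ i → f i * g i))

      yμ₁ yμ₂ yμ₃ : ℚ
      yμ₁ = y (encodeW μ₁)
      yμ₂ = y (encodeW μ₂)
      yμ₃ = y (encodeW μ₃)

      zeroα : sumFin (suc s) (λ i → 0ℚ * Δ (αValue y) (toℕ i)) ≡ 0ℚ
      zeroα = sumFin-*-zeroˡ (suc s) (λ i → Δ (αValue y) (toℕ i))
      zeroγ : sumFin (suc t) (λ j → 0ℚ * Δ (γValue y) (toℕ j)) ≡ 0ℚ
      zeroγ = sumFin-*-zeroˡ (suc t) (λ j → Δ (γValue y) (toℕ j))
      zeroβ : sumFin (suc p) (λ k → 0ℚ * Δ (βValue y) (toℕ k)) ≡ 0ℚ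
      zeroβ = sumFin-*-zeroˡ (suc p) (λ k → Δ (βValue y) (toℕ k))
      zeroδ : sumFin (suc q) (λ l → 0ℚ * Δ (δValue y) (toℕ l)) ≡ 0ℚ
      zeroδ = sumFin-*-zeroˡ (suc q) (λ l → Δ (δValue y) (toℕ l))

      allα : sumFin (suc s) (λ i → 1ℚ * Δ (αValue y) (toℕ i)) ≡ 1ℚ * (yμ₁ - 0ℚ)
      allα = trans (sumFin-*-telescope (suc s) 1ℚ (αValue y)) (cong (λ z → 1ℚ * (yμ₁ - z)) αValue-end)

      allβ : sumFin (suc p) (λ k → 1ℚ * Δ (βValue y) (toℕ k)) ≡ 1ℚ * (yμ₁ - yμ₂)
      allβ = trans (sumFin-*-telescope (suc p) 1ℚ (βValue y)) (cong (λ z → 1ℚ * (yμ₁ - z)) βValue-end)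

      allδ : sumFin (suc q) (λ l → - 1ℚ * Δ (δValue y) (toℕ l)) ≡ - 1ℚ * (yμ₃ - 0ℚ)
      allδ = trans (sumFin-*-telescope (suc q) (- 1ℚ) (δValue y)) (cong (λ z → - 1ℚ * (yμ₃ - z)) δValue-end)

      aboveα : ∀ κ → αTerm y (α κ) ≡ y (encodeW (α κ)) - 0ℚ
      aboveα κ = trans (sumFin-telescope-above (suc s) (toℕ κ) (αValue y) (ℕ.<-trans (Fin.toℕ<n κ) (ℕ.n<1+n s)))
                       (cong₂ _-_ (αValue-α κ) αValue-end)

      belowβ : ∀ κ → βTerm y (β κ) ≡ yμ₁ - y (encodeW (β κ))
      belowβ κ = trans (sumFin-telescope-below (suc p) (suc (toℕ κ)) (βValue y) (s≤s (ℕ.<⇒≤ (Fin.toℕ<n κ))))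
                       (cong (λ z → yμ₁ - z) (βValue-β κ))

      belowγ : ∀ κ → γTerm y (γ κ) ≡ - (yμ₃ - y (encodeW (γ κ)))
      belowγ κ = trans (sumFin-neg* (suc t) (λ j → χ< (toℕ j) (suc (toℕ κ))) (λ j → Δ (γValue y) (toℕ j)))
                       (cong -_ (trans (sumFin-telescope-below (suc t) (suc (toℕ κ)) (γValue y) (s≤s (ℕ.<⇒≤ (Fin.toℕ<n κ))))
                                       (cong (λ z → yμ₃ - z) (γValue-γ κ))))

      aboveδ : ∀ κ → δTerm y (δ κ) ≡ - (y (encodeW (δ κ)) - 0ℚ)
      aboveδ κ = trans (sumFin-neg* (suc q) (λ l → χ< (toℕ κ) (toℕ l)) (λ l → Δ (δValue y) (toℕ l)))
                       (cong -_ (trans (sumFin-telescope-above (suc q) (toℕ κ) (δValue y) (ℕ.<-trans (Fin.toℕ<n κ) (ℕ.n<1+n q)))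
                                       (cong₂ _-_ (δValue-δ κ) δValue-end)))

    terms-telescope : ∀ x → αTerm y x + γTerm y x - βTerm y x - δTerm y x ≡ y (encodeW x)
    terms-telescope μ₁ = trans (cong-terms allα zeroγ zeroβ zeroδ)
      (solve 1 (λ a → con 1ℚ :* (a :- con 0ℚ) :+ con 0ℚ :- con 0ℚ :- con 0ℚ := a) refl yμ₁)
    terms-telescope μ₂ = trans (cong-terms allα zeroγ allβ zeroδ)
      (solve 2 (λ a b → con 1ℚ :* (a :- con 0ℚ) :+ con 0ℚ :- con 1ℚ :* (a :- b) :- con 0ℚ := b) refl yμ₁ yμ₂)
    terms-telescope μ₃ = trans (cong-terms zeroα zeroγ zeroβ allδ)
      (solve 1 (λ a → con 0ℚ :+ con 0ℚ :- con 0ℚ :- (:- con 1ℚ) :* (a :- con 0ℚ) := a) refl yμ₃)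
    terms-telescope (α κ) = trans (cong-terms (aboveα κ) zeroγ zeroβ zeroδ)
      (solve 1 (λ a → (a :- con 0ℚ) :+ con 0ℚ :- con 0ℚ :- con 0ℚ := a) refl (y (encodeW (α κ))))
    terms-telescope (β κ) = trans (cong-terms allα zeroγ (belowβ κ) zeroδ)
      (solve 2 (λ a b → con 1ℚ :* (a :- con 0ℚ) :+ con 0ℚ :- (a :- b) :- con 0ℚ := b) refl yμ₁ (y (encodeW (β κ))))
    terms-telescope (γ κ) = trans (cong-terms zeroα (belowγ κ) zeroβ allδ)
      (solve 2 (λ a b → con 0ℚ :+ (:- (a :- b)) :- con 0ℚ :- (:- con 1ℚ) :* (a :- con 0ℚ) := b) refl yμ₃ (y (encodeW (γ κ))))
    terms-telescope (δ κ) = trans (cong-terms zeroα zeroγ zeroβ (aboveδ κ))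
      (solve 1 (λ a → con 0ℚ :+ con 0ℚ :- con 0ℚ :- (:- (a :- con 0ℚ)) := a) refl (y (encodeW (δ κ))))

  toW∘toEdges : ∀ y → AffineMap.apply toW (AffineMap.apply toEdges y) ≈ₚ y
  toW∘toEdges y a = begin
    sumFin nE (λ e → row x (decode e) * AffineMap.apply toEdges y e) + toW-offset x
      ≡⟨ cong (_+ toW-offset x) (sumFin-cong nE (λ e → cong (row x (decode e) *_) (apply-toEdges y e))) ⟩
    sumFin nE (λ e → row x (decode e) * edgeValue y (decode e)) + toW-offset x
      ≡⟨ toW-toEdges-terms y x ⟩
    αTerm y x + γTerm y x - βTerm y x - δTerm y x
      ≡⟨ terms-telescope y x ⟩
    y (encodeW x)
      ≡⟨ cong y (encodeW-decodeW a) ⟩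
    y a ∎
    where
    open ≡-Reasoning
    x = decodeW s t p q a

module Ideals (s t p q : ℕ) where

  open import Defs
  open Preliminaries
  open FiniteSums
  open Thresholds
  open Selections
  open OrderPolytopes
  open import Data.Nat as ℕ using (ℕ; zero; suc; z≤n; s≤s; _≡ᵇ_)
  import Data.Nat.Properties as ℕ
  open import Data.Fin as Fin using (Fin; zero; suc; toℕ; inject₁; fromℕ; fromℕ<)
  open import Data.Fin.Relation.Unary.Top using (view; ‵fromℕ; ‵inject₁)
  import Data.Fin.Properties as Fin
  open import Data.Bool using (true; false; not; if_then_else_)
  open import Data.Maybe as Maybe using (Maybe; just; nothing; maybe)
  open import Data.Sum using (_⊎_; inj₁; inj₂)
  open import Data.Product using (Σ; _×_; _,_; proj₁; proj₂)
  open import Data.Rational using (ℚ; 0ℚ; 1ℚ; _+_; _-_; _≤_)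
  open import Data.Rational.Properties using (+-identityʳ; ≤-refl)
  open import Data.Rational.Solver
  open import Relation.Binary.PropositionalEquality
  open import Relation.Nullary using (contradiction)
  open import Relation.Binary.Construct.Closure.ReflexiveTransitive using (ε; _◅_)
  open import Function using (_∘_)

  open +-*-Solver using (solve; _:=_; _:+_; _:-_; con)
  open GraphC s t p q
  open PosetW s t p q

  -- A 0/1 point of the order polytope is the indicator of an order ideal, which is described by the
  -- numbers of elements it contains from the chains α, β, γ, δ (counted from μ₁, μ₁, μ₃, μ₃). These
  -- counts must agree on the elements μ₁, μ₂, μ₃ shared by two chains.
  record Consistent (τα τβ τγ τδ : ℕ) : Set where
    field
      α-bound : τα ℕ.≤ suc s
      δ-bound : τδ ℕ.≤ suc q
      μ₁-shared : χ< 0 τα ≡ χ< 0 τβ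
      μ₂-shared : χ< (suc p) τβ ≡ χ< (suc t) τγ
      μ₃-shared : χ< 0 τδ ≡ χ< 0 τγ

  τα τβ τγ τδ : Shape → ℕ
  τα paths              = 0
  τα (α-cutβ i _)       = suc (toℕ i)
  τα (γ-cutδ _ _)       = 0
  τα (αγ-cutβδ i _ _ _) = suc (toℕ i)
  τα (α-cutδ i _)       = suc (toℕ i)
  τβ paths              = 0
  τβ (α-cutβ _ k)       = suc (toℕ k)
  τβ (γ-cutδ _ _)       = 0
  τβ (αγ-cutβδ _ _ k _) = suc (toℕ k)
  τβ (α-cutδ _ _)       = suc (suc p)
  τγ paths              = 0
  τγ (α-cutβ _ _)       = 0
  τγ (γ-cutδ j _)       = suc (toℕ j)
  τγ (αγ-cutβδ _ j _ _) = suc (toℕ j)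
  τγ (α-cutδ _ _)       = suc (suc t)
  τδ paths              = 0
  τδ (α-cutβ _ _)       = 0
  τδ (γ-cutδ _ l)       = suc (toℕ l)
  τδ (αγ-cutβδ _ _ _ l) = suc (toℕ l)
  τδ (α-cutδ _ l)       = suc (toℕ l)

  private
    χ<0-suc : ∀ {n} → χ< 0 (suc n) ≡ 1ℚ
    χ<0-suc = if<-yes (s≤s z≤n)

    χ<-end : ∀ {n} (k : Fin (suc n)) → χ< (suc n) (suc (toℕ k)) ≡ 0ℚ
    χ<-end k = if<-no (λ n+1<k+1 → ℕ.<⇒≱ (ℕ.≤-pred n+1<k+1) (ℕ.≤-pred (Fin.toℕ<n k)))

    χ<-0 : ∀ {m} → χ< m 0 ≡ 0ℚ
    χ<-0 = if<-no (λ ())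

    χ<-top : ∀ n → χ< (suc n) (suc (suc n)) ≡ 1ℚ
    χ<-top n = if<-yes ℕ.≤-refl

  shape-consistent : ∀ σ → Consistent (τα σ) (τβ σ) (τγ σ) (τδ σ)
  shape-consistent paths = record
    { α-bound = z≤n ; δ-bound = z≤n ; μ₁-shared = refl ; μ₂-shared = trans χ<-0 (sym χ<-0) ; μ₃-shared = refl }
  shape-consistent (α-cutβ i k) = record
    { α-bound = Fin.toℕ<n i ; δ-bound = z≤n ; μ₁-shared = trans χ<0-suc (sym χ<0-suc)
    ; μ₂-shared = trans (χ<-end k) (sym χ<-0) ; μ₃-shared = refl }
  shape-consistent (γ-cutδ j l) = record
    { α-bound = z≤n ; δ-bound = Fin.toℕ<n l ; μ₁-shared = refl
    ; μ₂-shared = trans χ<-0 (sym (χ<-end j)) ; μ₃-shared = trans χ<0-suc (sym χ<0-suc) }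
  shape-consistent (αγ-cutβδ i j k l) = record
    { α-bound = Fin.toℕ<n i ; δ-bound = Fin.toℕ<n l ; μ₁-shared = trans χ<0-suc (sym χ<0-suc)
    ; μ₂-shared = trans (χ<-end k) (sym (χ<-end j)) ; μ₃-shared = trans χ<0-suc (sym χ<0-suc) }
  shape-consistent (α-cutδ i l) = record
    { α-bound = Fin.toℕ<n i ; δ-bound = Fin.toℕ<n l ; μ₁-shared = trans χ<0-suc (sym χ<0-suc)
    ; μ₂-shared = trans (χ<-top p) (sym (χ<-top t)) ; μ₃-shared = trans χ<0-suc (sym χ<0-suc) }

  thresholdValue : (τα τβ τγ τδ : ℕ) → WElt s t p q → ℚ
  thresholdValue τα τβ τγ τδ μ₁    = χ< 0 τα
  thresholdValue τα τβ τγ τδ μ₂    = χ< (suc p) τβ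
  thresholdValue τα τβ τγ τδ μ₃    = χ< 0 τδ
  thresholdValue τα τβ τγ τδ (α κ) = χ< (suc (toℕ κ)) τα
  thresholdValue τα τβ τγ τδ (β κ) = χ< (suc (toℕ κ)) τβ
  thresholdValue τα τβ τγ τδ (γ κ) = χ< (suc (toℕ κ)) τγ
  thresholdValue τα τβ τγ τδ (δ κ) = χ< (suc (toℕ κ)) τδ

  ideal : Shape → Point nW′
  ideal σ a = thresholdValue (τα σ) (τβ σ) (τγ σ) (τδ σ) (decodeW s t p q a)

  module _ {τα τβ τγ τδ : ℕ} (consistent : Consistent τα τβ τγ τδ) where
    open Consistent consistent

    private
      point : Point nW′
      point a = thresholdValue τα τβ τγ τδ (decodeW s t p q a)

      point-encodeW : ∀ x → point (encodeW x) ≡ thresholdValue τα τβ τγ τδ x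
      point-encodeW x = cong (thresholdValue τα τβ τγ τδ) (decodeW-encodeW x)

      past-threshold : ∀ {n τ} → τ ℕ.≤ suc n → 0ℚ ≡ χ< (suc n) τ
      past-threshold τ≤n+1 = sym (if<-no (λ n+1<τ → ℕ.<⇒≱ n+1<τ τ≤n+1))

    αValue-threshold : ∀ n → αValue point n ≡ χ< n τα
    αValue-threshold zero = point-encodeW μ₁
    αValue-threshold (suc n) with fin?-view s n
    ... | inj₁ (i , eq , refl) rewrite eq = point-encodeW (α i)
    ... | inj₂ (eq , s≤n) rewrite eq = past-threshold (ℕ.≤-trans α-bound (s≤s s≤n))

    δValue-threshold : ∀ n → δValue point n ≡ χ< n τδ
    δValue-threshold zero = point-encodeW μ₃
    δValue-threshold (suc n) with fin?-view q n
    ... | inj₁ (l , eq , refl) rewrite eq = point-encodeW (δ l)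
    ... | inj₂ (eq , q≤n) rewrite eq = past-threshold (ℕ.≤-trans δ-bound (s≤s q≤n))

    βValue-threshold : ∀ n → n ℕ.≤ suc p → βValue point n ≡ χ< n τβ
    βValue-threshold zero _ = trans (point-encodeW μ₁) μ₁-shared
    βValue-threshold (suc n) n+1≤p+1 with fin?-view p n
    ... | inj₁ (k , eq , refl) rewrite eq = point-encodeW (β k)
    ... | inj₂ (eq , p≤n) rewrite eq | ℕ.≤-antisym (ℕ.≤-pred n+1≤p+1) p≤n = point-encodeW μ₂

    γValue-threshold : ∀ n → n ℕ.≤ suc t → γValue point n ≡ χ< n τγ
    γValue-threshold zero _ = trans (point-encodeW μ₃) μ₃-shared
    γValue-threshold (suc n) n+1≤t+1 with fin?-view t n
    ... | inj₁ (j , eq , refl) rewrite eq = point-encodeW (γ j)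
    ... | inj₂ (eq , t≤n) rewrite eq | ℕ.≤-antisym (ℕ.≤-pred n+1≤t+1) t≤n = trans (point-encodeW μ₂) μ₂-shared

  inTree-α : ∀ σ i → inTree σ (eα i) ≡ (τα σ ≡ᵇ suc (toℕ i))
  inTree-α paths                 i = refl
  inTree-α (α-cutβ i₀ _)         i = selects-≡ᵇ i₀ i
  inTree-α (γ-cutδ _ _)          i = refl
  inTree-α (αγ-cutβδ i₀ _ _ _)   i = selects-≡ᵇ i₀ i
  inTree-α (α-cutδ i₀ _)         i = selects-≡ᵇ i₀ i

  inTree-γ : ∀ σ j → inTree σ (eγ j) ≡ (τγ σ ≡ᵇ suc (toℕ j))
  inTree-γ paths                 j = refl
  inTree-γ (α-cutβ _ _)          j = refl
  inTree-γ (γ-cutδ j₀ _)         j = selects-≡ᵇ j₀ j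
  inTree-γ (αγ-cutβδ _ j₀ _ _)   j = selects-≡ᵇ j₀ j
  inTree-γ (α-cutδ _ _)          j = sym (past-end j)

  inTree-β : ∀ σ k → inTree σ (eβ k) ≡ not (τβ σ ≡ᵇ suc (toℕ k))
  inTree-β paths                 k = refl
  inTree-β (α-cutβ _ k₀)         k = cong not (selects-≡ᵇ k₀ k)
  inTree-β (γ-cutδ _ _)          k = refl
  inTree-β (αγ-cutβδ _ _ k₀ _)   k = cong not (selects-≡ᵇ k₀ k)
  inTree-β (α-cutδ _ _)          k = cong not (sym (past-end k))

  inTree-δ : ∀ σ l → inTree σ (eδ l) ≡ not (τδ σ ≡ᵇ suc (toℕ l))
  inTree-δ paths                 l = refl
  inTree-δ (α-cutβ _ _)          l = refl
  inTree-δ (γ-cutδ _ l₀)         l = cong not (selects-≡ᵇ l₀ l)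
  inTree-δ (αγ-cutβδ _ _ _ l₀)   l = cong not (selects-≡ᵇ l₀ l)
  inTree-δ (α-cutδ _ l₀)         l = cong not (selects-≡ᵇ l₀ l)

  private
    bit-not : ∀ b → bit (not b) ≡ 1ℚ - bit b
    bit-not true  = refl
    bit-not false = refl

    plain-step : ∀ a b c → a - b ≡ c → (a - b) + 0ℚ ≡ c
    plain-step a b c eq = trans (+-identityʳ (a - b)) eq

    complemented-step : ∀ a b c → a - b ≡ c → (b - a) + 1ℚ ≡ 1ℚ - c
    complemented-step a b c refl = solve 2 (λ a b → (b :- a) :+ con 1ℚ := con 1ℚ :- (a :- b)) refl a b

  edgeValue-ideal : ∀ σ x → edgeValue (ideal σ) x ≡ bit (inTree σ x)
  edgeValue-ideal σ (eα i) = trans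
    (plain-step (αValue (ideal σ) (toℕ i)) (αValue (ideal σ) (suc (toℕ i))) _
      (trans (cong₂ _-_ (αValue-threshold c (toℕ i)) (αValue-threshold c (suc (toℕ i))))
                             (χ<-step (toℕ i) (τα σ))))
    (cong bit (sym (inTree-α σ i)))
    where c = shape-consistent σ
  edgeValue-ideal σ (eγ j) = trans
    (plain-step (γValue (ideal σ) (toℕ j)) (γValue (ideal σ) (suc (toℕ j))) _
      (trans (cong₂ _-_ (γValue-threshold c (toℕ j) (ℕ.<⇒≤ (Fin.toℕ<n j)))
                                        (γValue-threshold c (suc (toℕ j)) (Fin.toℕ<n j)))
                             (χ<-step (toℕ j) (τγ σ))))
    (cong bit (sym (inTree-γ σ j)))
    where c = shape-consistent σ
  edgeValue-ideal σ (eβ k) = trans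
    (complemented-step (βValue (ideal σ) (toℕ k)) (βValue (ideal σ) (suc (toℕ k))) _
      (trans (cong₂ _-_ (βValue-threshold c (toℕ k) (ℕ.<⇒≤ (Fin.toℕ<n k)))
                                               (βValue-threshold c (suc (toℕ k)) (Fin.toℕ<n k)))
                                    (χ<-step (toℕ k) (τβ σ))))
    (trans (sym (bit-not _)) (cong bit (sym (inTree-β σ k))))
    where c = shape-consistent σ
  edgeValue-ideal σ (eδ l) = trans
    (complemented-step (δValue (ideal σ) (toℕ l)) (δValue (ideal σ) (suc (toℕ l))) _
      (trans (cong₂ _-_ (δValue-threshold c (toℕ l)) (δValue-threshold c (suc (toℕ l))))
                                    (χ<-step (toℕ l) (τδ σ))))
    (trans (sym (bit-not _)) (cong bit (sym (inTree-δ σ l))))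
    where c = shape-consistent σ

  toEdges-ideal : ∀ σ → AffineMap.apply toEdges (ideal σ) ≈ₚ χ (tree σ)
  toEdges-ideal σ e = trans (apply-toEdges (ideal σ) e) (edgeValue-ideal σ (decode e))

  module _ {τα τβ τγ τδ : ℕ} (consistent : Consistent τα τβ τγ τδ) where
    open Consistent consistent

    private
      value′ : WElt s t p q → ℚ
      value′ = thresholdValue τα τβ τγ τδ

      descends : ∀ {k} (seq : Fin (suc k) → WElt s t p q) τ → (∀ j → value′ (seq j) ≡ χ< (toℕ j) τ) →
        ∀ i → value′ (seq (suc i)) ≤ value′ (seq (inject₁ i))
      descends seq τ seq≡ i = subst₂ _≤_ (sym (seq≡ (suc i)))
        (sym (trans (seq≡ (inject₁ i)) (cong (λ n → χ< n τ) (Fin.toℕ-inject₁ i)))) (χ<-antitone (toℕ i) τ)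

    thresholdValue-generator : ∀ {x y} → Gen x y → value′ y ≤ value′ x
    thresholdValue-generator (chα i) = descends (chainSeq μ₁ α) τα
      (chainSeq-along μ₁ α value′ (λ n → χ< n τα) refl (λ _ → refl)) i
    thresholdValue-generator (chβ i) = descends (pathSeq μ₁ β μ₂) τβ
      (pathSeq-along μ₁ β μ₂ value′ (λ n → χ< n τβ) μ₁-shared (λ _ → refl) refl) i
    thresholdValue-generator (chγ i) = descends (pathSeq μ₃ γ μ₂) τγ
      (pathSeq-along μ₃ γ μ₂ value′ (λ n → χ< n τγ) μ₃-shared (λ _ → refl) μ₂-shared) i
    thresholdValue-generator (chδ i) = descends (chainSeq μ₃ δ) τδ
      (chainSeq-along μ₃ δ value′ (λ n → χ< n τδ) refl (λ _ → refl)) i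

    thresholdValue-zeroOne : ∀ x → value′ x ≡ 0ℚ ⊎ value′ x ≡ 1ℚ
    thresholdValue-zeroOne μ₁    = χ<-zeroOne _ _
    thresholdValue-zeroOne μ₂    = χ<-zeroOne _ _
    thresholdValue-zeroOne μ₃    = χ<-zeroOne _ _
    thresholdValue-zeroOne (α _) = χ<-zeroOne _ _
    thresholdValue-zeroOne (β _) = χ<-zeroOne _ _
    thresholdValue-zeroOne (γ _) = χ<-zeroOne _ _
    thresholdValue-zeroOne (δ _) = χ<-zeroOne _ _

  ideal-vertex : ∀ σ → OrderVertex (W s t p q) (ideal σ)
  ideal-vertex σ =
    (Antitone-generators (W s t p q) (λ a b → thresholdValue-generator (shape-consistent σ)) ,
     λ a → bounds (thresholdValue-zeroOne (shape-consistent σ) (decodeW s t p q a))) ,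
    λ a → thresholdValue-zeroOne (shape-consistent σ) (decodeW s t p q a)
    where
    bounds : ∀ {r} → r ≡ 0ℚ ⊎ r ≡ 1ℚ → 0ℚ ≤ r × r ≤ 1ℚ
    bounds (inj₁ refl) = ≤-refl , 0≤1
    bounds (inj₂ refl) = 0≤1 , ≤-refl

  data Position : ℕ → ℕ → Set where
    none : ∀ {N} → Position N 0
    at   : ∀ {N} (i : Fin N) → Position N (suc (toℕ i))

  position : ∀ {N τ} → τ ℕ.≤ N → Position N τ
  position {τ = zero} _ = none
  position {suc N} {suc τ} τ+1≤N+1 =
    subst (Position (suc N)) (cong suc (Fin.toℕ-fromℕ< τ+1≤N+1)) (at (fromℕ< τ+1≤N+1))

  private
    0≢1 : 0ℚ ≢ 1ℚ
    0≢1 ()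

    χ<-inject₁ : ∀ {n} (k : Fin (suc n)) → χ< (suc n) (suc (toℕ (inject₁ k))) ≡ 0ℚ
    χ<-inject₁ k = trans (cong (χ< _) (cong suc (Fin.toℕ-inject₁ k))) (χ<-end k)

    χ<-fromℕ : ∀ n → χ< (suc n) (suc (toℕ (fromℕ (suc n)))) ≡ 1ℚ
    χ<-fromℕ n = trans (cong (λ m → χ< (suc n) (suc m)) (Fin.toℕ-fromℕ (suc n))) (χ<-top n)

  ShapeWith : ℕ → ℕ → ℕ → ℕ → Set
  ShapeWith τα′ τβ′ τγ′ τδ′ = Σ Shape λ σ → τα σ ≡ τα′ × τβ σ ≡ τβ′ × τγ σ ≡ τγ′ × τδ σ ≡ τδ′

  shapeWith : ∀ {τα τβ τγ τδ} → τβ ℕ.≤ suc (suc p) → τγ ℕ.≤ suc (suc t) →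
    Consistent τα τβ τγ τδ → ShapeWith τα τβ τγ τδ
  shapeWith β-bound γ-bound consistent
    with position (Consistent.α-bound consistent) | position β-bound
       | position γ-bound | position (Consistent.δ-bound consistent)
  ... | none | none | none | none = paths , refl , refl , refl , refl
  ... | none | at _ | _ | _ = contradiction (trans (sym χ<-0) (trans μ₁-shared χ<0-suc)) 0≢1
    where
    open Consistent consistent
  ... | at _ | none | _ | _ = contradiction (trans (sym χ<-0) (trans (sym μ₁-shared) χ<0-suc)) 0≢1
    where
    open Consistent consistent
  ... | _ | _ | none | at _ = contradiction (trans (sym χ<-0) (trans (sym μ₃-shared) χ<0-suc)) 0≢1
    where
    open Consistent consistent
  ... | _ | _ | at _ | none = contradiction (trans (sym χ<-0) (trans μ₃-shared χ<0-suc)) 0≢1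
    where
    open Consistent consistent
  ... | none | none | at j | at l with view j
  ...   | ‵inject₁ j′ = γ-cutδ j′ l , refl , refl , cong suc (sym (Fin.toℕ-inject₁ j′)) , refl
  ...   | ‵fromℕ = contradiction (trans (sym χ<-0) (trans μ₂-shared (χ<-fromℕ t))) 0≢1
    where
    open Consistent consistent
  shapeWith _ _ consistent | at i | at k | none | none with view k
  ...   | ‵inject₁ k′ = α-cutβ i k′ , refl , cong suc (sym (Fin.toℕ-inject₁ k′)) , refl , refl
  ...   | ‵fromℕ = contradiction (trans (sym χ<-0) (trans (sym μ₂-shared) (χ<-fromℕ p))) 0≢1
    where
    open Consistent consistent
  shapeWith _ _ consistent | at i | at k | at j | at l with view k | view j
  ...   | ‵inject₁ k′ | ‵inject₁ j′ =
    αγ-cutβδ i j′ k′ l , refl , cong suc (sym (Fin.toℕ-inject₁ k′)) , cong suc (sym (Fin.toℕ-inject₁ j′)) , refl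
  ...   | ‵fromℕ | ‵fromℕ =
    α-cutδ i l , refl , cong suc (sym (Fin.toℕ-fromℕ (suc p))) , cong suc (sym (Fin.toℕ-fromℕ (suc t))) , refl
  ...   | ‵inject₁ k′ | ‵fromℕ = contradiction (trans (sym (χ<-inject₁ k′)) (trans μ₂-shared (χ<-fromℕ t))) 0≢1
    where
    open Consistent consistent
  ...   | ‵fromℕ | ‵inject₁ j′ = contradiction (trans (sym (χ<-inject₁ j′)) (trans (sym μ₂-shared) (χ<-fromℕ p))) 0≢1
    where
    open Consistent consistent

  private
    αPos-chain : ∀ j → αPos (toℕ j) ≡ just (chainSeq μ₁ α j)
    αPos-chain j = sym (chainSeq-along μ₁ α just αPos refl (λ i → cong (Maybe.map α) (sym (fin?-toℕ i))) j)

    δPos-chain : ∀ j → δPos (toℕ j) ≡ just (chainSeq μ₃ δ j)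
    δPos-chain j = sym (chainSeq-along μ₃ δ just δPos refl (λ i → cong (Maybe.map δ) (sym (fin?-toℕ i))) j)

    βPos-chain : ∀ j → βPos (toℕ j) ≡ just (pathSeq μ₁ β μ₂ j)
    βPos-chain j = sym (pathSeq-along μ₁ β μ₂ just βPos refl
      (λ i → cong (λ m → just (maybe β μ₂ m)) (sym (fin?-toℕ i))) (cong (λ m → just (maybe β μ₂ m)) (sym (fin?-≥ p p ℕ.≤-refl))) j)

    γPos-chain : ∀ j → γPos (toℕ j) ≡ just (pathSeq μ₃ γ μ₂ j)
    γPos-chain j = sym (pathSeq-along μ₃ γ μ₂ just γPos refl
      (λ i → cong (λ m → just (maybe γ μ₂ m)) (sym (fin?-toℕ i))) (cong (λ m → just (maybe γ μ₂ m)) (sym (fin?-≥ t t ℕ.≤-refl))) j)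

  module _ (z : Point nW′) (z-vertex : OrderVertex (W s t p q) z) where

    private
      z-zeroOne : ∀ mx → value z mx ≡ 0ℚ ⊎ value z mx ≡ 1ℚ
      z-zeroOne nothing  = inj₁ refl
      z-zeroOne (just x) = proj₂ z-vertex (encodeW x)

      z-generator : ∀ {x y} → Gen x y → z (encodeW y) ≤ z (encodeW x)
      z-generator {x} {y} g =
        proj₁ (proj₁ z-vertex) (encodeW x) (encodeW y) (subst₂ Gen (sym (decodeW-encodeW x)) (sym (decodeW-encodeW y)) g ◅ ε)

      chain-threshold : ∀ {K} (pos : ℕ → Maybe (WElt s t p q)) (seq : Fin (suc K) → WElt s t p q) →
        (∀ j → pos (toℕ j) ≡ just (seq j)) → (∀ i → Gen (seq (inject₁ i)) (seq (suc i))) →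
        Σ ℕ λ τ → τ ℕ.≤ suc K × (∀ n → n ℕ.≤ K → value z (pos n) ≡ χ< n τ)
      chain-threshold {K} pos seq pos≡ step = threshold K (value z ∘ pos) (λ n _ → z-zeroOne (pos n)) antitone
        where
        antitone : AntitoneOn K (value z ∘ pos)
        antitone n n<K = subst₂ _≤_ (cong (value z) (trans (sym (pos≡ (suc i))) (cong (pos ∘ suc) (Fin.toℕ-fromℕ< n<K))))
                                    (cong (value z) (trans (sym (pos≡ (inject₁ i))) (cong pos (trans (Fin.toℕ-inject₁ i) (Fin.toℕ-fromℕ< n<K)))))
                                    (z-generator (step i))
          where i = fromℕ< n<K

    vertex-ideal : Σ Shape λ σ → z ≈ₚ ideal σ
    vertex-ideal with chain-threshold αPos (chainSeq μ₁ α) αPos-chain chα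
                    | chain-threshold βPos (pathSeq μ₁ β μ₂) βPos-chain chβ
                    | chain-threshold γPos (pathSeq μ₃ γ μ₂) γPos-chain chγ
                    | chain-threshold δPos (chainSeq μ₃ δ) δPos-chain chδ
    ... | τα′ , τα≤ , α≡ | τβ′ , τβ≤ , β≡ | τγ′ , τγ≤ , γ≡ | τδ′ , τδ≤ , δ≡
      with shapeWith τβ≤ τγ≤ consistent
      where
      μ₂-β : value z (βPos (suc p)) ≡ z (encodeW μ₂)
      μ₂-β = cong (λ m → value z (just (maybe β μ₂ m))) (fin?-≥ p p ℕ.≤-refl)
      μ₂-γ : value z (γPos (suc t)) ≡ z (encodeW μ₂)
      μ₂-γ = cong (λ m → value z (just (maybe γ μ₂ m))) (fin?-≥ t t ℕ.≤-refl)
      consistent : Consistent τα′ τβ′ τγ′ τδ′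
      consistent = record
        { α-bound   = τα≤
        ; δ-bound   = τδ≤
        ; μ₁-shared = trans (sym (α≡ 0 z≤n)) (β≡ 0 z≤n)
        ; μ₂-shared = trans (sym (β≡ (suc p) ℕ.≤-refl)) (trans μ₂-β (trans (sym μ₂-γ) (γ≡ (suc t) ℕ.≤-refl)))
        ; μ₃-shared = trans (sym (δ≡ 0 z≤n)) (γ≡ 0 z≤n)
        }
    ... | σ , refl , refl , refl , refl = σ , λ a → trans (cong z (sym (encodeW-decodeW a))) (on-elements (decodeW s t p q a))
      where
      on-elements : ∀ x → z (encodeW x) ≡ thresholdValue (τα σ) (τβ σ) (τγ σ) (τδ σ) x
      on-elements μ₁    = α≡ 0 z≤n
      on-elements μ₂    = trans (sym (cong (λ m → value z (just (maybe β μ₂ m))) (fin?-≥ p p ℕ.≤-refl))) (β≡ (suc p) ℕ.≤-refl)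
      on-elements μ₃    = δ≡ 0 z≤n
      on-elements (α κ) = trans (cong (λ m → value z (Maybe.map α m)) (sym (fin?-toℕ κ))) (α≡ (suc (toℕ κ)) (Fin.toℕ<n κ))
      on-elements (β κ) = trans (cong (λ m → value z (just (maybe β μ₂ m))) (sym (fin?-toℕ κ))) (β≡ (suc (toℕ κ)) (s≤s (ℕ.<⇒≤ (Fin.toℕ<n κ))))
      on-elements (γ κ) = trans (cong (λ m → value z (just (maybe γ μ₂ m))) (sym (fin?-toℕ κ))) (γ≡ (suc (toℕ κ)) (s≤s (ℕ.<⇒≤ (Fin.toℕ<n κ))))
      on-elements (δ κ) = trans (cong (λ m → value z (Maybe.map δ m)) (sym (fin?-toℕ κ))) (δ≡ (suc (toℕ κ)) (Fin.toℕ<n κ))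

module UnimodularEquivalence (s t p q : ℕ) where
  open import Defs
  open FiniteSums
  open AffineHulls
  open OrderPolytopes
  open Integrality
  open Thresholds
  open import Data.Nat using (ℕ; suc; _<_)
  open import Data.Fin using (toℕ)
  open import Data.Bool using (if_then_else_)
  open import Data.Sum using (inj₁; inj₂)
  open import Data.Maybe using (just; nothing)
  open import Data.Product using (Σ; _×_; _,_; proj₁)
  open import Data.Rational using (0ℚ; 1ℚ)
  open import Relation.Binary.PropositionalEquality
  open import Function using (id)
  open GraphC s t p q
  open PosetW s t p q
  open Ideals s t p q

  open AffineMap using (apply)

  private
    P : Region nE
    P = BasePolytope (C s t p q)

    Q : Region nW′
    Q = OrderPolytope (W s t p q)

  BasisPoint : Region nE
  BasisPoint y = Σ (EdgeSet nE) λ B → IsBasis (C s t p q) B × y ≈ₚ χ B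

  basisPoint-ideal : ∀ y → BasisPoint y → Σ Shape λ σ → y ≈ₚ apply toEdges (ideal σ)
  basisPoint-ideal y (B , B-basis , y≈χB) with BasesAreTrees.basis-tree s t p q B B-basis
  ... | σ , B≡tree = σ , (begin
    y                          ≈⟨ y≈χB ⟩
    χ B                        ≈⟨ (λ e → cong (λ b → if b then 1ℚ else 0ℚ) (B≡tree e)) ⟩
    χ (tree σ)                 ≈⟨ ≈ₚ-sym (toEdges-ideal σ) ⟩
    apply toEdges (ideal σ)    ∎)
    where
    open ≈ₚ-Reasoning

  vertex-basisPoint : ∀ z → OrderVertex (W s t p q) z → BasisPoint (apply toEdges z)
  vertex-basisPoint z z-vertex with vertex-ideal z z-vertex
  ... | σ , z≈ideal = tree σ , TreesAreBases.tree-basis s t p q σ , (begin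
    apply toEdges z            ≈⟨ apply-cong toEdges z≈ideal ⟩
    apply toEdges (ideal σ)    ≈⟨ toEdges-ideal σ ⟩
    χ (tree σ)                 ∎)
    where
    open ≈ₚ-Reasoning

  -- Goals containing apply toW or apply toEdges must not be normalised, as the rational arithmetic in
  -- them blows up; hence let instead of with, and some implicit arguments given explicitly.
  basisPoint-toW : ∀ y → BasisPoint y → Q (apply toW y)
  basisPoint-toW y y∈B =
    let σ , y≈ = basisPoint-ideal y y∈B
    in OrderPolytope-respects (W s t p q) {x = ideal σ} {y = apply toW y} (begin
      ideal σ                              ≈⟨ ≈ₚ-sym (toW∘toEdges (ideal σ)) ⟩
      apply toW (apply toEdges (ideal σ))  ≈⟨ apply-cong toW (≈ₚ-sym y≈) ⟩
      apply toW y                          ∎) (proj₁ (ideal-vertex σ))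
    where
    open ≈ₚ-Reasoning

  P→Q : ∀ x → P x → Q (apply toW x)
  P→Q x x∈P = ConvHull-least {S = Q} (OrderPolytope-respects (W s t p q)) (OrderPolytope-convex (W s t p q))
    (λ _ → id) (apply toW x) (ConvHull-map toW basisPoint-toW x x∈P)

  Q→P : ∀ y → Q y → P (apply toEdges y)
  Q→P y y∈Q = ConvHull-map toEdges vertex-basisPoint y
    (OrderPolytope⊆ConvHull-vertices (W s t p q) y y∈Q)

  AffHull-P⊆image : ∀ x → AffHull P x → Image toEdges x
  AffHull-P⊆image = AffHull-least (Image-respects toEdges) (Image-affinelyClosed toEdges)
    (ConvHull-least (Image-respects toEdges) (Image-convexlyClosed toEdges)
      (λ y y∈B → let σ , y≈ = basisPoint-ideal y y∈B in ideal σ , y≈))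

  toEdges∘toW : ∀ x → AffHull P x → apply toEdges (apply toW x) ≈ₚ x
  toEdges∘toW x x∈aff =
    let z , x≈z′ = AffHull-P⊆image x x∈aff
    in begin
      apply toEdges (apply toW x)                      ≈⟨ apply-cong toEdges (apply-cong toW x≈z′) ⟩
      apply toEdges (apply toW (apply toEdges z))      ≈⟨ apply-cong toEdges (toW∘toEdges z) ⟩
      apply toEdges z                                  ≈⟨ ≈ₚ-sym x≈z′ ⟩
      x                                                ∎
    where
    open ≈ₚ-Reasoning

  private
    isInteger-χ< : ∀ m n → IsInteger (χ< m n)
    isInteger-χ< m n with χ<-zeroOne m n
    ... | inj₁ eq = subst IsInteger (sym eq) isInteger-0
    ... | inj₂ eq = subst IsInteger (sym eq) isInteger-1

    isInteger-coordinate : ∀ mx a → IsInteger (coordinate mx a)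
    isInteger-coordinate nothing  a = isInteger-0
    isInteger-coordinate (just x) a = isInteger-if _

    isInteger-offset : ∀ x → IsInteger (offset x)
    isInteger-offset (eα _) = isInteger-0
    isInteger-offset (eγ _) = isInteger-0
    isInteger-offset (eβ _) = isInteger-1
    isInteger-offset (eδ _) = isInteger-1

    isInteger-rowα : ∀ x n → IsInteger (rowα x n)
    isInteger-rowα μ₁    _ = isInteger-1
    isInteger-rowα μ₂    _ = isInteger-1
    isInteger-rowα μ₃    _ = isInteger-0
    isInteger-rowα (α κ) n = isInteger-χ< (toℕ κ) n
    isInteger-rowα (β _) _ = isInteger-1
    isInteger-rowα (γ _) _ = isInteger-0
    isInteger-rowα (δ _) _ = isInteger-0

    isInteger-rowγ : ∀ x n → IsInteger (rowγ x n)
    isInteger-rowγ μ₁    _ = isInteger-0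
    isInteger-rowγ μ₂    _ = isInteger-0
    isInteger-rowγ μ₃    _ = isInteger-0
    isInteger-rowγ (α _) _ = isInteger-0
    isInteger-rowγ (β _) _ = isInteger-0
    isInteger-rowγ (γ κ) n = isInteger-neg (isInteger-χ< n _)
    isInteger-rowγ (δ _) _ = isInteger-0

    isInteger-rowβ : ∀ x n → IsInteger (rowβ x n)
    isInteger-rowβ μ₁    _ = isInteger-0
    isInteger-rowβ μ₂    _ = isInteger-1
    isInteger-rowβ μ₃    _ = isInteger-0
    isInteger-rowβ (α _) _ = isInteger-0
    isInteger-rowβ (β κ) n = isInteger-χ< n _
    isInteger-rowβ (γ _) _ = isInteger-0
    isInteger-rowβ (δ _) _ = isInteger-0

    isInteger-rowδ : ∀ x n → IsInteger (rowδ x n)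
    isInteger-rowδ μ₁    _ = isInteger-0
    isInteger-rowδ μ₂    _ = isInteger-0
    isInteger-rowδ μ₃    _ = isInteger-neg isInteger-1
    isInteger-rowδ (α _) _ = isInteger-0
    isInteger-rowδ (β _) _ = isInteger-0
    isInteger-rowδ (γ _) _ = isInteger-neg isInteger-1
    isInteger-rowδ (δ κ) n = isInteger-neg (isInteger-χ< (toℕ κ) n)

    isInteger-row : ∀ x e → IsInteger (row x e)
    isInteger-row x (eα i) = isInteger-rowα x (toℕ i)
    isInteger-row x (eγ j) = isInteger-rowγ x (toℕ j)
    isInteger-row x (eβ k) = isInteger-rowβ x (toℕ k)
    isInteger-row x (eδ l) = isInteger-rowδ x (toℕ l)

    isInteger-toW-offset : ∀ x → IsInteger (toW-offset x)
    isInteger-toW-offset x = isInteger-neg (isInteger-+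
      (isInteger-sumFin (suc p) _ (λ k → isInteger-rowβ x (toℕ k)))
      (isInteger-sumFin (suc q) _ (λ l → isInteger-rowδ x (toℕ l))))

  toW-integral : ∀ x → Integral x → Integral (apply toW x)
  toW-integral = apply-integral toW (λ a e → isInteger-row (decodeW s t p q a) (decode e))
                                    (λ a → isInteger-toW-offset (decodeW s t p q a))

  toEdges-integral : ∀ y → Integral y → Integral (apply toEdges y)
  toEdges-integral = apply-integral toEdges
    (λ e a → isInteger-+ (isInteger-coordinate (plus (decode e)) a) (isInteger-neg (isInteger-coordinate (minus (decode e)) a)))
    (λ e → isInteger-offset (decode e))

open import Defs
open import Data.Nat using (ℕ; _<_)
open import Data.Product using (_,_)
open AffineHulls using (AffHull-map; ConvHull-respects)
open Integrality using (Integral-respects)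

lemma4p6 : (s t p q : ℕ) → 0 < s → 0 < q →
    UnimodEquiv (BasePolytope (C s t p q)) (OrderPolytope (W s t p q))
lemma4p6 s t p q _ _ =
  toW , toEdges ,
  AffHull-map toW P→Q , AffHull-map toEdges Q→P ,
  toEdges∘toW , (λ y _ → toW∘toEdges y) ,
  (λ x x∈aff → toW-integral x ,
     λ Fx∈ℤ → Integral-respects {x = apply toEdges (apply toW x)} {y = x} (toEdges∘toW x x∈aff) (toEdges-integral _ Fx∈ℤ)) ,
  (λ x x∈aff → P→Q x ,
     λ Fx∈Q → ConvHull-respects {x = apply toEdges (apply toW x)} {y = x} (toEdges∘toW x x∈aff) (Q→P _ Fx∈Q))
  where
  open AffineMap using (apply)
  open PosetW s t p q
  open UnimodularEquivalence s t p q
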